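{- Fix an integer $d\ge2$, a real-valued toll function $f$ on $d$-ary increasing trees with associated additive functional $F$, and a real number $\mu$. Define the formal power series in $x$ (with coefficients smooth functions of $a,b$) $$Z(x,a,b)=1+\sum_T\frac{x^{|T|}}{|T|!}e^{aF(T)-a\mu|T|-bf(T)},$$ the sum over all $d$-ary increasing trees, and let $Z^{(r)}(x,a,b)$ be the $r$-th partial derivative of $Z$ with respect to $a$. For every integer $r\ge1$, the following identity of formal power series holds: $$\frac{\partial}{\partial x}\Big(Z(x,0,0)^{ -d}Z^{(r)}(x,0,0)\Big)=-Z(x,0,0)^{ -d}H_r(x)+\sum_{s=0}^r\binom{r}{s}(-\mu)^{r-s}s!\sum_{\substack{\ell\in\mathcal{P}(s)\\ \ell_r\ne1}}\frac{d!}{(d-|\ell|)!}\prod_{j\ge1}\frac{1}{\ell_j!\,j!^{\ell_j}}\Big(\frac{Z^{(j)}(x,0,0)}{Z(x,0,0)}\Big)^{\ell_j},$$ where $$H_r(x)=\sum_{s=1}^r\binom{r}{s}\sum_T\frac{x^{|T|-1}}{(|T|-1)!}\big(F(T)-\mu|T|\big)^{r-s}\big(-f(T)\big)^s.$$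
   Context: A $d$-ary increasing tree with $n$ vertices is a rooted tree in which every vertex has $d$ distinguishable slots for children, with vertices labelled $1,\dots,n$ so that labels increase along every path from the root; $|T|$ is its number of vertices. A toll function $f$ assigns a real number to each such tree depending only on the relative order of labels; the additive functional is $F(T)=\sum_{j=1}^kF(B_j)+f(T)$ where $B_1,\dots,B_k$ are the root branches (relabelled order-preservingly). A partition of a nonnegative integer $s$ is represented as a sequence $\ell=(\ell_1,\ell_2,\dots)$ of nonnegative integers with $\sum_j j\ell_j=s$ ($\ell_j$ is the multiplicity of part $j$); $\mathcal{P}(s)$ is the set of partitions of $s$ ($\mathcal{P}(0)$ consists of the empty partition) and $|\ell|=\sum_j\ell_j$. The quantity $\frac{d!}{(d-|\ell|)!}$ denotes the falling factorial $d(d-1)\cdots(d-|\ell|+1)$, which is $0$ when $|\ell|>d$. Since $Z(x,0,0)$ has constant term $1$, its negative powers are well-defined formal power series. -}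

module Defs where

open import Level using (Level)
open import Algebra.Bundles using (CommutativeRing)
open import Data.Nat as ℕ using (ℕ; zero; suc; _<_; _≤?_; _≟_; _!)
open import Data.Nat.Combinatorics using (_C_)
open import Data.Nat.DivMod using (_/_)
open import Data.Nat.ListAction using (sum)
open import Data.List as List using (List; []; _∷_; _++_; length; upTo; filter; concatMap)
open import Data.List.Relation.Unary.Unique.Propositional using (Unique)
open import Data.List.Membership.Propositional using (_∈_)
open import Data.List.Relation.Binary.Permutation.Propositional using (_↭_)
open import Data.Vec as Vec using (Vec; []; _∷_)
open import Data.Product using (_×_)
open import Data.Unit using (⊤)
open import Data.Empty using (⊥)
open import Relation.Nullary.Decidable using (¬?)

-- d-ary labelled trees.  'leaf' is an empty slot; 'node m ts' is a vertex
-- with label m and d (distinguishable) child slots ts.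

data DTree (d : ℕ) : Set where
  leaf : DTree d
  node : ℕ → Vec (DTree d) d → DTree d

module _ {d : ℕ} where

  mutual
    labels : DTree d → List ℕ
    labels leaf        = []
    labels (node m ts) = m ∷ labelsV ts

    labelsV : ∀ {k} → Vec (DTree d) k → List ℕ
    labelsV []       = []
    labelsV (t ∷ ts) = labels t ++ labelsV ts

  size : DTree d → ℕ
  size T = length (labels T)

  mutual
    mapLabels : (ℕ → ℕ) → DTree d → DTree d
    mapLabels g leaf        = leaf
    mapLabels g (node m ts) = node (g m) (mapLabelsV g ts)

    mapLabelsV : ∀ {k} → (ℕ → ℕ) → Vec (DTree d) k → Vec (DTree d) k
    mapLabelsV g []       = []
    mapLabelsV g (t ∷ ts) = mapLabels g t ∷ mapLabelsV g ts

  rank : List ℕ → ℕ → ℕ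
  rank L x = length (filter (λ y → y ≤? x) L)

  -- order-preserving relabelling of a tree to labels 1, …, |T|
  std : DTree d → DTree d
  std T = mapLabels (rank (labels T)) T

  mutual
    Above : ℕ → DTree d → Set
    Above k leaf        = ⊤
    Above k (node m ts) = (k < m) × AboveV m ts

    AboveV : ∀ {j} → ℕ → Vec (DTree d) j → Set
    AboveV m []       = ⊤
    AboveV m (t ∷ ts) = Above m t × AboveV m ts

  Increasing : DTree d → Set
  Increasing leaf        = ⊥
  Increasing (node m ts) = AboveV m ts

  IncTree : ℕ → DTree d → Set
  IncTree n T = Increasing T × (labels T ↭ List.map suc (upTo n))

  IsEnumeration : (ℕ → List (DTree d)) → Set
  IsEnumeration enum =
    (∀ n → Unique (enum n)) ×
    (∀ n T → (T ∈ enum n → IncTree n T) × (IncTree n T → T ∈ enum n))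

-- Partitions of s, as multiplicity lists (ℓ₁, …, ℓ_s)

boundedLists : ℕ → ℕ → List (List ℕ)
boundedLists zero    b = [] ∷ []
boundedLists (suc k) b =
  concatMap (λ x → List.map (x ∷_) (boundedLists k b)) (upTo (suc b))

weightFrom : ℕ → List ℕ → ℕ
weightFrom j []       = 0
weightFrom j (x ∷ xs) = j ℕ.* x ℕ.+ weightFrom (suc j) xs

weight : List ℕ → ℕ
weight = weightFrom 1

partitions : ℕ → List (List ℕ)
partitions s = filter (λ ℓ → weight ℓ ≟ s) (boundedLists s s)

-- ℓ_j (j ≥ 1), zero beyond the end of the list
mult : List ℕ → ℕ → ℕ
mult []       j             = 0
mult (x ∷ xs) zero          = 0
mult (x ∷ xs) (suc zero)    = x
mult (x ∷ xs) (suc (suc j)) = mult xs (suc j)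

card : List ℕ → ℕ
card = sum

-- d!/(d-k)! (falling factorial, 0 if k > d)
falling : ℕ → ℕ → ℕ
falling d zero    = 1
falling d (suc k) = (d ℕ.∸ k) ℕ.* falling d k

denomFrom : ℕ → List ℕ → ℕ
denomFrom j []       = 1
denomFrom j (x ∷ xs) = (x !) ℕ.* ((j !) ℕ.^ x) ℕ.* denomFrom (suc j) xs

-- natural-number division (only applied to exact divisions by nonzero numbers)
divN : ℕ → ℕ → ℕ
divN m zero    = 0
divN m (suc n) = m / suc n

-- Formal power series over a commutative ring, in exponential form:
-- a sequence A : ℕ → R stands for Σ_n A n · xⁿ / n!.

module Series {c ℓ} (R : CommutativeRing c ℓ) where
  open CommutativeRing R

  Ser : Set c
  Ser = ℕ → Carrier

  sumL : List Carrier → Carrier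
  sumL = List.foldr _+_ 0#

  prodL : List Carrier → Carrier
  prodL = List.foldr _*_ 1#

  natR : ℕ → Carrier
  natR zero    = 0#
  natR (suc n) = 1# + natR n

  pow : Carrier → ℕ → Carrier
  pow x zero    = 1#
  pow x (suc n) = x * pow x n

  sumTo : ℕ → (ℕ → Carrier) → Carrier
  sumTo n g = sumL (List.map g (upTo (suc n)))

  one : Ser
  one zero    = 1#
  one (suc n) = 0#

  _⊕_ : Ser → Ser → Ser
  (A ⊕ B) n = A n + B n

  neg : Ser → Ser
  neg A n = - A n

  scale : Carrier → Ser → Ser
  scale c A n = c * A n

  -- product of series (binomial convolution of exponential coefficients)
  _⊛_ : Ser → Ser → Ser
  (A ⊛ B) n = sumTo n (λ k → natR (n C k) * (A k * B (n ℕ.∸ k)))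

  deriv : Ser → Ser
  deriv A n = A (suc n)

  powS : Ser → ℕ → Ser
  powS A zero    = one
  powS A (suc k) = A ⊛ powS A k

  sumS : List Ser → Ser
  sumS = List.foldr _⊕_ (λ _ → 0#)

  prodS : List Ser → Ser
  prodS = List.foldr _⊛_ one

  _≈S_ : Ser → Ser → Set ℓ
  A ≈S B = ∀ n → A n ≈ B n

module Main {c ℓ} (R : CommutativeRing c ℓ) (d : ℕ)
            (f : DTree d → CommutativeRing.Carrier R)
            (μ : CommutativeRing.Carrier R)
            (enum : ℕ → List (DTree d)) where
  open CommutativeRing R
  open Series R

  -- additive functional, computed with fuel (fuel |T| suffices)
  mutual
    Ff : ℕ → DTree d → Carrier
    Ff zero    T           = 0#
    Ff (suc k) leaf        = 0#
    Ff (suc k) (node m ts) = FfV k ts + f (node m ts)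

    FfV : ∀ {j} → ℕ → Vec (DTree d) j → Carrier
    FfV k []       = 0#
    FfV k (t ∷ ts) = Ff k (std t) + FfV k ts

  -- F(T) = Σ_j F(B_j) + f(T)   (empty slots contribute 0)
  F : DTree d → Carrier
  F T = Ff (size T) T

  sumTrees : ℕ → (DTree d → Carrier) → Carrier
  sumTrees n g = sumL (List.map g (enum n))

  -- Z^{(r)}(x,0,0) = [r = 0] + Σ_T x^{|T|}/|T|! (F(T) - μ|T|)^r
  const1 : ℕ → ℕ → Carrier
  const1 zero zero = 1#
  const1 _    _    = 0#

  Zr : ℕ → Ser
  Zr r n = const1 r n + sumTrees n (λ T → pow (F T - natR n * μ) r)

  Z : Ser
  Z = Zr 0

  H : ℕ → Ser
  H r m = sumL (List.map
            (λ s → natR (r C s) *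
                   sumTrees (suc m) (λ T → pow (F T - natR (suc m) * μ) (r ℕ.∸ s)
                                            * pow (- f T) s))
            (List.map suc (upTo r)))

  -- LHS = ∂/∂x ( W · Z^{(r)} ), W = Z(x,0,0)^{-d} = V^d
  LHS : Ser → ℕ → Ser
  LHS V r = deriv (powS V d ⊛ Zr r)

  partTerm : Ser → ℕ → List ℕ → Ser
  partTerm V s ℓs =
    scale (natR (falling d (card ℓs) ℕ.* divN (s !) (denomFrom 1 ℓs)))
          (prodS (List.map (λ j → powS (Zr j ⊛ V) (mult ℓs j))
                           (List.map suc (upTo s))))

  RHS : Ser → ℕ → Ser
  RHS V r =
    neg (powS V d ⊛ H r) ⊕
    sumS (List.map
      (λ s → scale (natR (r C s) * pow (- μ) (r ℕ.∸ s))
               (sumS (List.map (partTerm V s)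
                 (filter (λ ℓs → ¬? (mult ℓs r ≟ 1)) (partitions s)))))
      (upTo (suc r)))

-- Removing the root of an increasing tree T with n + 1 vertices leaves d branches whose label sets
-- split {2, …, n + 1}, and F(T) − μ|T| − f(T) is the sum of F(Bᵢ) − μ|Bᵢ| over the branches minus μ.
-- Expanding ((F(T) − μ|T|) − f(T))ʳ binomially in −f(T) and in −μ therefore gives
--   Z⁽ʳ⁾′ + H_r = Σₛ C(r,s) (−μ)ʳ⁻ˢ [aˢ/s!] Z(x, a, 0)ᵈ,
-- which for r = 0 is Z′ = Zᵈ. Since Z(x, a, 0)/Z = 1 + Σ_{j≥1} (Z⁽ʲ⁾/Z) aʲ/j!, the multinomial
-- expansion of its d-th power is the sum over partitions of s in the statement. Finally
-- (Z⁻ᵈ)′ = −d Z⁻ᵈ⁻¹ Zᵈ = −d/Z, so (Z⁻ᵈ)′ Z⁽ʳ⁾ = −d Z⁽ʳ⁾/Z, which cancels exactly the term of the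
-- partition with ℓ_r = 1.

module Submission where

open import Defs
open import Algebra.Bundles using (CommutativeRing)
open import Data.Nat as ℕ using (ℕ; zero; suc; _∸_; _<_; _≤_; z≤n; s≤s; _≤?_; _≟_; _!)
import Data.Nat.Properties as ℕₚ
open import Data.Nat.Combinatorics using (_C_)
open import Data.List as List using (List; []; _∷_; _++_; length; map; concatMap; filter; upTo)
open import Relation.Binary.PropositionalEquality as ≡ using (_≡_; _≢_)

nC0≡1 : ∀ n → n C 0 ≡ 1
nC0≡1 zero    = ≡.refl
nC0≡1 (suc n) = ≡.refl

module Sums {c ℓ} (R : CommutativeRing c ℓ) where
  open CommutativeRing R
  open Series R
  open import Data.Nat.Combinatorics using (nCk+nC[k+1]≡[n+1]C[k+1]; k>n⇒nCk≡0)
  import Data.List.Properties as Listₚ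
  open import Data.List.Membership.Propositional using (_∈_)
  open import Data.List.Relation.Unary.Any using (here; there)
  import Data.List.Relation.Unary.All as All
  open import Data.List.Relation.Unary.Unique.Propositional using (Unique)
  open import Data.List.Relation.Unary.AllPairs using (_∷_)
  open import Data.List.Relation.Binary.Permutation.Propositional as ↭ using (_↭_)
  open import Data.Bool using (true; false; if_then_else_)
  open import Relation.Nullary using (Dec; does; ¬?)
  open import Algebra.Properties.CommutativeSemigroup +-commutativeSemigroup using (interchange; x∙yz≈y∙xz)
  open import Relation.Binary.Reasoning.Setoid setoid

  opaque
    ∑ : ℕ → (ℕ → Carrier) → Carrier
    ∑ zero    g = 0#
    ∑ (suc n) g = g 0 + ∑ n (λ i → g (suc i))

    ∑-empty : ∀ (g : ℕ → Carrier) → ∑ 0 g ≈ 0#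
    ∑-empty g = refl

    ∑-suc : ∀ n (g : ℕ → Carrier) → ∑ (suc n) g ≈ g 0 + ∑ n (λ i → g (suc i))
    ∑-suc n g = refl

    sumL-upTo : ∀ n (g : ℕ → Carrier) → sumL (map g (upTo n)) ≡ ∑ n g
    sumL-upTo n g = ≡.trans (≡.cong sumL (Listₚ.map-upTo g n)) (applyUpTo n g)
      where
      applyUpTo : ∀ n (g : ℕ → Carrier) → sumL (List.applyUpTo g n) ≡ ∑ n g
      applyUpTo zero    g = ≡.refl
      applyUpTo (suc n) g = ≡.cong (g 0 +_) (applyUpTo n (λ i → g (suc i)))

    ∑-cong< : ∀ n {g h : ℕ → Carrier} → (∀ i → i < n → g i ≈ h i) → ∑ n g ≈ ∑ n h
    ∑-cong< zero    e = refl
    ∑-cong< (suc n) e = +-cong (e 0 (s≤s z≤n)) (∑-cong< n (λ i i<n → e (suc i) (s≤s i<n)))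

    ∑-+ : ∀ n (g h : ℕ → Carrier) → ∑ n (λ i → g i + h i) ≈ ∑ n g + ∑ n h
    ∑-+ zero    g h = sym (+-identityˡ 0#)
    ∑-+ (suc n) g h = trans (+-congˡ (∑-+ n _ _)) (interchange _ _ _ _)

    ∑-distribˡ : ∀ n x (g : ℕ → Carrier) → x * ∑ n g ≈ ∑ n (λ i → x * g i)
    ∑-distribˡ zero    x g = zeroʳ x
    ∑-distribˡ (suc n) x g = trans (distribˡ x _ _) (+-congˡ (∑-distribˡ n x _))

    ∑-last : ∀ n (g : ℕ → Carrier) → ∑ (suc n) g ≈ ∑ n g + g n
    ∑-last zero    g = trans (+-identityʳ _) (sym (+-identityˡ _))
    ∑-last (suc n) g = trans (+-congˡ (∑-last n _)) (sym (+-assoc _ _ _))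

    ∑-split : ∀ m n (g : ℕ → Carrier) → ∑ (m ℕ.+ n) g ≈ ∑ m g + ∑ n (λ i → g (m ℕ.+ i))
    ∑-split zero    n g = sym (+-identityˡ _)
    ∑-split (suc m) n g = trans (+-congˡ (∑-split m n _)) (sym (+-assoc _ _ _))

  ∑-cong : ∀ n {g h : ℕ → Carrier} → (∀ i → g i ≈ h i) → ∑ n g ≈ ∑ n h
  ∑-cong n e = ∑-cong< n (λ i _ → e i)

  sumTo≡∑ : ∀ n (g : ℕ → Carrier) → sumTo n g ≡ ∑ (suc n) g
  sumTo≡∑ n = sumL-upTo (suc n)

  ∑-singleton : ∀ (g : ℕ → Carrier) → ∑ 1 g ≈ g 0
  ∑-singleton g = trans (∑-suc 0 g) (trans (+-congˡ (∑-empty _)) (+-identityʳ _))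

  ∑-vanish< : ∀ n (g : ℕ → Carrier) → (∀ i → i < n → g i ≈ 0#) → ∑ n g ≈ 0#
  ∑-vanish< zero    g z = ∑-empty g
  ∑-vanish< (suc n) g z = begin
    ∑ (suc n) g                        ≈⟨ ∑-suc n g ⟩
    g 0 + ∑ n (λ i → g (suc i))        ≈⟨ +-cong (z 0 (s≤s z≤n)) (∑-vanish< n _ (λ i i<n → z (suc i) (s≤s i<n))) ⟩
    0# + 0#                            ≈⟨ +-identityˡ 0# ⟩
    0#                                 ∎

  ∑-vanish : ∀ n (g : ℕ → Carrier) → (∀ i → g i ≈ 0#) → ∑ n g ≈ 0#
  ∑-vanish n g z = ∑-vanish< n g (λ i _ → z i)

  ∑-comm : ∀ n m (g : ℕ → ℕ → Carrier) →
           ∑ n (λ i → ∑ m (λ j → g i j)) ≈ ∑ m (λ j → ∑ n (λ i → g i j))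
  ∑-comm zero    m g = trans (∑-empty _) (sym (∑-vanish m _ (λ _ → ∑-empty _)))
  ∑-comm (suc n) m g = begin
    ∑ (suc n) (λ i → ∑ m (g i))                                  ≈⟨ ∑-suc n _ ⟩
    ∑ m (g 0) + ∑ n (λ i → ∑ m (g (suc i)))                      ≈⟨ +-congˡ (∑-comm n m _) ⟩
    ∑ m (g 0) + ∑ m (λ j → ∑ n (λ i → g (suc i) j))              ≈⟨ ∑-+ m _ _ ⟨
    ∑ m (λ j → g 0 j + ∑ n (λ i → g (suc i) j))                  ≈⟨ ∑-cong m (λ j → ∑-suc n _) ⟨
    ∑ m (λ j → ∑ (suc n) (λ i → g i j))                          ∎

  ∑-extend : ∀ m n (g : ℕ → Carrier) → m ≤ n → (∀ i → m ≤ i → i < n → g i ≈ 0#) → ∑ n g ≈ ∑ m g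
  ∑-extend m n g m≤n z = begin
    ∑ n g                                    ≡⟨ ≡.cong (λ k → ∑ k g) (ℕₚ.m+[n∸m]≡n m≤n) ⟨
    ∑ (m ℕ.+ (n ∸ m)) g                      ≈⟨ ∑-split m (n ∸ m) g ⟩
    ∑ m g + ∑ (n ∸ m) (λ i → g (m ℕ.+ i))    ≈⟨ +-congˡ (∑-vanish< (n ∸ m) _ tail≈0) ⟩
    ∑ m g + 0#                               ≈⟨ +-identityʳ _ ⟩
    ∑ m g                                    ∎
    where
    tail≈0 : ∀ i → i < n ∸ m → g (m ℕ.+ i) ≈ 0#
    tail≈0 i i< = z (m ℕ.+ i) (ℕₚ.m≤m+n m i)
                    (≡.subst (m ℕ.+ i <_) (ℕₚ.m+[n∸m]≡n m≤n) (ℕₚ.+-monoʳ-< m i<))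

  natR-+ : ∀ m n → natR (m ℕ.+ n) ≈ natR m + natR n
  natR-+ zero    n = sym (+-identityˡ _)
  natR-+ (suc m) n = trans (+-congˡ (natR-+ m n)) (sym (+-assoc _ _ _))

  natR-* : ∀ m n → natR (m ℕ.* n) ≈ natR m * natR n
  natR-* zero    n = sym (zeroˡ _)
  natR-* (suc m) n = begin
    natR (n ℕ.+ m ℕ.* n)            ≈⟨ natR-+ n (m ℕ.* n) ⟩
    natR n + natR (m ℕ.* n)         ≈⟨ +-cong (sym (*-identityˡ _)) (natR-* m n) ⟩
    1# * natR n + natR m * natR n   ≈⟨ distribʳ _ _ _ ⟨
    (1# + natR m) * natR n          ∎

  natR-1 : natR 1 ≈ 1#
  natR-1 = +-identityʳ 1#

  natR-C0 : ∀ n → natR (n C 0) ≈ 1#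
  natR-C0 n = trans (reflexive (≡.cong natR (nC0≡1 n))) natR-1

  ∑-pascal : ∀ n (φ : ℕ → ℕ → Carrier) →
    ∑ (suc (suc n)) (λ k → natR (suc n C k) * φ k (suc n ∸ k)) ≈
    ∑ (suc n) (λ k → natR (n C k) * φ (suc k) (n ∸ k)) +
    ∑ (suc n) (λ k → natR (n C k) * φ k (suc n ∸ k))
  ∑-pascal n φ = begin
    ∑ (suc (suc n)) (λ k → natR (suc n C k) * φ k (suc n ∸ k))
      ≈⟨ ∑-suc (suc n) _ ⟩
    natR (suc n C 0) * φ 0 (suc n) + ∑ (suc n) (λ k → natR (suc n C suc k) * φ (suc k) (n ∸ k))
      ≈⟨ +-congˡ (∑-cong (suc n) split) ⟩
    natR (suc n C 0) * φ 0 (suc n) + ∑ (suc n) (λ k → A k + B k)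
      ≈⟨ +-congˡ (∑-+ (suc n) A B) ⟩
    natR (suc n C 0) * φ 0 (suc n) + (∑ (suc n) A + ∑ (suc n) B)
      ≈⟨ +-congˡ (+-congˡ (trans (∑-last n B) (trans (+-congˡ Bn≈0) (+-identityʳ _)))) ⟩
    natR (suc n C 0) * φ 0 (suc n) + (∑ (suc n) A + ∑ n B)
      ≈⟨ x∙yz≈y∙xz _ _ _ ⟩
    ∑ (suc n) A + (natR (suc n C 0) * φ 0 (suc n) + ∑ n B)
      ≈⟨ +-congˡ (+-congʳ (*-congʳ (trans (natR-C0 (suc n)) (sym (natR-C0 n))))) ⟩
    ∑ (suc n) A + (natR (n C 0) * φ 0 (suc n) + ∑ n B)
      ≈⟨ +-congˡ (∑-suc n _) ⟨
    ∑ (suc n) A + ∑ (suc n) (λ k → natR (n C k) * φ k (suc n ∸ k))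
      ∎
    where
    A B : ℕ → Carrier
    A k = natR (n C k) * φ (suc k) (n ∸ k)
    B k = natR (n C suc k) * φ (suc k) (n ∸ k)
    split : ∀ k → natR (suc n C suc k) * φ (suc k) (n ∸ k) ≈ A k + B k
    split k = trans (*-congʳ (trans (reflexive (≡.cong natR (≡.sym (nCk+nC[k+1]≡[n+1]C[k+1] n k))))
                                    (natR-+ (n C k) (n C suc k))))
                    (distribʳ _ _ _)
    Bn≈0 : B n ≈ 0#
    Bn≈0 = trans (*-congʳ (reflexive (≡.cong natR (k>n⇒nCk≡0 (ℕₚ.n<1+n n))))) (zeroˡ _)

  module _ {a} {X : Set a} where

    sumL-++ : ∀ (g : X → Carrier) xs ys → sumL (map g (xs ++ ys)) ≈ sumL (map g xs) + sumL (map g ys)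
    sumL-++ g []       ys = sym (+-identityˡ _)
    sumL-++ g (x ∷ xs) ys = trans (+-congˡ (sumL-++ g xs ys)) (sym (+-assoc _ _ _))

    sumL-cong∈ : ∀ {g h : X → Carrier} xs → (∀ {x} → x ∈ xs → g x ≈ h x) → sumL (map g xs) ≈ sumL (map h xs)
    sumL-cong∈ []       e = refl
    sumL-cong∈ (x ∷ xs) e = +-cong (e (here ≡.refl)) (sumL-cong∈ xs (λ m → e (there m)))

    sumL-cong : ∀ {g h : X → Carrier} xs → (∀ x → g x ≈ h x) → sumL (map g xs) ≈ sumL (map h xs)
    sumL-cong xs e = sumL-cong∈ xs (λ {x} _ → e x)

    sumL-↭ : ∀ (g : X → Carrier) {xs ys} → xs ↭ ys → sumL (map g xs) ≈ sumL (map g ys)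
    sumL-↭ g ↭.refl         = refl
    sumL-↭ g (↭.prep x p)   = +-congˡ (sumL-↭ g p)
    sumL-↭ g (↭.swap x y p) = begin
      g x + (g y + _)  ≈⟨ +-assoc _ _ _ ⟨
      (g x + g y) + _  ≈⟨ +-cong (+-comm _ _) (sumL-↭ g p) ⟩
      (g y + g x) + _  ≈⟨ +-assoc _ _ _ ⟩
      g y + (g x + _)  ∎
    sumL-↭ g (↭.trans p q)  = trans (sumL-↭ g p) (sumL-↭ g q)

    sumL-distribˡ : ∀ x (g : X → Carrier) xs → x * sumL (map g xs) ≈ sumL (map (λ y → x * g y) xs)
    sumL-distribˡ x g []       = zeroʳ x
    sumL-distribˡ x g (y ∷ xs) = trans (distribˡ x _ _) (+-congˡ (sumL-distribˡ x g xs))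

    sumL-distribʳ : ∀ x (g : X → Carrier) xs → sumL (map g xs) * x ≈ sumL (map (λ y → g y * x) xs)
    sumL-distribʳ x g xs = trans (*-comm _ x) (trans (sumL-distribˡ x g xs) (sumL-cong xs (λ y → *-comm x (g y))))

    sumL-vanish : ∀ (g : X → Carrier) xs → (∀ {x} → x ∈ xs → g x ≈ 0#) → sumL (map g xs) ≈ 0#
    sumL-vanish g []       z = refl
    sumL-vanish g (x ∷ xs) z = trans (+-cong (z (here ≡.refl)) (sumL-vanish g xs (λ m → z (there m)))) (+-identityˡ 0#)

    sumL-∑-comm : ∀ (L : List X) m (g : X → ℕ → Carrier) →
      sumL (map (λ T → ∑ m (g T)) L) ≈ ∑ m (λ s → sumL (map (λ T → g T s) L))
    sumL-∑-comm []      m g = sym (∑-vanish m _ (λ _ → refl))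
    sumL-∑-comm (T ∷ L) m g = trans (+-congˡ (sumL-∑-comm L m g)) (sym (∑-+ m _ _))

    sumL-filter : ∀ {p} {Q : X → Set p} (Q? : ∀ x → Dec (Q x)) (g : X → Carrier) xs →
      sumL (map g (filter Q? xs)) ≈ sumL (map (λ x → if does (Q? x) then g x else 0#) xs)
    sumL-filter Q? g []       = refl
    sumL-filter Q? g (x ∷ xs) with does (Q? x)
    ... | true  = +-congˡ (sumL-filter Q? g xs)
    ... | false = trans (sumL-filter Q? g xs) (sym (+-identityˡ _))

    sumL-partition : ∀ {p} {Q : X → Set p} (Q? : ∀ x → Dec (Q x)) (g : X → Carrier) xs →
      sumL (map g xs) ≈ sumL (map g (filter (λ x → ¬? (Q? x)) xs)) + sumL (map g (filter Q? xs))
    sumL-partition Q? g []       = sym (+-identityˡ 0#)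
    sumL-partition Q? g (x ∷ xs) with does (Q? x)
    ... | true  = trans (+-congˡ (sumL-partition Q? g xs)) (x∙yz≈y∙xz _ _ _)
    ... | false = trans (+-congˡ (sumL-partition Q? g xs)) (sym (+-assoc _ _ _))

    sumL-single : ∀ (g : X → Carrier) {xs p} → Unique xs → p ∈ xs →
                  (∀ {x} → x ∈ xs → x ≢ p → g x ≈ 0#) → sumL (map g xs) ≈ g p
    sumL-single g {x ∷ xs} (x∉xs ∷ u) (here ≡.refl) z =
      trans (+-congˡ (sumL-vanish g xs (λ m → z (there m) (λ e → All.lookup x∉xs m (≡.sym e))))) (+-identityʳ _)
    sumL-single g {x ∷ xs} (x∉xs ∷ u) (there m) z =
      trans (+-cong (z (here ≡.refl) (λ e → All.lookup x∉xs m e)) (sumL-single g u m (λ m' → z (there m')))) (+-identityˡ _)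

  module _ {a b} {X : Set a} {Y : Set b} where

    sumL-map : ∀ (g : Y → Carrier) (h : X → Y) xs → sumL (map g (map h xs)) ≡ sumL (map (λ x → g (h x)) xs)
    sumL-map g h xs = ≡.cong sumL (≡.sym (Listₚ.map-∘ xs))

    sumL-concatMap : ∀ (g : Y → Carrier) (G : X → List Y) xs →
      sumL (map g (concatMap G xs)) ≈ sumL (map (λ x → sumL (map g (G x))) xs)
    sumL-concatMap g G []       = refl
    sumL-concatMap g G (x ∷ xs) = trans (sumL-++ g (G x) (concatMap G xs)) (+-congˡ (sumL-concatMap g G xs))

module SeriesRing {c ℓ} (R : CommutativeRing c ℓ) where
  open CommutativeRing R
  open Series R
  open Sums R
  open import Data.Product using (_,_)
  open import Algebra.Properties.CommutativeSemigroup *-commutativeSemigroup using (x∙yz≈y∙xz)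
  open import Relation.Binary.Reasoning.Setoid setoid

  zeroS : Ser
  zeroS _ = 0#

  ⊛-coeff : ∀ A B n → (A ⊛ B) n ≈ ∑ (suc n) (λ k → natR (n C k) * (A k * B (n ∸ k)))
  ⊛-coeff A B n = reflexive (sumTo≡∑ n _)

  ⊛-coeff₀ : ∀ A B → (A ⊛ B) 0 ≈ A 0 * B 0
  ⊛-coeff₀ A B = trans (⊛-coeff A B 0) (trans (∑-singleton _) (trans (*-congʳ natR-1) (*-identityˡ _)))

  ⊛-cong : ∀ {A A' B B'} → A ≈S A' → B ≈S B' → (A ⊛ B) ≈S (A' ⊛ B')
  ⊛-cong {A} {A'} {B} {B'} e e' n = begin
    (A ⊛ B) n                                                ≈⟨ ⊛-coeff A B n ⟩
    ∑ (suc n) (λ k → natR (n C k) * (A k * B (n ∸ k)))        ≈⟨ ∑-cong (suc n) (λ k → *-congˡ (*-cong (e k) (e' (n ∸ k)))) ⟩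
    ∑ (suc n) (λ k → natR (n C k) * (A' k * B' (n ∸ k)))      ≈⟨ ⊛-coeff A' B' n ⟨
    (A' ⊛ B') n                                              ∎

  -- On exponential coefficients this is Pascal's rule.
  leibniz : ∀ A B → deriv (A ⊛ B) ≈S ((deriv A ⊛ B) ⊕ (A ⊛ deriv B))
  leibniz A B n = begin
    (A ⊛ B) (suc n)
      ≈⟨ ⊛-coeff A B (suc n) ⟩
    ∑ (suc (suc n)) (λ k → natR (suc n C k) * (A k * B (suc n ∸ k)))
      ≈⟨ ∑-pascal n (λ k m → A k * B m) ⟩
    ∑ (suc n) (λ k → natR (n C k) * (A (suc k) * B (n ∸ k))) +
    ∑ (suc n) (λ k → natR (n C k) * (A k * B (suc n ∸ k)))
      ≈⟨ +-cong (sym (⊛-coeff (deriv A) B n))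
                (trans (∑-cong< (suc n) (λ k k< → *-congˡ (*-congˡ (reflexive (≡.cong B (ℕₚ.+-∸-assoc 1 (ℕₚ.≤-pred k<)))))))
                       (sym (⊛-coeff A (deriv B) n))) ⟩
    (deriv A ⊛ B) n + (A ⊛ deriv B) n
      ∎

  ⊛-zeroˡ : ∀ A → (zeroS ⊛ A) ≈S zeroS
  ⊛-zeroˡ A n = trans (⊛-coeff zeroS A n) (∑-vanish (suc n) _ (λ k → trans (*-congˡ (zeroˡ _)) (zeroʳ _)))

  ⊛-distribˡ : ∀ A B D → (A ⊛ (B ⊕ D)) ≈S ((A ⊛ B) ⊕ (A ⊛ D))
  ⊛-distribˡ A B D n = begin
    (A ⊛ (B ⊕ D)) n
      ≈⟨ ⊛-coeff A (B ⊕ D) n ⟩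
    ∑ (suc n) (λ k → natR (n C k) * (A k * (B (n ∸ k) + D (n ∸ k))))
      ≈⟨ ∑-cong (suc n) (λ k → trans (*-congˡ (distribˡ _ _ _)) (distribˡ _ _ _)) ⟩
    ∑ (suc n) (λ k → natR (n C k) * (A k * B (n ∸ k)) + natR (n C k) * (A k * D (n ∸ k)))
      ≈⟨ ∑-+ (suc n) _ _ ⟩
    _ ≈⟨ +-cong (sym (⊛-coeff A B n)) (sym (⊛-coeff A D n)) ⟩
    (A ⊛ B) n + (A ⊛ D) n
      ∎

  ⊛-comm : ∀ A B → (A ⊛ B) ≈S (B ⊛ A)
  ⊛-comm A B zero    = trans (⊛-coeff₀ A B) (trans (*-comm _ _) (sym (⊛-coeff₀ B A)))
  ⊛-comm A B (suc n) = begin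
    (A ⊛ B) (suc n)                      ≈⟨ leibniz A B n ⟩
    (deriv A ⊛ B) n + (A ⊛ deriv B) n    ≈⟨ +-cong (⊛-comm (deriv A) B n) (⊛-comm A (deriv B) n) ⟩
    (B ⊛ deriv A) n + (deriv B ⊛ A) n    ≈⟨ +-comm _ _ ⟩
    (deriv B ⊛ A) n + (B ⊛ deriv A) n    ≈⟨ leibniz B A n ⟨
    (B ⊛ A) (suc n)                      ∎

  ⊛-distribʳ : ∀ A B D → ((B ⊕ D) ⊛ A) ≈S ((B ⊛ A) ⊕ (D ⊛ A))
  ⊛-distribʳ A B D n =
    trans (⊛-comm (B ⊕ D) A n) (trans (⊛-distribˡ A B D n) (+-cong (⊛-comm A B n) (⊛-comm A D n)))

  ⊛-identityˡ : ∀ A → (one ⊛ A) ≈S A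
  ⊛-identityˡ A zero    = trans (⊛-coeff₀ one A) (*-identityˡ _)
  ⊛-identityˡ A (suc n) = begin
    (one ⊛ A) (suc n)                        ≈⟨ leibniz one A n ⟩
    (deriv one ⊛ A) n + (one ⊛ deriv A) n    ≈⟨ +-cong (⊛-zeroˡ A n) (⊛-identityˡ (deriv A) n) ⟩
    0# + A (suc n)                           ≈⟨ +-identityˡ _ ⟩
    A (suc n)                                ∎

  ⊛-assoc : ∀ A B D → ((A ⊛ B) ⊛ D) ≈S (A ⊛ (B ⊛ D))
  ⊛-assoc A B D zero = begin
    ((A ⊛ B) ⊛ D) 0       ≈⟨ ⊛-coeff₀ (A ⊛ B) D ⟩
    (A ⊛ B) 0 * D 0       ≈⟨ *-congʳ (⊛-coeff₀ A B) ⟩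
    A 0 * B 0 * D 0       ≈⟨ *-assoc _ _ _ ⟩
    A 0 * (B 0 * D 0)     ≈⟨ *-congˡ (⊛-coeff₀ B D) ⟨
    A 0 * (B ⊛ D) 0       ≈⟨ ⊛-coeff₀ A (B ⊛ D) ⟨
    (A ⊛ (B ⊛ D)) 0       ∎
  ⊛-assoc A B D (suc n) = begin
    ((A ⊛ B) ⊛ D) (suc n)
      ≈⟨ leibniz (A ⊛ B) D n ⟩
    (deriv (A ⊛ B) ⊛ D) n + ((A ⊛ B) ⊛ deriv D) n
      ≈⟨ +-congʳ (trans (⊛-cong {B = D} {D} (leibniz A B) (λ _ → refl) n) (⊛-distribʳ D (deriv A ⊛ B) (A ⊛ deriv B) n)) ⟩
    (((deriv A ⊛ B) ⊛ D) n + ((A ⊛ deriv B) ⊛ D) n) + ((A ⊛ B) ⊛ deriv D) n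
      ≈⟨ +-cong (+-cong (⊛-assoc (deriv A) B D n) (⊛-assoc A (deriv B) D n)) (⊛-assoc A B (deriv D) n) ⟩
    ((deriv A ⊛ (B ⊛ D)) n + (A ⊛ (deriv B ⊛ D)) n) + (A ⊛ (B ⊛ deriv D)) n
      ≈⟨ +-assoc _ _ _ ⟩
    (deriv A ⊛ (B ⊛ D)) n + ((A ⊛ (deriv B ⊛ D)) n + (A ⊛ (B ⊛ deriv D)) n)
      ≈⟨ +-congˡ (trans (⊛-cong {A} (λ _ → refl) (leibniz B D) n) (⊛-distribˡ A (deriv B ⊛ D) (B ⊛ deriv D) n)) ⟨
    (deriv A ⊛ (B ⊛ D)) n + (A ⊛ deriv (B ⊛ D)) n
      ≈⟨ leibniz A (B ⊛ D) n ⟨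
    (A ⊛ (B ⊛ D)) (suc n)
      ∎

  seriesRing : CommutativeRing c ℓ
  seriesRing = record
    { Carrier = Ser
    ; _≈_ = _≈S_
    ; _+_ = _⊕_
    ; _*_ = _⊛_
    ; -_ = neg
    ; 0# = zeroS
    ; 1# = one
    ; isCommutativeRing = record
      { isRing = record
        { +-isAbelianGroup = record
          { isGroup = record
            { isMonoid = record
              { isSemigroup = record
                { isMagma = record
                  { isEquivalence = record
                    { refl = λ _ → refl ; sym = λ e n → sym (e n) ; trans = λ e e' n → trans (e n) (e' n) }
                  ; ∙-cong = λ e e' n → +-cong (e n) (e' n) }
                ; assoc = λ _ _ _ n → +-assoc _ _ _ }
              ; identity = (λ _ n → +-identityˡ _) , (λ _ n → +-identityʳ _) }
            ; inverse = (λ _ n → -‿inverseˡ _) , (λ _ n → -‿inverseʳ _)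
            ; ⁻¹-cong = λ e n → -‿cong (e n) }
          ; comm = λ _ _ n → +-comm _ _ }
        ; *-cong = ⊛-cong
        ; *-assoc = ⊛-assoc
        ; *-identity = ⊛-identityˡ , (λ A n → trans (⊛-comm A one n) (⊛-identityˡ A n))
        ; distrib = (λ A B D → ⊛-distribˡ A B D) , (λ A B D → ⊛-distribʳ A B D) }
      ; *-comm = ⊛-comm }
    }

  scale-⊛ˡ : ∀ x A B → (scale x A ⊛ B) ≈S scale x (A ⊛ B)
  scale-⊛ˡ x A B n = begin
    (scale x A ⊛ B) n                                         ≈⟨ ⊛-coeff (scale x A) B n ⟩
    ∑ (suc n) (λ k → natR (n C k) * (x * A k * B (n ∸ k)))    ≈⟨ ∑-cong (suc n) (λ k → trans (*-congˡ (*-assoc _ _ _)) (x∙yz≈y∙xz _ _ _)) ⟩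
    ∑ (suc n) (λ k → x * (natR (n C k) * (A k * B (n ∸ k))))  ≈⟨ ∑-distribˡ (suc n) x _ ⟨
    x * ∑ (suc n) (λ k → natR (n C k) * (A k * B (n ∸ k)))    ≈⟨ *-congˡ (⊛-coeff A B n) ⟨
    x * (A ⊛ B) n                                             ∎

  scale-⊛ʳ : ∀ x A B → (A ⊛ scale x B) ≈S scale x (A ⊛ B)
  scale-⊛ʳ x A B n = trans (⊛-comm A (scale x B) n) (trans (scale-⊛ˡ x B A n) (*-congˡ (⊛-comm B A n)))

  scale-cong : ∀ x {A B} → A ≈S B → scale x A ≈S scale x B
  scale-cong x e n = *-congˡ (e n)

  pow-cong : ∀ k {a b} → a ≈ b → pow a k ≈ pow b k
  pow-cong zero    e = refl
  pow-cong (suc k) e = *-cong e (pow-cong k e)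

  -- exp y = e^{yx}
  exp : Carrier → Ser
  exp y n = pow y n

  exp-0 : exp 0# ≈S one
  exp-0 zero    = refl
  exp-0 (suc n) = zeroˡ _

  exp-+ : ∀ y z → (exp y ⊛ exp z) ≈S exp (y + z)
  exp-+ y z zero    = trans (⊛-coeff₀ (exp y) (exp z)) (*-identityˡ 1#)
  exp-+ y z (suc n) = begin
    (exp y ⊛ exp z) (suc n)                                       ≈⟨ leibniz (exp y) (exp z) n ⟩
    (scale y (exp y) ⊛ exp z) n + (exp y ⊛ scale z (exp z)) n     ≈⟨ +-cong (scale-⊛ˡ y (exp y) (exp z) n) (scale-⊛ʳ z (exp y) (exp z) n) ⟩
    y * (exp y ⊛ exp z) n + z * (exp y ⊛ exp z) n                 ≈⟨ distribʳ _ y z ⟨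
    (y + z) * (exp y ⊛ exp z) n                                   ≈⟨ *-congˡ (exp-+ y z n) ⟩
    (y + z) * pow (y + z) n                                       ∎

  binomial : ∀ y z n → pow (y + z) n ≈ ∑ (suc n) (λ k → natR (n C k) * (pow y k * pow z (n ∸ k)))
  binomial y z n = trans (sym (exp-+ y z n)) (⊛-coeff (exp y) (exp z) n)

  powS-cong : ∀ {A B} → A ≈S B → ∀ k → powS A k ≈S powS B k
  powS-cong e zero    = λ _ → refl
  powS-cong e (suc k) = ⊛-cong e (powS-cong e k)

  powS-one : ∀ k → powS one k ≈S one
  powS-one zero    = λ _ → refl
  powS-one (suc k) i = trans (⊛-identityˡ (powS one k) i) (powS-one k i)

  powS-cong≤ : ∀ s {A B : Ser} → (∀ i → i ≤ s → A i ≈ B i) → ∀ k i → i ≤ s → powS A k i ≈ powS B k i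
  powS-cong≤ s e zero    i i≤s = refl
  powS-cong≤ s {A} {B} e (suc k) i i≤s = begin
    (A ⊛ powS A k) i                                                ≈⟨ ⊛-coeff A (powS A k) i ⟩
    ∑ (suc i) (λ j → natR (i C j) * (A j * powS A k (i ∸ j)))        ≈⟨ ∑-cong< (suc i) termwise ⟩
    ∑ (suc i) (λ j → natR (i C j) * (B j * powS B k (i ∸ j)))        ≈⟨ ⊛-coeff B (powS B k) i ⟨
    (B ⊛ powS B k) i                                                ∎
    where
    termwise : ∀ j → j < suc i → natR (i C j) * (A j * powS A k (i ∸ j)) ≈ natR (i C j) * (B j * powS B k (i ∸ j))
    termwise j j< = *-congˡ (*-cong (e j (ℕₚ.≤-trans (ℕₚ.≤-pred j<) i≤s))
                                    (powS-cong≤ s e k (i ∸ j) (ℕₚ.≤-trans (ℕₚ.m∸n≤m i j) i≤s)))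

-- Series whose coefficients are series: A n s is the coefficient of xⁿ/n! yˢ/s!.
module Bivariate {c ℓ} (R : CommutativeRing c ℓ) where
  open CommutativeRing R
  open Series R
  open Sums R
  open SeriesRing R
  module S₂ = Series seriesRing
  module R₂ = SeriesRing seriesRing
  module Σ₂ = Sums seriesRing
  open import Algebra.Properties.CommutativeSemigroup *-commutativeSemigroup using (x∙yz≈y∙xz)
  open import Relation.Binary.Reasoning.Setoid setoid

  sumL₂-coeff : ∀ (L : List Ser) s → S₂.sumL L s ≡ sumL (map (λ X → X s) L)
  sumL₂-coeff []      s = ≡.refl
  sumL₂-coeff (X ∷ L) s = ≡.cong (X s +_) (sumL₂-coeff L s)

  ∑₂-coeff : ∀ m (g : ℕ → Ser) s → Σ₂.∑ m g s ≈ ∑ m (λ k → g k s)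
  ∑₂-coeff zero    g s = trans (Σ₂.∑-empty g s) (sym (∑-empty _))
  ∑₂-coeff (suc m) g s = trans (Σ₂.∑-suc m g s) (trans (+-congˡ (∑₂-coeff m (λ k → g (suc k)) s)) (sym (∑-suc m _)))

  natR₂-⊛ : ∀ m X → (S₂.natR m ⊛ X) ≈S scale (natR m) X
  natR₂-⊛ m X n = trans (⊛-cong {B = X} {X} (natR₂≈scale m) (λ _ → refl) n) (trans (scale-⊛ˡ (natR m) one X n) (*-congˡ (⊛-identityˡ X n)))
    where
    natR₂≈scale : ∀ m → S₂.natR m ≈S scale (natR m) one
    natR₂≈scale zero    n = sym (zeroˡ _)
    natR₂≈scale (suc m) n = trans (+-congˡ (natR₂≈scale m n)) (trans (+-congʳ (sym (*-identityˡ _))) (sym (distribʳ _ _ _)))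

  ⊛₂-coeff : ∀ (A B : S₂.Ser) n s → (A S₂.⊛ B) n s ≈ ∑ (suc n) (λ k → natR (n C k) * (A k ⊛ B (n ∸ k)) s)
  ⊛₂-coeff A B n s = begin
    (A S₂.⊛ B) n s                                              ≡⟨ ≡.cong (λ X → X s) (Σ₂.sumTo≡∑ n _) ⟩
    Σ₂.∑ (suc n) (λ k → S₂.natR (n C k) ⊛ (A k ⊛ B (n ∸ k))) s   ≈⟨ ∑₂-coeff (suc n) _ s ⟩
    ∑ (suc n) (λ k → (S₂.natR (n C k) ⊛ (A k ⊛ B (n ∸ k))) s)    ≈⟨ ∑-cong (suc n) (λ k → natR₂-⊛ (n C k) (A k ⊛ B (n ∸ k)) s) ⟩
    ∑ (suc n) (λ k → natR (n C k) * (A k ⊛ B (n ∸ k)) s)         ∎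

  swap : S₂.Ser → S₂.Ser
  swap A s n = A n s

  swap-⊛ : ∀ (A B : S₂.Ser) n s → (A S₂.⊛ B) n s ≈ (swap A S₂.⊛ swap B) s n
  swap-⊛ A B n s = begin
    (A S₂.⊛ B) n s
      ≈⟨ ⊛₂-coeff A B n s ⟩
    ∑ (suc n) (λ k → natR (n C k) * (A k ⊛ B (n ∸ k)) s)
      ≈⟨ ∑-cong (suc n) (λ k → trans (*-congˡ (⊛-coeff (A k) (B (n ∸ k)) s)) (∑-distribˡ (suc s) _ _)) ⟩
    ∑ (suc n) (λ k → ∑ (suc s) (λ t → natR (n C k) * (natR (s C t) * (A k t * B (n ∸ k) (s ∸ t)))))
      ≈⟨ ∑-comm (suc n) (suc s) _ ⟩
    ∑ (suc s) (λ t → ∑ (suc n) (λ k → natR (n C k) * (natR (s C t) * (A k t * B (n ∸ k) (s ∸ t)))))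
      ≈⟨ ∑-cong (suc s) (λ t → ∑-cong (suc n) (λ k → x∙yz≈y∙xz _ _ _)) ⟩
    ∑ (suc s) (λ t → ∑ (suc n) (λ k → natR (s C t) * (natR (n C k) * (A k t * B (n ∸ k) (s ∸ t)))))
      ≈⟨ ∑-cong (suc s) (λ t → trans (sym (∑-distribˡ (suc n) _ _)) (*-congˡ (sym (⊛-coeff (swap A t) (swap B (s ∸ t)) n)))) ⟩
    ∑ (suc s) (λ t → natR (s C t) * (swap A t ⊛ swap B (s ∸ t)) n)
      ≈⟨ ⊛₂-coeff (swap A) (swap B) s n ⟨
    (swap A S₂.⊛ swap B) s n
      ∎

  swap-powS : ∀ (A : S₂.Ser) k n s → S₂.powS A k n s ≈ S₂.powS (swap A) k s n
  swap-powS A zero    zero    zero    = refl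
  swap-powS A zero    zero    (suc s) = refl
  swap-powS A zero    (suc n) zero    = refl
  swap-powS A zero    (suc n) (suc s) = refl
  swap-powS A (suc k) n s =
    trans (swap-⊛ A (S₂.powS A k) n s) (R₂.⊛-cong {swap A} (λ _ _ → refl) (λ s' n' → swap-powS A k n' s') s n)

  powS₂-coeff₀ : ∀ (A : S₂.Ser) k → S₂.powS A k 0 ≈S powS (A 0) k
  powS₂-coeff₀ A zero    = λ _ → refl
  powS₂-coeff₀ A (suc k) = λ n → trans (R₂.⊛-coeff₀ A (S₂.powS A k) n) (⊛-cong {A 0} (λ _ → refl) (powS₂-coeff₀ A k) n)

  powS₂-scale : ∀ (A : S₂.Ser) U k s → S₂.powS (λ t → A t ⊛ U) k s ≈S (powS U k ⊛ S₂.powS A k s)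
  powS₂-scale A U zero    s n = sym (⊛-identityˡ (S₂.one s) n)
  powS₂-scale A U (suc k) s n = begin
    ((λ t → A t ⊛ U) S₂.⊛ S₂.powS (λ t → A t ⊛ U) k) s n
      ≈⟨ R₂.⊛-cong {B = S₂.powS (λ t → A t ⊛ U) k} (λ t → ⊛-comm (A t) U) (powS₂-scale A U k) s n ⟩
    (S₂.scale U A S₂.⊛ S₂.scale (powS U k) (S₂.powS A k)) s n
      ≈⟨ R₂.scale-⊛ˡ U A (S₂.scale (powS U k) (S₂.powS A k)) s n ⟩
    (U ⊛ (A S₂.⊛ S₂.scale (powS U k) (S₂.powS A k)) s) n
      ≈⟨ ⊛-cong {U} (λ _ → refl) (R₂.scale-⊛ʳ (powS U k) A (S₂.powS A k) s) n ⟩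
    (U ⊛ (powS U k ⊛ (A S₂.⊛ S₂.powS A k) s)) n
      ≈⟨ ⊛-assoc U (powS U k) ((A S₂.⊛ S₂.powS A k) s) n ⟨
    ((U ⊛ powS U k) ⊛ (A S₂.⊛ S₂.powS A k) s) n
      ∎

  pow₂≈powS : ∀ A k → S₂.pow A k ≈S powS A k
  pow₂≈powS A zero    = λ _ → refl
  pow₂≈powS A (suc k) = ⊛-cong {A} (λ _ → refl) (pow₂≈powS A k)

  powS-binomial : ∀ (A B : Ser) k s →
    powS (A ⊕ B) k s ≈ ∑ (suc k) (λ j → natR (k C j) * (powS A j ⊛ powS B (k ∸ j)) s)
  powS-binomial A B k s = begin
    powS (A ⊕ B) k s
      ≈⟨ pow₂≈powS (A ⊕ B) k s ⟨
    S₂.pow (A ⊕ B) k s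
      ≈⟨ R₂.binomial A B k s ⟩
    Σ₂.∑ (suc k) (λ j → S₂.natR (k C j) ⊛ (S₂.pow A j ⊛ S₂.pow B (k ∸ j))) s
      ≈⟨ ∑₂-coeff (suc k) _ s ⟩
    ∑ (suc k) (λ j → (S₂.natR (k C j) ⊛ (S₂.pow A j ⊛ S₂.pow B (k ∸ j))) s)
      ≈⟨ ∑-cong (suc k) (λ j → trans (natR₂-⊛ (k C j) (S₂.pow A j ⊛ S₂.pow B (k ∸ j)) s)
                                      (*-congˡ (⊛-cong (pow₂≈powS A j) (pow₂≈powS B (k ∸ j)) s))) ⟩
    ∑ (suc k) (λ j → natR (k C j) * (powS A j ⊛ powS B (k ∸ j)) s)
      ∎

module ListCombinatorics where
  open import Level using (Level)
  import Data.List.Properties as Listₚ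
  open import Data.List.Membership.Propositional using (_∈_; _∉_; find)
  open import Data.List.Membership.Propositional.Properties
    using (∈-++⁺ˡ; ∈-++⁺ʳ; ∈-++⁻; ∈-map⁺; ∈-map⁻; ∈-concatMap⁺; ∈-concatMap⁻; ∈-filter⁺; ∈-filter⁻)
  open import Data.List.Membership.Propositional.Properties.WithK using (unique∧set⇒bag)
  open import Data.List.Membership.DecPropositional ℕₚ._≟_ using (_∈?_; _∉?_)
  open import Data.List.Relation.Unary.Any as Any using (here; there)
  open import Data.List.Relation.Unary.All as All using ([])
  import Data.List.Relation.Unary.All.Properties as Allₚ
  open import Data.List.Relation.Unary.AllPairs as AllPairs using (AllPairs; []; _∷_)
  open import Data.List.Relation.Unary.Unique.Propositional using (Unique)
  import Data.List.Relation.Unary.Unique.Propositional.Properties as Uniqueₚ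
  open import Data.List.Relation.Binary.Sublist.Propositional using (_⊆_; []; _∷_; _∷ʳ_; ⊆-trans; lookup)
  import Data.List.Relation.Binary.Sublist.Propositional.Properties as ⊆ₚ
  open import Data.List.Relation.Binary.Permutation.Propositional as ↭ using (_↭_; ↭-sym; ↭⇒↭ₛ)
  import Data.List.Relation.Binary.Permutation.Propositional.Properties as ↭ₚ
  import Data.List.Relation.Binary.Permutation.Setoid.Properties as ↭ₛₚ
  open import Data.List.Relation.Binary.BagAndSetEquality using (∼bag⇒↭)
  open import Data.Vec as Vec using (Vec; []; _∷_)
  import Data.Vec.Properties as Vecₚ
  import Data.Vec.Relation.Unary.All as VAll
  open import Data.Vec.Relation.Binary.Pointwise.Inductive using (Pointwise; []; _∷_)
  open import Data.Product using (Σ-syntax; ∃; _×_; _,_; proj₁; proj₂)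
  open import Data.Sum using (inj₁; inj₂)
  open import Data.Empty using (⊥; ⊥-elim)
  open import Relation.Nullary using (Dec; yes; no; ¬?)
  open import Function using (_∘_; mk⇔)

  private variable
    a b : Level
    A : Set a
    B : Set b

  Unique-∈⇒↭ : ∀ {xs ys : List A} → Unique xs → Unique ys →
               (∀ {z} → z ∈ xs → z ∈ ys) → (∀ {z} → z ∈ ys → z ∈ xs) → xs ↭ ys
  Unique-∈⇒↭ ux uy f g = ∼bag⇒↭ (unique∧set⇒bag ux uy (mk⇔ f g))

  Unique-resp-↭ : ∀ {xs ys : List A} → xs ↭ ys → Unique xs → Unique ys
  Unique-resp-↭ {A = A} p = ↭ₛₚ.Unique-resp-↭ (≡.setoid A) (↭⇒↭ₛ p)

  Unique-++⁻ˡ : ∀ (xs : List A) {ys} → Unique (xs ++ ys) → Unique xs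
  Unique-++⁻ˡ []       u       = []
  Unique-++⁻ˡ (x ∷ xs) (h ∷ u) = Allₚ.++⁻ˡ xs h ∷ Unique-++⁻ˡ xs u

  Unique-++⁻ʳ : ∀ (xs : List A) {ys} → Unique (xs ++ ys) → Unique ys
  Unique-++⁻ʳ []       u       = u
  Unique-++⁻ʳ (x ∷ xs) (h ∷ u) = Unique-++⁻ʳ xs u

  Unique-++⇒disjoint : ∀ (xs : List A) {ys z} → Unique (xs ++ ys) → z ∈ xs → z ∈ ys → ⊥
  Unique-++⇒disjoint (x ∷ xs) (h ∷ u) (here ≡.refl) m' = All.lookup (Allₚ.++⁻ʳ xs h) m' ≡.refl
  Unique-++⇒disjoint (x ∷ xs) (h ∷ u) (there m)     m' = Unique-++⇒disjoint xs u m m'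

  ∈-concatMap⁺′ : ∀ (F : A → List B) {xs x y} → x ∈ xs → y ∈ F x → y ∈ concatMap F xs
  ∈-concatMap⁺′ F mx my = ∈-concatMap⁺ F (Any.map (λ { ≡.refl → my }) mx)

  ∈-concatMap⁻′ : ∀ (F : A → List B) xs {y} → y ∈ concatMap F xs → ∃ λ x → x ∈ xs × y ∈ F x
  ∈-concatMap⁻′ F xs m = find (∈-concatMap⁻ F m)

  Unique-map⁺ : ∀ (f : A → B) {xs} → Unique xs →
                (∀ {x x'} → x ∈ xs → x' ∈ xs → f x ≡ f x' → x ≡ x') → Unique (map f xs)
  Unique-map⁺ f {[]}     _       _   = []
  Unique-map⁺ f {x ∷ xs} (h ∷ u) inj =
    All.tabulate (λ m e → let (x' , mx' , e') = ∈-map⁻ f m in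
                          All.lookup h mx' (inj (here ≡.refl) (there mx') (≡.trans e e')))
    ∷ Unique-map⁺ f u (λ m m' → inj (there m) (there m'))

  Unique-concatMap⁺ : ∀ (F : A → List B) {xs} → Unique xs → (∀ {x} → x ∈ xs → Unique (F x)) →
    (∀ {x x' y} → x ∈ xs → x' ∈ xs → y ∈ F x → y ∈ F x' → x ≡ x') → Unique (concatMap F xs)
  Unique-concatMap⁺ F {[]}     _       _  _   = []
  Unique-concatMap⁺ F {x ∷ xs} (h ∷ u) uF inj =
    Uniqueₚ.++⁺ (uF (here ≡.refl)) (Unique-concatMap⁺ F u (uF ∘ there) (λ m m' → inj (there m) (there m')))
      (λ (m₁ , m₂) → let (x' , mx' , my) = ∈-concatMap⁻′ F xs m₂ in
                      All.lookup h mx' (inj (here ≡.refl) (there mx') m₁ my))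

  <-Unique : ∀ {xs} → AllPairs _<_ xs → Unique xs
  <-Unique = AllPairs.map ℕₚ.<⇒≢

  AllPairs-resp-⊆ : ∀ {R : ℕ → ℕ → Set} {xs ys} → xs ⊆ ys → AllPairs R ys → AllPairs R xs
  AllPairs-resp-⊆ []           []      = []
  AllPairs-resp-⊆ (≡.refl ∷ s) (h ∷ i) = ⊆ₚ.All-resp-⊆ s h ∷ AllPairs-resp-⊆ s i
  AllPairs-resp-⊆ (y ∷ʳ s)     (h ∷ i) = AllPairs-resp-⊆ s i

  AllPairs<-↭⇒≡ : ∀ {xs ys} → AllPairs _<_ xs → AllPairs _<_ ys → xs ↭ ys → xs ≡ ys
  AllPairs<-↭⇒≡ {[]}     {[]}     _ _ _ = ≡.refl
  AllPairs<-↭⇒≡ {[]}     {y ∷ ys} _ _ p with () ← ↭ₚ.↭-empty-inv (↭-sym p)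
  AllPairs<-↭⇒≡ {x ∷ xs} {[]}     _ _ p with () ← ↭ₚ.↭-empty-inv p
  AllPairs<-↭⇒≡ {x ∷ xs} {y ∷ ys} (hx ∷ ix) (hy ∷ iy) p
    with ↭ₚ.∈-resp-↭ p (here ≡.refl) | ↭ₚ.∈-resp-↭ (↭-sym p) (here ≡.refl)
  ... | here ≡.refl | _           = ≡.cong (x ∷_) (AllPairs<-↭⇒≡ ix iy (↭ₚ.drop-∷ p))
  ... | there _     | here ≡.refl = ≡.cong (x ∷_) (AllPairs<-↭⇒≡ ix iy (↭ₚ.drop-∷ p))
  ... | there mx    | there my    = ⊥-elim (ℕₚ.<-asym (All.lookup hy mx) (All.lookup hx my))

  concatV : ∀ {k} → Vec (List A) k → List A
  concatV []       = []
  concatV (l ∷ ls) = l ++ concatV ls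

  bipartitions : List A → List (List A × List A)
  bipartitions []       = ([] , []) ∷ []
  bipartitions (x ∷ xs) = map (λ (l , r) → (x ∷ l , r)) (bipartitions xs)
                       ++ map (λ (l , r) → (l , x ∷ r)) (bipartitions xs)

  bipartitions-sound : ∀ (L : List A) {p} → p ∈ bipartitions L →
                       proj₁ p ⊆ L × proj₂ p ⊆ L × (proj₁ p ++ proj₂ p ↭ L)
  bipartitions-sound [] (here ≡.refl) = [] , [] , ↭.refl
  bipartitions-sound (x ∷ xs) m with ∈-++⁻ (map (λ (l , r) → (x ∷ l , r)) (bipartitions xs)) m
  ... | inj₁ m' with (q₁ , q₂) , mq , ≡.refl ← ∈-map⁻ _ m'
              with s₁ , s₂ , pm ← bipartitions-sound xs mq
              = ≡.refl ∷ s₁ , x ∷ʳ s₂ , ↭.prep x pm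
  ... | inj₂ m' with (q₁ , q₂) , mq , ≡.refl ← ∈-map⁻ _ m'
              with s₁ , s₂ , pm ← bipartitions-sound xs mq
              = x ∷ʳ s₁ , ≡.refl ∷ s₂ , ↭.trans (↭ₚ.shift x q₁ q₂) (↭.prep x pm)

  filter-∈-bipartitions : ∀ {P : A → Set} (P? : ∀ z → Dec (P z)) L →
    (filter P? L , filter (¬? ∘ P?) L) ∈ bipartitions L
  filter-∈-bipartitions P? []       = here ≡.refl
  filter-∈-bipartitions P? (x ∷ xs) with P? x
  ... | yes _ = ∈-++⁺ˡ (∈-map⁺ _ (filter-∈-bipartitions P? xs))
  ... | no  _ = ∈-++⁺ʳ _ (∈-map⁺ _ (filter-∈-bipartitions P? xs))

  bipartitions-unique : ∀ L → AllPairs _<_ L → Unique (bipartitions L)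
  bipartitions-unique []       _       = [] ∷ []
  bipartitions-unique (x ∷ xs) (h ∷ i) =
    Uniqueₚ.++⁺ (Unique-map⁺ _ (bipartitions-unique xs i) (λ { _ _ ≡.refl → ≡.refl }))
                (Unique-map⁺ _ (bipartitions-unique xs i) (λ { _ _ ≡.refl → ≡.refl }))
                disjoint
    where
    disjoint : ∀ {z} → z ∈ map (λ (l , r) → (x ∷ l , r)) (bipartitions xs)
                     × z ∈ map (λ (l , r) → (l , x ∷ r)) (bipartitions xs) → ⊥
    disjoint (m₁ , m₂) with ∈-map⁻ _ m₁ | ∈-map⁻ _ m₂
    ... | _ , _ , ≡.refl | q , mq , e with s₁ , _ , _ ← bipartitions-sound xs mq =
      ℕₚ.<-irrefl ≡.refl (All.lookup h (lookup s₁ (≡.subst (x ∈_) (≡.cong proj₁ e) (here ≡.refl))))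

  bipartitions-map : ∀ (φ : A → B) L →
    bipartitions (map φ L) ≡ map (λ (l , r) → (map φ l , map φ r)) (bipartitions L)
  bipartitions-map φ []       = ≡.refl
  bipartitions-map φ (x ∷ xs) rewrite bipartitions-map φ xs =
    ≡.trans (≡.cong₂ _++_ (≡.trans (≡.sym (Listₚ.map-∘ (bipartitions xs))) (Listₚ.map-∘ (bipartitions xs)))
                          (≡.trans (≡.sym (Listₚ.map-∘ (bipartitions xs))) (Listₚ.map-∘ (bipartitions xs))))
            (≡.sym (Listₚ.map-++ _ (map _ (bipartitions xs)) (map _ (bipartitions xs))))

  splitsInto : (k : ℕ) → List A → List (Vec (List A) k)
  splitsInto zero    []       = [] ∷ []
  splitsInto zero    (x ∷ xs) = []
  splitsInto (suc k) L        = concatMap (λ (l , r) → map (l ∷_) (splitsInto k r)) (bipartitions L)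

  splitsInto-sound : ∀ k (L : List A) {σ} → σ ∈ splitsInto k L → VAll.All (_⊆ L) σ × (concatV σ ↭ L)
  splitsInto-sound zero    []  (here ≡.refl) = VAll.[] , ↭.refl
  splitsInto-sound (suc k) L m
    with (l , r) , mp , m' ← ∈-concatMap⁻′ (λ (l , r) → map (l ∷_) (splitsInto k r)) (bipartitions L) m
    with σ' , mσ' , ≡.refl ← ∈-map⁻ (l ∷_) m'
    with s₁ , s₂ , pm ← bipartitions-sound L mp
    with parts , pm' ← splitsInto-sound k r mσ'
    = s₁ VAll.∷ VAll.map (λ s → ⊆-trans s s₂) parts , ↭.trans (↭ₚ.++⁺ˡ l pm') pm

  splitsInto-complete : ∀ {k} (ls : Vec (List ℕ) k) L → AllPairs _<_ L → concatV ls ↭ L →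
    Σ[ σ ∈ Vec (List ℕ) k ] σ ∈ splitsInto k L × Pointwise _↭_ ls σ
  splitsInto-complete []       L _ p with ≡.refl ← ↭ₚ.↭-empty-inv (↭-sym p) = [] , here ≡.refl , []
  splitsInto-complete {suc k} (l ∷ ls) L i p =
      filter (_∈? l) L ∷ proj₁ rest
    , ∈-concatMap⁺′ (λ (l , r) → map (l ∷_) (splitsInto k r)) (filter-∈-bipartitions (_∈? l) L)
                    (∈-map⁺ _ (proj₁ (proj₂ rest)))
    , Unique-∈⇒↭ (Unique-++⁻ˡ l uc) (Uniqueₚ.filter⁺ (_∈? l) uL) inFilter fromFilter ∷ proj₂ (proj₂ rest)
    where
    uL = <-Unique i
    uc : Unique (l ++ concatV ls)
    uc = Unique-resp-↭ (↭-sym p) uL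
    L' = filter (_∉? l) L
    inFilter : ∀ {z} → z ∈ l → z ∈ filter (_∈? l) L
    inFilter m = ∈-filter⁺ (_∈? l) (↭ₚ.∈-resp-↭ p (∈-++⁺ˡ m)) m
    fromFilter : ∀ {z} → z ∈ filter (_∈? l) L → z ∈ l
    fromFilter m = proj₂ (∈-filter⁻ (_∈? l) {xs = L} m)
    toL' : ∀ {z} → z ∈ concatV ls → z ∈ L'
    toL' m = ∈-filter⁺ (_∉? l) (↭ₚ.∈-resp-↭ p (∈-++⁺ʳ l m)) (λ m' → Unique-++⇒disjoint l uc m' m)
    fromL' : ∀ {z} → z ∈ L' → z ∈ concatV ls
    fromL' m with mL , z∉l ← ∈-filter⁻ (_∉? l) {xs = L} m
             with ∈-++⁻ l (↭ₚ.∈-resp-↭ (↭-sym p) mL)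
    ... | inj₁ ml = ⊥-elim (z∉l ml)
    ... | inj₂ mr = mr
    rest↭L' : concatV ls ↭ L'
    rest↭L' = Unique-∈⇒↭ (Unique-++⁻ʳ l uc) (Uniqueₚ.filter⁺ (_∉? l) uL) toL' fromL'
    rest = splitsInto-complete ls L' (AllPairs-resp-⊆ (⊆ₚ.filter-⊆ (_∉? l) L) i) rest↭L'

  splitsInto-unique : ∀ k L → AllPairs _<_ L → Unique (splitsInto k L)
  splitsInto-unique zero    []       _ = [] ∷ []
  splitsInto-unique zero    (x ∷ xs) _ = []
  splitsInto-unique (suc k) L i =
    Unique-concatMap⁺ (λ (l , r) → map (l ∷_) (splitsInto k r)) (bipartitions-unique L i)
      (λ {(l , r)} mp → Unique-map⁺ (l ∷_)
         (splitsInto-unique k r (AllPairs-resp-⊆ (proj₁ (proj₂ (bipartitions-sound L mp))) i))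
         (λ _ _ → Vecₚ.∷-injectiveʳ))
      sameBipartition
    where
    sameBipartition : ∀ {p p' y} → p ∈ bipartitions L → p' ∈ bipartitions L →
      y ∈ map (proj₁ p ∷_) (splitsInto k (proj₂ p)) → y ∈ map (proj₁ p' ∷_) (splitsInto k (proj₂ p')) → p ≡ p'
    sameBipartition {l , r} {l' , r'} mp mp' my my'
      with σ , mσ , ≡.refl ← ∈-map⁻ _ my | σ' , mσ' , e ← ∈-map⁻ _ my'
      with ≡.refl , ≡.refl ← Vecₚ.∷-injective e
      with _ , s₂ , _ ← bipartitions-sound L mp | _ , s₂' , _ ← bipartitions-sound L mp'
      = ≡.cong (l ,_) (AllPairs<-↭⇒≡ (AllPairs-resp-⊆ s₂ i) (AllPairs-resp-⊆ s₂' i)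
          (↭.trans (↭-sym (proj₂ (splitsInto-sound k r mσ))) (proj₂ (splitsInto-sound k r' mσ'))))

  splitsInto-map : ∀ (φ : A → B) k L → splitsInto k (map φ L) ≡ map (Vec.map (map φ)) (splitsInto k L)
  splitsInto-map φ zero    []       = ≡.refl
  splitsInto-map φ zero    (x ∷ xs) = ≡.refl
  splitsInto-map φ (suc k) L = begin
    concatMap G (bipartitions (map φ L))
      ≡⟨ ≡.cong (concatMap G) (bipartitions-map φ L) ⟩
    concatMap G (map (λ (l , r) → (map φ l , map φ r)) (bipartitions L))
      ≡⟨ Listₚ.concatMap-map G _ (bipartitions L) ⟩
    concatMap (λ (l , r) → map (map φ l ∷_) (splitsInto k (map φ r))) (bipartitions L)
      ≡⟨ Listₚ.concatMap-cong (λ (l , r) → ≡.trans (≡.cong (map (map φ l ∷_)) (splitsInto-map φ k r))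
                                    (≡.trans (≡.sym (Listₚ.map-∘ (splitsInto k r))) (Listₚ.map-∘ (splitsInto k r))))
                              (bipartitions L) ⟩
    concatMap (λ (l , r) → map (Vec.map (map φ)) (map (l ∷_) (splitsInto k r))) (bipartitions L)
      ≡⟨ Listₚ.map-concatMap (Vec.map (map φ)) (λ (l , r) → map (l ∷_) (splitsInto k r)) (bipartitions L) ⟨
    map (Vec.map (map φ)) (concatMap (λ (l , r) → map (l ∷_) (splitsInto k r)) (bipartitions L))
      ∎
    where
    open ≡.≡-Reasoning
    G : List B × List B → List (Vec (List B) (suc k))
    G (l , r) = map (l ∷_) (splitsInto k r)

  choices : ∀ {k} → Vec (List A) k → List (Vec A k)
  choices []       = [] ∷ []
  choices (l ∷ ls) = concatMap (λ y → map (y ∷_) (choices ls)) l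

  ∈-choices⁻ : ∀ {k} (ls : Vec (List A) k) {v} → v ∈ choices ls → Pointwise (λ l y → y ∈ l) ls v
  ∈-choices⁻ []       (here ≡.refl) = []
  ∈-choices⁻ (l ∷ ls) m
    with y , my , m' ← ∈-concatMap⁻′ (λ y → map (y ∷_) (choices ls)) l m
    with v , mv , ≡.refl ← ∈-map⁻ (y ∷_) m'
    = my ∷ ∈-choices⁻ ls mv

  ∈-choices⁺ : ∀ {k} {ls : Vec (List A) k} {v} → Pointwise (λ l y → y ∈ l) ls v → v ∈ choices ls
  ∈-choices⁺ []                   = here ≡.refl
  ∈-choices⁺ {ls = l ∷ ls} (m ∷ ms) = ∈-concatMap⁺′ (λ y → map (y ∷_) (choices ls)) m (∈-map⁺ _ (∈-choices⁺ ms))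

  choices-unique : ∀ {k} {ls : Vec (List A) k} → VAll.All Unique ls → Unique (choices ls)
  choices-unique VAll.[] = [] ∷ []
  choices-unique {ls = l ∷ ls} (u VAll.∷ us) =
    Unique-concatMap⁺ (λ y → map (y ∷_) (choices ls)) u
      (λ _ → Unique-map⁺ _ (choices-unique us) (λ _ _ → Vecₚ.∷-injectiveʳ))
      (λ _ _ my my' → let (_ , _ , e₁) = ∈-map⁻ _ my ; (_ , _ , e₂) = ∈-map⁻ _ my' in
                      Vecₚ.∷-injectiveˡ (≡.trans (≡.sym e₁) e₂))

  choices-map : ∀ (f : A → B) {k} (ls : Vec (List A) k) → choices (Vec.map (map f) ls) ≡ map (Vec.map f) (choices ls)
  choices-map f []       = ≡.refl
  choices-map f (l ∷ ls) =
    ≡.trans (Listₚ.concatMap-map (λ y → map (y ∷_) (choices (Vec.map (map f) ls))) f l)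
    (≡.trans (Listₚ.concatMap-cong (λ y → ≡.trans (≡.cong (map (f y ∷_)) (choices-map f ls))
                                       (≡.trans (≡.sym (Listₚ.map-∘ (choices ls))) (Listₚ.map-∘ (choices ls)))) l)
             (≡.sym (Listₚ.map-concatMap (Vec.map f) (λ y → map (y ∷_) (choices ls)) l)))

module Labels where
  import Data.List.Properties as Listₚ
  open import Data.List.Relation.Unary.All as All using (All)
  import Data.List.Relation.Unary.All.Properties as Allₚ
  open import Data.List.Relation.Unary.AllPairs as AllPairs using (AllPairs)
  import Data.List.Relation.Unary.AllPairs.Properties as AllPairsₚ
  open import Data.List.Relation.Binary.Permutation.Propositional using (_↭_)
  import Data.List.Relation.Binary.Permutation.Propositional.Properties as ↭ₚ
  open import Data.Empty using (⊥)

  oneTo : ℕ → List ℕ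
  oneTo n = map suc (upTo n)

  oneTo-suc : ∀ n → oneTo (suc n) ≡ 1 ∷ map suc (oneTo n)
  oneTo-suc n = ≡.cong (λ z → 1 ∷ map suc z) (≡.sym (Listₚ.map-upTo suc n))

  oneTo-length : ∀ n → length (oneTo n) ≡ n
  oneTo-length n = ≡.trans (Listₚ.length-map suc (upTo n)) (Listₚ.length-upTo n)

  map-suc-< : ∀ {S} → AllPairs _<_ S → AllPairs _<_ (map suc S)
  map-suc-< i = AllPairsₚ.map⁺ (AllPairs.map s≤s i)

  oneTo-< : ∀ n → AllPairs _<_ (oneTo n)
  oneTo-< n = map-suc-< (AllPairsₚ.applyUpTo⁺₁ (λ i → i) n (λ i<j _ → i<j))

  oneTo-positive : ∀ n → All (0 <_) (oneTo n)
  oneTo-positive n = Allₚ.map⁺ (All.tabulate (λ _ → s≤s z≤n))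

  oneTo-nonempty : ∀ {n} → 1 ≤ n → oneTo n ↭ [] → ⊥
  oneTo-nonempty {suc n} _ p with () ← ↭ₚ.↭-empty-inv p

module IncreasingTrees (d : ℕ) where
  import Data.List.Properties as Listₚ
  open import Data.List.Membership.Propositional using (_∈_)
  open import Data.List.Membership.Propositional.Properties using (∈-map⁺; ∈-map⁻)
  open import Data.List.Relation.Unary.Any using (here; there)
  open import Data.List.Relation.Unary.All as All using (All; []; _∷_)
  import Data.List.Relation.Unary.All.Properties as Allₚ
  open import Data.List.Relation.Unary.AllPairs using (AllPairs; []; _∷_)
  open import Data.List.Relation.Unary.Unique.Propositional using (Unique)
  open import Data.List.Relation.Binary.Sublist.Propositional using (_⊆_)
  import Data.List.Relation.Binary.Sublist.Propositional.Properties as ⊆ₚ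
  open import Data.List.Relation.Binary.Permutation.Propositional as ↭ using (_↭_; ↭-sym)
  import Data.List.Relation.Binary.Permutation.Propositional.Properties as ↭ₚ
  open import Data.Vec as Vec using (Vec; []; _∷_)
  import Data.Vec.Properties as Vecₚ
  import Data.Vec.Relation.Unary.All as VAll
  open import Data.Vec.Relation.Binary.Pointwise.Inductive using (Pointwise; []; _∷_)
  open import Data.Product using (_×_; _,_; proj₁; proj₂)
  open import Data.Unit using (⊤; tt)
  open import Data.Empty using (⊥; ⊥-elim)
  open ListCombinatorics
  open Labels

  IncreasingOrLeaf : DTree d → Set
  IncreasingOrLeaf leaf        = ⊤
  IncreasingOrLeaf (node m ts) = AboveV m ts

  -- K is fuel: treesOn K S lists all increasing trees with label set S once |S| ≤ K.
  treesOn : ℕ → List ℕ → List (DTree d)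
  treesOn _       []       = leaf ∷ []
  treesOn zero    (x ∷ xs) = []
  treesOn (suc K) (x ∷ xs) = concatMap (λ σ → map (node x) (choices (Vec.map (treesOn K) σ))) (splitsInto d xs)

  concatV-labels : ∀ {k} (w : Vec (DTree d) k) → concatV (Vec.map labels w) ≡ labelsV w
  concatV-labels []      = ≡.refl
  concatV-labels (t ∷ w) = ≡.cong (labels t ++_) (concatV-labels w)

  mutual
    Above⇒labels> : ∀ {y} t → Above y t → All (y <_) (labels t)
    Above⇒labels> leaf       _          = []
    Above⇒labels> (node m w) (y<m , ab) = y<m ∷ All.map (ℕₚ.<-trans y<m) (AboveV⇒labels> w ab)

    AboveV⇒labels> : ∀ {y k} (w : Vec (DTree d) k) → AboveV y w → All (y <_) (labelsV w)
    AboveV⇒labels> []      _        = []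
    AboveV⇒labels> (t ∷ w) (a , as) = Allₚ.++⁺ (Above⇒labels> t a) (AboveV⇒labels> w as)

  Above⇒IncreasingOrLeaf : ∀ {y} t → Above y t → IncreasingOrLeaf t
  Above⇒IncreasingOrLeaf leaf       _        = tt
  Above⇒IncreasingOrLeaf (node m w) (_ , ab) = ab

  mutual
    treesOn-sound : ∀ K S → AllPairs _<_ S → ∀ {t} → t ∈ treesOn K S →
                    (labels t ↭ S) × (∀ y → All (y <_) S → Above y t)
    treesOn-sound K [] _ (here ≡.refl) = ↭.refl , λ _ _ → tt
    treesOn-sound (suc K) (x ∷ xs) (hx ∷ ixs) m
      with σ , mσ , m' ← ∈-concatMap⁻′ (λ σ → map (node x) (choices (Vec.map (treesOn K) σ))) (splitsInto d xs) m
      with v , mv , ≡.refl ← ∈-map⁻ (node x) m'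
      with parts , concatσ↭xs ← splitsInto-sound d xs mσ
      with labels↭ , above ← treesOnV-sound K x xs hx ixs σ v parts (∈-choices⁻ (Vec.map (treesOn K) σ) mv)
      = ↭.prep x (↭.trans labels↭ concatσ↭xs) , λ y y<S → All.head y<S , above

    treesOnV-sound : ∀ K x xs → All (x <_) xs → AllPairs _<_ xs → ∀ {k} (σ : Vec (List ℕ) k) (v : Vec (DTree d) k) →
      VAll.All (_⊆ xs) σ → Pointwise (λ l t → t ∈ l) (Vec.map (treesOn K) σ) v → (labelsV v ↭ concatV σ) × AboveV x v
    treesOnV-sound K x xs hx ixs []      []      VAll.[]         []       = ↭.refl , tt
    treesOnV-sound K x xs hx ixs (S ∷ σ) (t ∷ v) (s VAll.∷ ss) (mt ∷ ms)
      with labels↭₁ , above₁ ← treesOn-sound K S (AllPairs-resp-⊆ s ixs) mt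
      with labels↭₂ , above₂ ← treesOnV-sound K x xs hx ixs σ v ss ms
      = ↭ₚ.++⁺ labels↭₁ labels↭₂ , above₁ x (⊆ₚ.All-resp-⊆ s hx) , above₂

  Pointwise-labels : ∀ {k} (w : Vec (DTree d) k) {σ : Vec (List ℕ) k} → Pointwise _↭_ (Vec.map labels w) σ →
                     Pointwise (λ t S → labels t ↭ S) w σ
  Pointwise-labels []      []       = []
  Pointwise-labels (t ∷ w) (p ∷ ps) = p ∷ Pointwise-labels w ps

  mutual
    treesOn-complete : ∀ K S → AllPairs _<_ S → length S ≤ K → ∀ t → IncreasingOrLeaf t → labels t ↭ S → t ∈ treesOn K S
    treesOn-complete K [] i le leaf _ p = here ≡.refl
    treesOn-complete K (s ∷ ss) i le leaf _ p with () ← ↭ₚ.↭-empty-inv (↭-sym p)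
    treesOn-complete K [] i le (node m w) _ p with () ← ↭ₚ.↭-empty-inv p
    treesOn-complete (suc K) (s ∷ ss) (hs ∷ iss) (s≤s le) (node m w) ab p with ↭ₚ.∈-resp-↭ p (here ≡.refl)
    ... | there m∈ss = ⊥-elim (s∉labels (↭ₚ.∈-resp-↭ (↭-sym p) (here ≡.refl)))
      where
      s<m = All.lookup hs m∈ss
      s∉labels : s ∈ m ∷ labelsV w → ⊥
      s∉labels (here e)  = ℕₚ.<-irrefl e s<m
      s∉labels (there s∈) = ℕₚ.<-asym (All.lookup (AboveV⇒labels> w ab) s∈) s<m
    ... | here ≡.refl
      with σ , mσ , pw ← splitsInto-complete (Vec.map labels w) ss iss
                           (≡.subst (_↭ ss) (≡.sym (concatV-labels w)) (↭ₚ.drop-∷ p))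
      = ∈-concatMap⁺′ (λ σ → map (node m) (choices (Vec.map (treesOn K) σ))) mσ
          (∈-map⁺ (node m) (∈-choices⁺ (treesOnV-complete K m ss iss le σ w
                                          (proj₁ (splitsInto-sound d ss mσ)) (Pointwise-labels w pw) ab)))

    treesOnV-complete : ∀ K m ss → AllPairs _<_ ss → length ss ≤ K → ∀ {k} (σ : Vec (List ℕ) k) (w : Vec (DTree d) k) →
      VAll.All (_⊆ ss) σ → Pointwise (λ t S → labels t ↭ S) w σ → AboveV m w →
      Pointwise (λ l t → t ∈ l) (Vec.map (treesOn K) σ) w
    treesOnV-complete K m ss iss le []      []      VAll.[]           []         _        = []
    treesOnV-complete K m ss iss le (S ∷ σ) (t ∷ w) (sub VAll.∷ subs) (pl ∷ pls) (a , as) =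
      treesOn-complete K S (AllPairs-resp-⊆ sub iss) (ℕₚ.≤-trans (⊆ₚ.length-mono-≤ sub) le) t (Above⇒IncreasingOrLeaf t a) pl
      ∷ treesOnV-complete K m ss iss le σ w subs pls as

  treesOnV-injective : ∀ K xs → AllPairs _<_ xs → ∀ {k} (σ σ' : Vec (List ℕ) k) (v : Vec (DTree d) k) →
    VAll.All (_⊆ xs) σ → VAll.All (_⊆ xs) σ' →
    Pointwise (λ l t → t ∈ l) (Vec.map (treesOn K) σ) v → Pointwise (λ l t → t ∈ l) (Vec.map (treesOn K) σ') v → σ ≡ σ'
  treesOnV-injective K xs i []      []        []      VAll.[]       VAll.[]         []       []         = ≡.refl
  treesOnV-injective K xs i (S ∷ σ) (S' ∷ σ') (t ∷ v) (s VAll.∷ ss) (s' VAll.∷ ss') (m ∷ ms) (m' ∷ ms') =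
    ≡.cong₂ _∷_ (AllPairs<-↭⇒≡ (AllPairs-resp-⊆ s i) (AllPairs-resp-⊆ s' i)
                  (↭.trans (↭-sym (proj₁ (treesOn-sound K S (AllPairs-resp-⊆ s i) m)))
                           (proj₁ (treesOn-sound K S' (AllPairs-resp-⊆ s' i) m'))))
                (treesOnV-injective K xs i σ σ' v ss ss' ms ms')

  treesOn-unique : ∀ K S → AllPairs _<_ S → Unique (treesOn K S)
  treesOn-unique K       []       i = [] ∷ []
  treesOn-unique zero    (x ∷ xs) i = []
  treesOn-unique (suc K) (x ∷ xs) (hx ∷ ixs) =
    Unique-concatMap⁺ (λ σ → map (node x) (choices (Vec.map (treesOn K) σ))) (splitsInto-unique d xs ixs)
      (λ mσ → Unique-map⁺ (node x) (choices-unique (branchesUnique _ (proj₁ (splitsInto-sound d xs mσ))))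
                (λ { _ _ ≡.refl → ≡.refl }))
      sameSplit
    where
    branchesUnique : ∀ {k} (σ : Vec (List ℕ) k) → VAll.All (_⊆ xs) σ → VAll.All Unique (Vec.map (treesOn K) σ)
    branchesUnique []      VAll.[]       = VAll.[]
    branchesUnique (S ∷ σ) (s VAll.∷ ss) = treesOn-unique K S (AllPairs-resp-⊆ s ixs) VAll.∷ branchesUnique σ ss
    sameSplit : ∀ {σ σ' y} → σ ∈ splitsInto d xs → σ' ∈ splitsInto d xs →
                y ∈ map (node x) (choices (Vec.map (treesOn K) σ)) →
                y ∈ map (node x) (choices (Vec.map (treesOn K) σ')) → σ ≡ σ'
    sameSplit {σ} {σ'} mσ mσ' my my'
      with v , mv , ≡.refl ← ∈-map⁻ (node x) my
      with v' , mv' , ≡.refl ← ∈-map⁻ (node x) my'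
      = treesOnV-injective K xs ixs σ σ' v (proj₁ (splitsInto-sound d xs mσ)) (proj₁ (splitsInto-sound d xs mσ'))
          (∈-choices⁻ (Vec.map (treesOn K) σ) mv) (∈-choices⁻ (Vec.map (treesOn K) σ') mv')

  mapLabelsV≡map : ∀ (φ : ℕ → ℕ) {k} (v : Vec (DTree d) k) → mapLabelsV φ v ≡ Vec.map (mapLabels φ) v
  mapLabelsV≡map φ []      = ≡.refl
  mapLabelsV≡map φ (t ∷ v) = ≡.cong (mapLabels φ t ∷_) (mapLabelsV≡map φ v)

  treesOn-mapLabels : ∀ (φ : ℕ → ℕ) K S → map (mapLabels φ) (treesOn K S) ≡ treesOn K (map φ S)
  treesOn-mapLabels φ K       []       = ≡.refl
  treesOn-mapLabels φ zero    (x ∷ xs) = ≡.refl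
  treesOn-mapLabels φ (suc K) (x ∷ xs) = begin
    map (mapLabels φ) (concatMap (λ σ → map (node x) (choices (Vec.map (treesOn K) σ))) (splitsInto d xs))
      ≡⟨ Listₚ.map-concatMap (mapLabels φ) _ (splitsInto d xs) ⟩
    concatMap (λ σ → map (mapLabels φ) (map (node x) (choices (Vec.map (treesOn K) σ)))) (splitsInto d xs)
      ≡⟨ Listₚ.concatMap-cong relabel (splitsInto d xs) ⟩
    concatMap (λ σ → map (node (φ x)) (choices (Vec.map (treesOn K) (Vec.map (map φ) σ)))) (splitsInto d xs)
      ≡⟨ Listₚ.concatMap-map (λ σ → map (node (φ x)) (choices (Vec.map (treesOn K) σ))) (Vec.map (map φ)) (splitsInto d xs) ⟨
    concatMap (λ σ → map (node (φ x)) (choices (Vec.map (treesOn K) σ))) (map (Vec.map (map φ)) (splitsInto d xs))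
      ≡⟨ ≡.cong (concatMap (λ σ → map (node (φ x)) (choices (Vec.map (treesOn K) σ)))) (splitsInto-map φ d xs) ⟨
    concatMap (λ σ → map (node (φ x)) (choices (Vec.map (treesOn K) σ))) (splitsInto d (map φ xs))
      ∎
    where
    open ≡.≡-Reasoning
    relabel : ∀ σ → map (mapLabels φ) (map (node x) (choices (Vec.map (treesOn K) σ)))
                  ≡ map (node (φ x)) (choices (Vec.map (treesOn K) (Vec.map (map φ) σ)))
    relabel σ = begin
      map (mapLabels φ) (map (node x) (choices (Vec.map (treesOn K) σ)))
        ≡⟨ Listₚ.map-∘ _ ⟨
      map (λ v → node (φ x) (mapLabelsV φ v)) (choices (Vec.map (treesOn K) σ))
        ≡⟨ Listₚ.map-cong (λ v → ≡.cong (node (φ x)) (mapLabelsV≡map φ v)) _ ⟩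
      map (λ v → node (φ x) (Vec.map (mapLabels φ) v)) (choices (Vec.map (treesOn K) σ))
        ≡⟨ Listₚ.map-∘ _ ⟩
      map (node (φ x)) (map (Vec.map (mapLabels φ)) (choices (Vec.map (treesOn K) σ)))
        ≡⟨ ≡.cong (map (node (φ x))) (choices-map (mapLabels φ) (Vec.map (treesOn K) σ)) ⟨
      map (node (φ x)) (choices (Vec.map (map (mapLabels φ)) (Vec.map (treesOn K) σ)))
        ≡⟨ ≡.cong (λ z → map (node (φ x)) (choices z)) branches ⟩
      map (node (φ x)) (choices (Vec.map (treesOn K) (Vec.map (map φ) σ)))
        ∎
      where
      branches : Vec.map (map (mapLabels φ)) (Vec.map (treesOn K) σ) ≡ Vec.map (treesOn K) (Vec.map (map φ) σ)
      branches = ≡.trans (≡.sym (Vecₚ.map-∘ (map (mapLabels φ)) (treesOn K) σ))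
                 (≡.trans (Vecₚ.map-cong (treesOn-mapLabels φ K) σ) (Vecₚ.map-∘ (treesOn K) (map φ) σ))

  mutual
    mapLabels-cong : ∀ {f g : ℕ → ℕ} → (∀ z → f z ≡ g z) → ∀ t → mapLabels f t ≡ mapLabels g t
    mapLabels-cong e leaf       = ≡.refl
    mapLabels-cong e (node m w) = ≡.cong₂ node (e m) (mapLabelsV-cong e w)

    mapLabelsV-cong : ∀ {f g : ℕ → ℕ} → (∀ z → f z ≡ g z) → ∀ {k} (w : Vec (DTree d) k) → mapLabelsV f w ≡ mapLabelsV g w
    mapLabelsV-cong e []      = ≡.refl
    mapLabelsV-cong e (t ∷ w) = ≡.cong₂ _∷_ (mapLabels-cong e t) (mapLabelsV-cong e w)

  rank-↭ : ∀ {L L'} → L ↭ L' → ∀ z → rank {d} L z ≡ rank {d} L' z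
  rank-↭ p z = ↭ₚ.↭-length (↭ₚ.filter-↭ (λ y → y ≤? z) p)

  std≡relabel : ∀ {S} t → labels t ↭ S → std t ≡ mapLabels (rank {d} S) t
  std≡relabel t p = mapLabels-cong (rank-↭ p) t

  rank-self : ∀ S → AllPairs _<_ S → map (rank {d} S) S ≡ oneTo (length S)
  rank-self []       _       = ≡.refl
  rank-self (x ∷ xs) (h ∷ i) = begin
    rank {d} (x ∷ xs) x ∷ map (rank {d} (x ∷ xs)) xs
      ≡⟨ ≡.cong₂ _∷_ (≡.trans (rank-head x ℕₚ.≤-refl) (≡.cong suc rank-x≡0))
                     (Listₚ.map-cong-local (All.map (λ x<z → rank-head _ (ℕₚ.<⇒≤ x<z)) h)) ⟩
    1 ∷ map (λ z → suc (rank {d} xs z)) xs  ≡⟨ ≡.cong (1 ∷_) (Listₚ.map-∘ xs) ⟩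
    1 ∷ map suc (map (rank {d} xs) xs)      ≡⟨ ≡.cong (λ z → 1 ∷ map suc z) (rank-self xs i) ⟩
    1 ∷ map suc (oneTo (length xs))         ≡⟨ oneTo-suc (length xs) ⟨
    oneTo (length (x ∷ xs))                 ∎
    where
    open ≡.≡-Reasoning
    rank-head : ∀ z → x ≤ z → rank {d} (x ∷ xs) z ≡ suc (rank {d} xs z)
    rank-head z x≤z = ≡.cong length (Listₚ.filter-accept (λ y → y ≤? z) x≤z)
    rank-x≡0 : rank {d} xs x ≡ 0
    rank-x≡0 = ≡.cong length (Listₚ.filter-none (λ y → y ≤? x) (All.map ℕₚ.<⇒≱ h))

  treesOn-std : ∀ K S → AllPairs _<_ S → map std (treesOn K S) ≡ treesOn K (oneTo (length S))
  treesOn-std K S i = begin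
    map std (treesOn K S)
      ≡⟨ Listₚ.map-cong-local (All.tabulate (λ m → std≡relabel _ (proj₁ (treesOn-sound K S i m)))) ⟩
    map (mapLabels (rank {d} S)) (treesOn K S)  ≡⟨ treesOn-mapLabels (rank {d} S) K S ⟩
    treesOn K (map (rank {d} S) S)              ≡⟨ ≡.cong (treesOn K) (rank-self S i) ⟩
    treesOn K (oneTo (length S))                ∎
    where open ≡.≡-Reasoning

  module Enumeration (enum : ℕ → List (DTree d)) (isE : IsEnumeration enum) where

    enum-0 : enum 0 ≡ []
    enum-0 with enum 0 in eq
    ... | []     = ≡.refl
    ... | T ∷ Ts with proj₁ (proj₂ isE 0 T) (≡.subst (T ∈_) (≡.sym eq) (here ≡.refl))
    ...   | inc , p with T
    ...     | leaf     = ⊥-elim inc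
    ...     | node m w with () ← ↭ₚ.↭-empty-inv p

    enum↭treesOn : ∀ n K → n ≤ K → 1 ≤ n → enum n ↭ treesOn K (oneTo n)
    enum↭treesOn n K n≤K 1≤n = Unique-∈⇒↭ (proj₁ isE n) (treesOn-unique K (oneTo n) (oneTo-< n)) toTrees toEnum
      where
      toTrees : ∀ {T} → T ∈ enum n → T ∈ treesOn K (oneTo n)
      toTrees {T} m with proj₁ (proj₂ isE n T) m
      toTrees {leaf}     m | () , _
      toTrees {node x w} m | inc , p =
        treesOn-complete K (oneTo n) (oneTo-< n) (≡.subst (_≤ K) (≡.sym (oneTo-length n)) n≤K) (node x w) inc p
      toEnum : ∀ {T} → T ∈ treesOn K (oneTo n) → T ∈ enum n
      toEnum {T} m with treesOn-sound K (oneTo n) (oneTo-< n) m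
      toEnum {leaf} m | p , _ = ⊥-elim (oneTo-nonempty 1≤n (↭-sym p))
      toEnum {node x w} m | p , ab = proj₂ (proj₂ isE n (node x w)) (proj₂ (ab 0 (oneTo-positive n)) , p)

    size-enum : ∀ k {B} → B ∈ enum k → size B ≡ k
    size-enum k m = ≡.trans (↭ₚ.↭-length (proj₂ (proj₁ (proj₂ isE k _) m))) (oneTo-length k)

module ProductSums {c ℓ} (A : CommutativeRing c ℓ) where
  open import Data.Vec as Vec using (Vec; []; _∷_)
  import Data.Vec.Relation.Unary.All as VAll
  open import Data.Product using (_×_; _,_)
  open import Function using (_∘_)
  open ListCombinatorics
  open CommutativeRing A
  open Series A
  open Sums A
  open SeriesRing A using (⊛-coeff)
  open import Relation.Binary.Reasoning.Setoid setoid

  prodVec : ∀ {k} → Vec Carrier k → Carrier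
  prodVec []      = 1#
  prodVec (x ∷ v) = x * prodVec v

  prodVec-cong : ∀ {a} {X : Set a} {P : X → Set} {f g : X → Carrier} {k} (σ : Vec X k) →
    VAll.All P σ → (∀ {x} → P x → f x ≈ g x) → prodVec (Vec.map f σ) ≈ prodVec (Vec.map g σ)
  prodVec-cong []      VAll.[]         e = refl
  prodVec-cong (x ∷ σ) (p VAll.∷ ps) e = *-cong (e p) (prodVec-cong σ ps e)

  bipartitions-sum : ∀ {a} {X : Set a} (L : List X) (φ : ℕ → ℕ → Carrier) →
    sumL (map (λ (l , r) → φ (length l) (length r)) (bipartitions L)) ≈
    ∑ (suc (length L)) (λ k → natR (length L C k) * φ k (length L ∸ k))
  bipartitions-sum {X = X} []       φ = trans (+-identityʳ _) (sym (trans (∑-singleton _) (trans (*-congʳ natR-1) (*-identityˡ _))))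
  bipartitions-sum {X = X} (x ∷ xs) φ = begin
    sumL (map F (map left (bipartitions xs) ++ map right (bipartitions xs)))
      ≈⟨ sumL-++ F (map left (bipartitions xs)) (map right (bipartitions xs)) ⟩
    sumL (map F (map left (bipartitions xs))) + sumL (map F (map right (bipartitions xs)))
      ≈⟨ +-cong (reflexive (sumL-map F left (bipartitions xs))) (reflexive (sumL-map F right (bipartitions xs))) ⟩
    sumL (map (λ (l , r) → φ (suc (length l)) (length r)) (bipartitions xs)) +
    sumL (map (λ (l , r) → φ (length l) (suc (length r))) (bipartitions xs))
      ≈⟨ +-cong (bipartitions-sum xs (λ a b → φ (suc a) b)) (bipartitions-sum xs (λ a b → φ a (suc b))) ⟩
    ∑ (suc m) (λ k → natR (m C k) * φ (suc k) (m ∸ k)) + ∑ (suc m) (λ k → natR (m C k) * φ k (suc (m ∸ k)))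
      ≈⟨ +-congˡ (∑-cong< (suc m) (λ k k< → *-congˡ (reflexive (≡.cong (φ k) (≡.sym (ℕₚ.+-∸-assoc 1 (ℕₚ.≤-pred k<))))))) ⟩
    ∑ (suc m) (λ k → natR (m C k) * φ (suc k) (m ∸ k)) + ∑ (suc m) (λ k → natR (m C k) * φ k (suc m ∸ k))
      ≈⟨ ∑-pascal m φ ⟨
    ∑ (suc (suc m)) (λ k → natR (suc m C k) * φ k (suc m ∸ k))
      ∎
    where
    m = length xs
    F : List X × List X → Carrier
    F (l , r) = φ (length l) (length r)
    left right : List X × List X → List X × List X
    left  (l , r) = (x ∷ l , r)
    right (l , r) = (l , x ∷ r)

  splitsInto-sum : ∀ {a} {X : Set a} k (L : List X) (G : ℕ → Carrier) →
    sumL (map (λ σ → prodVec (Vec.map (G ∘ length) σ)) (splitsInto k L)) ≈ powS G k (length L)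
  splitsInto-sum zero    []       G = +-identityʳ _
  splitsInto-sum zero    (x ∷ xs) G = refl
  splitsInto-sum {X = X} (suc k) L G = begin
    sumL (map Pσ (concatMap (λ (l , r) → map (l ∷_) (splitsInto k r)) (bipartitions L)))
      ≈⟨ sumL-concatMap Pσ (λ (l , r) → map (l ∷_) (splitsInto k r)) (bipartitions L) ⟩
    sumL (map (λ (l , r) → sumL (map Pσ (map (l ∷_) (splitsInto k r)))) (bipartitions L))
      ≈⟨ sumL-cong (bipartitions L) (λ (l , r) →
           trans (reflexive (sumL-map Pσ (l ∷_) (splitsInto k r)))
                 (trans (sym (sumL-distribˡ (G (length l)) Pσ (splitsInto k r))) (*-congˡ (splitsInto-sum k r G)))) ⟩
    sumL (map (λ (l , r) → G (length l) * powS G k (length r)) (bipartitions L))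
      ≈⟨ bipartitions-sum L (λ a b → G a * powS G k b) ⟩
    ∑ (suc (length L)) (λ j → natR (length L C j) * (G j * powS G k (length L ∸ j)))
      ≈⟨ ⊛-coeff G (powS G k) (length L) ⟨
    powS G (suc k) (length L)
      ∎
    where
    Pσ : ∀ {j} → Vec (List X) j → Carrier
    Pσ σ = prodVec (Vec.map (G ∘ length) σ)

  choices-sum : ∀ {a} {Y : Set a} {k} (ls : Vec (List Y) k) (h : Y → Carrier) →
    sumL (map (λ v → prodVec (Vec.map h v)) (choices ls)) ≈ prodVec (Vec.map (λ l → sumL (map h l)) ls)
  choices-sum []       h = +-identityʳ _
  choices-sum (l ∷ ls) h = begin
    sumL (map Pv (concatMap (λ y → map (y ∷_) (choices ls)) l))
      ≈⟨ sumL-concatMap Pv (λ y → map (y ∷_) (choices ls)) l ⟩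
    sumL (map (λ y → sumL (map Pv (map (y ∷_) (choices ls)))) l)
      ≈⟨ sumL-cong l (λ y → trans (reflexive (sumL-map Pv (y ∷_) (choices ls)))
                           (trans (sym (sumL-distribˡ (h y) Pv (choices ls))) (*-congˡ (choices-sum ls h)))) ⟩
    sumL (map (λ y → h y * prodVec (Vec.map (λ l → sumL (map h l)) ls)) l)
      ≈⟨ sumL-distribʳ _ h l ⟨
    sumL (map h l) * prodVec (Vec.map (λ l → sumL (map h l)) ls)
      ∎
    where
    Pv : ∀ {j} → Vec _ j → Carrier
    Pv v = prodVec (Vec.map h v)

module TreeSums {c ℓ} (A : CommutativeRing c ℓ) (d : ℕ) (enum : ℕ → List (DTree d)) (isE : IsEnumeration enum)
                (h : DTree d → CommutativeRing.Carrier A) where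
  import Data.List.Properties as Listₚ
  open import Data.List.Membership.Propositional using (_∈_)
  open import Data.List.Relation.Binary.Sublist.Propositional using (_⊆_)
  import Data.List.Relation.Binary.Sublist.Propositional.Properties as ⊆ₚ
  open import Data.Vec as Vec using (Vec)
  import Data.Vec.Properties as Vecₚ
  open import Data.Product using (_,_; proj₁)
  open import Function using (_∘_)
  open ListCombinatorics
  open Labels
  open CommutativeRing A
  open Series A
  open Sums A
  open ProductSums A
  open IncreasingTrees d
  open Enumeration enum isE
  open import Relation.Binary.Reasoning.Setoid setoid

  atLeaf : ℕ → Carrier
  atLeaf zero    = h leaf
  atLeaf (suc k) = 0#

  treeEGF : Ser
  treeEGF k = atLeaf k + sumL (map h (enum k))

  branchProduct : DTree d → Carrier
  branchProduct leaf       = 0#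
  branchProduct (node m v) = prodVec (Vec.map (h ∘ std) v)

  treesOn-treeEGF : ∀ j K → j ≤ K → sumL (map h (treesOn K (oneTo j))) ≈ treeEGF j
  treesOn-treeEGF zero    K _   = +-congˡ (reflexive (≡.cong (λ z → sumL (map h z)) (≡.sym enum-0)))
  treesOn-treeEGF (suc j) K j≤K = trans (sym (sumL-↭ h (enum↭treesOn (suc j) K j≤K (s≤s z≤n)))) (sym (+-identityˡ _))

  -- Removing the root splits the labels 2, …, n+1 among the d branches.
  root-decomposition : ∀ n → sumL (map branchProduct (enum (suc n))) ≈ powS treeEGF d n
  root-decomposition n = begin
    sumL (map branchProduct (enum (suc n)))
      ≈⟨ sumL-↭ branchProduct (enum↭treesOn (suc n) (suc n) ℕₚ.≤-refl (s≤s z≤n)) ⟩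
    sumL (map branchProduct (treesOn (suc n) (oneTo (suc n))))
      ≡⟨ ≡.cong (λ z → sumL (map branchProduct (treesOn (suc n) z))) (oneTo-suc n) ⟩
    sumL (map branchProduct (concatMap rooted (splitsInto d rest)))
      ≈⟨ sumL-concatMap branchProduct rooted (splitsInto d rest) ⟩
    sumL (map (λ σ → sumL (map branchProduct (rooted σ))) (splitsInto d rest))
      ≈⟨ sumL-cong∈ (splitsInto d rest) (λ {σ} mσ →
           trans (reflexive (sumL-map branchProduct (node 1) (choices (Vec.map (treesOn n) σ))))
           (trans (choices-sum (Vec.map (treesOn n) σ) (h ∘ std))
           (trans (reflexive (≡.cong prodVec (≡.sym (Vecₚ.map-∘ (λ l → sumL (map (h ∘ std) l)) (treesOn n) σ))))
                  (prodVec-cong σ (proj₁ (splitsInto-sound d rest mσ)) branchSum)))) ⟩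
    sumL (map (λ σ → prodVec (Vec.map (treeEGF ∘ length) σ)) (splitsInto d rest))
      ≈⟨ splitsInto-sum d rest treeEGF ⟩
    powS treeEGF d (length rest)
      ≡⟨ ≡.cong (powS treeEGF d) rest-length ⟩
    powS treeEGF d n
      ∎
    where
    rest = map suc (oneTo n)
    rest-length : length rest ≡ n
    rest-length = ≡.trans (Listₚ.length-map suc (oneTo n)) (oneTo-length n)
    rooted : Vec (List ℕ) d → List (DTree d)
    rooted σ = map (node 1) (choices (Vec.map (treesOn n) σ))
    branchSum : ∀ {S} → S ⊆ rest → sumL (map (h ∘ std) (treesOn n S)) ≈ treeEGF (length S)
    branchSum {S} s = begin
      sumL (map (h ∘ std) (treesOn n S))        ≡⟨ sumL-map h std (treesOn n S) ⟨
      sumL (map h (map std (treesOn n S)))      ≡⟨ ≡.cong (λ z → sumL (map h z)) (treesOn-std n S (AllPairs-resp-⊆ s (map-suc-< (oneTo-< n)))) ⟩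
      sumL (map h (treesOn n (oneTo (length S)))) ≈⟨ treesOn-treeEGF (length S) n (≡.subst (length S ≤_) rest-length (⊆ₚ.length-mono-≤ s)) ⟩
      treeEGF (length S)                        ∎

module AdditiveFunctional {c ℓ} (R : CommutativeRing c ℓ) (d : ℕ)
                          (f : DTree d → CommutativeRing.Carrier R) (μ : CommutativeRing.Carrier R)
                          (enum : ℕ → List (DTree d)) where
  import Data.List.Properties as Listₚ
  open import Data.Vec as Vec using (Vec; []; _∷_)
  open import Function using (_∘_)
  open CommutativeRing R
  open Series R
  open Sums R
  open Main R d f μ enum
  open import Algebra.Properties.AbelianGroup +-abelianGroup using (⁻¹-∙-comm; ε⁻¹≈ε)
  open import Algebra.Properties.CommutativeSemigroup +-commutativeSemigroup using (interchange)
  open import Relation.Binary.Reasoning.Setoid setoid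

  mutual
    labels-mapLabels : ∀ (φ : ℕ → ℕ) t → labels (mapLabels φ t) ≡ map φ (labels t)
    labels-mapLabels φ leaf       = ≡.refl
    labels-mapLabels φ (node m w) = ≡.cong (φ m ∷_) (labelsV-mapLabelsV φ w)

    labelsV-mapLabelsV : ∀ (φ : ℕ → ℕ) {k} (w : Vec (DTree d) k) → labelsV (mapLabelsV φ w) ≡ map φ (labelsV w)
    labelsV-mapLabelsV φ []      = ≡.refl
    labelsV-mapLabelsV φ (t ∷ w) =
      ≡.trans (≡.cong₂ _++_ (labels-mapLabels φ t) (labelsV-mapLabelsV φ w)) (≡.sym (Listₚ.map-++ φ (labels t) (labelsV w)))

  size-std : ∀ t → size (std t) ≡ size t
  size-std t = ≡.trans (≡.cong length (labels-mapLabels _ t)) (Listₚ.length-map _ (labels t))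

  sizeV : ∀ {k} → Vec (DTree d) k → ℕ
  sizeV w = length (labelsV w)

  size-head≤ : ∀ t {j} (w : Vec (DTree d) j) → size (std t) ≤ sizeV (t ∷ w)
  size-head≤ t w = ≡.subst₂ _≤_ (≡.sym (size-std t)) (≡.sym (Listₚ.length-++ (labels t))) (ℕₚ.m≤m+n _ _)

  size-tail≤ : ∀ t {j} (w : Vec (DTree d) j) → sizeV w ≤ sizeV (t ∷ w)
  size-tail≤ t w = ≡.subst (sizeV w ≤_) (≡.sym (Listₚ.length-++ (labels t))) (ℕₚ.m≤n+m _ _)

  mutual
    Ff-fuel : ∀ k k' T → size T ≤ k → size T ≤ k' → Ff k T ≡ Ff k' T
    Ff-fuel zero    zero     T          _       _        = ≡.refl
    Ff-fuel zero    (suc k') leaf       _       _        = ≡.refl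
    Ff-fuel (suc k) zero     leaf       _       _        = ≡.refl
    Ff-fuel (suc k) (suc k') leaf       _       _        = ≡.refl
    Ff-fuel (suc k) (suc k') (node m w) (s≤s le) (s≤s le') = ≡.cong (_+ f (node m w)) (FfV-fuel k k' w le le')

    FfV-fuel : ∀ k k' {j} (w : Vec (DTree d) j) → sizeV w ≤ k → sizeV w ≤ k' → FfV k w ≡ FfV k' w
    FfV-fuel k k' []      _  _   = ≡.refl
    FfV-fuel k k' (t ∷ w) le le' = ≡.cong₂ _+_
      (Ff-fuel k k' (std t) (ℕₚ.≤-trans (size-head≤ t w) le) (ℕₚ.≤-trans (size-head≤ t w) le'))
      (FfV-fuel k k' w (ℕₚ.≤-trans (size-tail≤ t w) le) (ℕₚ.≤-trans (size-tail≤ t w) le'))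

  sumVec : ∀ {k} → Vec Carrier k → Carrier
  sumVec []      = 0#
  sumVec (x ∷ v) = x + sumVec v

  FfV≈sum : ∀ k {j} (w : Vec (DTree d) j) → sizeV w ≤ k → FfV k w ≈ sumVec (Vec.map (F ∘ std) w)
  FfV≈sum k []      _  = refl
  FfV≈sum k (t ∷ w) le = +-cong (reflexive (Ff-fuel k (size (std t)) (std t) (ℕₚ.≤-trans (size-head≤ t w) le) ℕₚ.≤-refl))
                                (FfV≈sum k w (ℕₚ.≤-trans (size-tail≤ t w) le))

  F-node : ∀ m (w : Vec (DTree d) d) → F (node m w) ≈ sumVec (Vec.map (F ∘ std) w) + f (node m w)
  F-node m w = +-congʳ (FfV≈sum (sizeV w) w ℕₚ.≤-refl)

  sizeV≈sum : ∀ {j} (w : Vec (DTree d) j) → natR (sizeV w) ≈ sumVec (Vec.map (natR ∘ size ∘ std) w)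
  sizeV≈sum []      = refl
  sizeV≈sum (t ∷ w) = trans (reflexive (≡.cong natR (Listₚ.length-++ (labels t))))
    (trans (natR-+ (size t) (sizeV w)) (+-cong (reflexive (≡.cong natR (≡.sym (size-std t)))) (sizeV≈sum w)))

  Fμ : DTree d → Carrier
  Fμ T = F T - natR (size T) * μ

  Fμ-leaf : Fμ leaf ≈ 0#
  Fμ-leaf = trans (+-congˡ (trans (-‿cong (zeroˡ μ)) ε⁻¹≈ε)) (+-identityʳ 0#)

  sumVec-Fμ : ∀ {j} (w : Vec (DTree d) j) →
    sumVec (Vec.map (Fμ ∘ std) w) ≈ sumVec (Vec.map (F ∘ std) w) - sumVec (Vec.map (natR ∘ size ∘ std) w) * μ
  sumVec-Fμ []      = sym (trans (+-congˡ (trans (-‿cong (zeroˡ μ)) ε⁻¹≈ε)) (+-identityʳ 0#))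
  sumVec-Fμ (t ∷ w) = begin
    (F (std t) - natR (size (std t)) * μ) + sumVec (Vec.map (Fμ ∘ std) w)
      ≈⟨ +-congˡ (sumVec-Fμ w) ⟩
    (F (std t) - natR (size (std t)) * μ) + (sumVec (Vec.map (F ∘ std) w) - sumVec (Vec.map (natR ∘ size ∘ std) w) * μ)
      ≈⟨ interchange _ _ _ _ ⟩
    (F (std t) + sumVec (Vec.map (F ∘ std) w)) + (- (natR (size (std t)) * μ) + - (sumVec (Vec.map (natR ∘ size ∘ std) w) * μ))
      ≈⟨ +-congˡ (trans (⁻¹-∙-comm _ _) (-‿cong (sym (distribʳ μ _ _)))) ⟩
    (F (std t) + sumVec (Vec.map (F ∘ std) w)) - (natR (size (std t)) + sumVec (Vec.map (natR ∘ size ∘ std) w)) * μ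
      ∎

  Fμ-node : ∀ m (w : Vec (DTree d) d) → Fμ (node m w) - f (node m w) ≈ sumVec (Vec.map (Fμ ∘ std) w) - μ
  Fμ-node m w = begin
    (F T - natR (suc (sizeV w)) * μ) - f T   ≈⟨ +-congʳ (+-cong (F-node m w) (-‿cong (*-congʳ (+-congˡ (sizeV≈sum w))))) ⟩
    ((ΣF + f T) - (1# + Σn) * μ) - f T       ≈⟨ cancel ΣF (f T) Σn ⟩
    (ΣF - Σn * μ) - μ                        ≈⟨ +-congʳ (sumVec-Fμ w) ⟨
    sumVec (Vec.map (Fμ ∘ std) w) - μ        ∎
    where
    T = node m w
    ΣF = sumVec (Vec.map (F ∘ std) w)
    Σn = sumVec (Vec.map (natR ∘ size ∘ std) w)
    cancel : ∀ a b n → ((a + b) - (1# + n) * μ) - b ≈ (a - n * μ) - μ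
    cancel a b n = begin
      ((a + b) - (1# + n) * μ) - b             ≈⟨ +-congʳ (+-congˡ (-‿cong (trans (distribʳ μ 1# n) (+-congʳ (*-identityˡ μ))))) ⟩
      ((a + b) - (μ + n * μ)) - b              ≈⟨ +-congʳ (+-congˡ (⁻¹-∙-comm μ (n * μ))) ⟨
      ((a + b) + (- μ - n * μ)) - b            ≈⟨ rearrange a b (- μ) (- (n * μ)) (- b) ⟩
      ((a - n * μ) - μ) + (b - b)              ≈⟨ +-congˡ (-‿inverseʳ b) ⟩
      ((a - n * μ) - μ) + 0#                   ≈⟨ +-identityʳ _ ⟩
      (a - n * μ) - μ                          ∎
      where
      open import Algebra.Solver.Ring.NaturalCoefficients.Default commutativeSemiring using (solve; _:+_; _:=_)
      rearrange : ∀ a b x y z → ((a + b) + (x + y)) + z ≈ ((a + y) + x) + (b + z)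
      rearrange = solve 5 (λ a b x y z → ((a :+ b) :+ (x :+ y)) :+ z := ((a :+ y) :+ x) :+ (b :+ z)) refl

module RootRecursion {c ℓ} (R : CommutativeRing c ℓ) (d : ℕ)
                     (f : DTree d → CommutativeRing.Carrier R) (μ : CommutativeRing.Carrier R)
                     (enum : ℕ → List (DTree d)) (isE : IsEnumeration enum) where
  open import Data.List.Membership.Propositional using (_∈_)
  open import Data.Vec as Vec using (Vec; []; _∷_)
  import Data.Vec.Properties as Vecₚ
  open import Data.Product using (_,_; proj₁; proj₂)
  open import Function using (_∘_)
  open CommutativeRing R
  open Series R
  open Sums R
  open SeriesRing R
  open Bivariate R
  open Main R d f μ enum
  open AdditiveFunctional R d f μ enum
  open IncreasingTrees.Enumeration d enum isE using (size-enum)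
  open import Relation.Binary.Reasoning.Setoid setoid

  -- Exponentiating F − μ|·| turns the sum over the branches into a product of series.
  module Branches = TreeSums seriesRing d enum isE (exp ∘ Fμ)
  open Branches using (branchProduct; treeEGF; root-decomposition)
  open ProductSums seriesRing using (prodVec)

  -- Z(x, a, 0) as a series in x and a; its coefficients in a are the Z⁽ˢ⁾.
  Zs : S₂.Ser
  Zs s = Zr s

  prodVec-exp : ∀ {k} (v : Vec Carrier k) → prodVec (Vec.map exp v) ≈S exp (sumVec v)
  prodVec-exp []      n = sym (exp-0 n)
  prodVec-exp (y ∷ v) n = trans (⊛-cong {exp y} (λ _ → refl) (prodVec-exp v) n) (exp-+ y (sumVec v) n)

  branchProduct-node : ∀ m (w : Vec (DTree d) d) → branchProduct (node m w) ≈S exp (sumVec (Vec.map (Fμ ∘ std) w))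
  branchProduct-node m w n =
    trans (reflexive (≡.cong (λ z → prodVec z n) (Vecₚ.map-∘ exp (Fμ ∘ std) w))) (prodVec-exp (Vec.map (Fμ ∘ std) w) n)

  swap-treeEGF : ∀ s k → swap treeEGF s k ≈ Zs s k
  swap-treeEGF s k = +-cong (atLeaf≈const1 s k)
    (begin
      S₂.sumL (map (exp ∘ Fμ) (enum k)) s          ≡⟨ sumL₂-coeff (map (exp ∘ Fμ) (enum k)) s ⟩
      sumL (map (λ X → X s) (map (exp ∘ Fμ) (enum k))) ≡⟨ sumL-map (λ X → X s) (exp ∘ Fμ) (enum k) ⟩
      sumL (map (λ B → pow (Fμ B) s) (enum k))
        ≈⟨ sumL-cong∈ (enum k) (λ {B} m → reflexive (≡.cong (λ z → pow (F B - natR z * μ) s) (size-enum k m))) ⟩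
      sumL (map (λ B → pow (F B - natR k * μ) s) (enum k)) ∎)
    where
    atLeaf≈const1 : ∀ s k → Branches.atLeaf k s ≈ const1 s k
    atLeaf≈const1 zero    zero    = refl
    atLeaf≈const1 (suc s) zero    = trans (*-congʳ Fμ-leaf) (zeroˡ _)
    atLeaf≈const1 zero    (suc k) = refl
    atLeaf≈const1 (suc s) (suc k) = refl

  sum-branchProduct : ∀ n s → sumL (map (λ T → branchProduct T s) (enum (suc n))) ≈ S₂.powS Zs d s n
  sum-branchProduct n s = begin
    sumL (map (λ T → branchProduct T s) (enum (suc n)))
      ≡⟨ ≡.trans (sumL₂-coeff (map branchProduct (enum (suc n))) s) (sumL-map (λ X → X s) branchProduct (enum (suc n))) ⟨
    S₂.sumL (map branchProduct (enum (suc n))) s      ≈⟨ root-decomposition n s ⟩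
    S₂.powS treeEGF d n s                              ≈⟨ swap-powS treeEGF d n s ⟩
    S₂.powS (swap treeEGF) d s n                       ≈⟨ R₂.powS-cong swap-treeEGF d s n ⟩
    S₂.powS Zs d s n                                   ∎

  pow-Fμ-f : ∀ n {T} → T ∈ enum (suc n) → ∀ r →
    pow ((F T - natR (suc n) * μ) - f T) r ≈ ∑ (suc r) (λ s → natR (r C s) * (branchProduct T s * pow (- μ) (r ∸ s)))
  pow-Fμ-f n {T} m r with T | proj₁ (proj₁ (proj₂ isE (suc n) T) m) | size-enum (suc n) m
  ... | leaf     | () | _
  ... | node x w | _  | size≡ = begin
    pow ((F (node x w) - natR (suc n) * μ) - f (node x w)) r
      ≈⟨ pow-cong r (trans (+-congʳ (+-congˡ (-‿cong (*-congʳ (reflexive (≡.cong natR (≡.sym size≡))))))) (Fμ-node x w)) ⟩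
    pow (sumVec (Vec.map (Fμ ∘ std) w) - μ) r
      ≈⟨ binomial _ (- μ) r ⟩
    ∑ (suc r) (λ s → natR (r C s) * (pow (sumVec (Vec.map (Fμ ∘ std) w)) s * pow (- μ) (r ∸ s)))
      ≈⟨ ∑-cong (suc r) (λ s → *-congˡ (*-congʳ (sym (branchProduct-node x w s)))) ⟩
    ∑ (suc r) (λ s → natR (r C s) * (branchProduct (node x w) s * pow (- μ) (r ∸ s)))
      ∎

  Zr-recursion : ∀ r n → Zr r (suc n) + H r n ≈ ∑ (suc r) (λ s → natR (r C s) * (S₂.powS Zs d s n * pow (- μ) (r ∸ s)))
  Zr-recursion r n = begin
    Zr r (suc n) + H r n
      ≈⟨ +-cong (trans (+-congʳ (const1-suc r)) (+-identityˡ _)) (reflexive H≡∑) ⟩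
    sumL (map (λ T → pow (X T) r) L) + ∑ r (λ s → natR (r C suc s) * sumL (map (λ T → pow (X T) (r ∸ suc s) * pow (- f T) (suc s)) L))
      ≈⟨ +-cong (sumL-cong L (λ T → trans (sym (*-identityˡ _)) (*-cong (sym (natR-C0 r)) (sym (*-identityˡ _)))))
                (∑-cong r (λ s → trans (sumL-distribˡ _ _ L) (sumL-cong L (λ T → *-congˡ (*-comm _ _))))) ⟩
    sumL (map (λ T → g T 0) L) + ∑ r (λ s → sumL (map (λ T → g T (suc s)) L))
      ≈⟨ ∑-suc r _ ⟨
    ∑ (suc r) (λ s → sumL (map (λ T → g T s) L))
      ≈⟨ sumL-∑-comm L (suc r) g ⟨
    sumL (map (λ T → ∑ (suc r) (g T)) L)
      ≈⟨ sumL-cong L (λ T → trans (sym (binomial (- f T) (X T) r)) (pow-cong r (+-comm _ _))) ⟩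
    sumL (map (λ T → pow (X T - f T) r) L)
      ≈⟨ sumL-cong∈ L (λ m → pow-Fμ-f n m r) ⟩
    sumL (map (λ T → ∑ (suc r) (λ s → natR (r C s) * (branchProduct T s * pow (- μ) (r ∸ s)))) L)
      ≈⟨ sumL-∑-comm L (suc r) _ ⟩
    ∑ (suc r) (λ s → sumL (map (λ T → natR (r C s) * (branchProduct T s * pow (- μ) (r ∸ s))) L))
      ≈⟨ ∑-cong (suc r) (λ s → trans (sym (sumL-distribˡ _ _ L))
                                     (*-congˡ (trans (sym (sumL-distribʳ _ _ L)) (*-congʳ (sum-branchProduct n s))))) ⟩
    ∑ (suc r) (λ s → natR (r C s) * (S₂.powS Zs d s n * pow (- μ) (r ∸ s)))
      ∎
    where
    L = enum (suc n)
    X : DTree d → Carrier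
    X T = F T - natR (suc n) * μ
    g : DTree d → ℕ → Carrier
    g T s = natR (r C s) * (pow (- f T) s * pow (X T) (r ∸ s))
    const1-suc : ∀ r → const1 r (suc n) ≈ 0#
    const1-suc zero    = refl
    const1-suc (suc r) = refl
    H≡∑ : H r n ≡ ∑ r (λ s → natR (r C suc s) * sumL (map (λ T → pow (X T) (r ∸ suc s) * pow (- f T) (suc s)) L))
    H≡∑ = ≡.trans (sumL-map _ suc (upTo r)) (sumL-upTo r _)

  deriv-Z : deriv Z ≈S powS Z d
  deriv-Z n = begin
    Z (suc n)                                          ≈⟨ +-identityʳ _ ⟨
    Z (suc n) + H 0 n                                  ≈⟨ Zr-recursion 0 n ⟩
    ∑ 1 (λ s → natR (0 C s) * (S₂.powS Zs d s n * pow (- μ) (0 ∸ s)))  ≈⟨ ∑-singleton _ ⟩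
    natR 1 * (S₂.powS Zs d 0 n * 1#)                   ≈⟨ trans (*-congʳ natR-1) (trans (*-identityˡ _) (*-identityʳ _)) ⟩
    S₂.powS Zs d 0 n                                   ≈⟨ powS₂-coeff₀ Zs d n ⟩
    powS Z d n                                         ∎

  binomialCoeff : ℕ → ℕ → Carrier
  binomialCoeff r s = natR (r C s) * pow (- μ) (r ∸ s)

  deriv-Zr : ∀ r → deriv (Zr r) ≈S (neg (H r) ⊕ Σ₂.∑ (suc r) (λ s → scale (binomialCoeff r s) (S₂.powS Zs d s)))
  deriv-Zr r n = begin
    Zr r (suc n)                                                           ≈⟨ +-identityʳ _ ⟨
    Zr r (suc n) + 0#                                                      ≈⟨ +-congˡ (-‿inverseʳ (H r n)) ⟨
    Zr r (suc n) + (H r n - H r n)                                         ≈⟨ +-assoc _ _ _ ⟨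
    (Zr r (suc n) + H r n) - H r n                                         ≈⟨ +-congʳ (Zr-recursion r n) ⟩
    ∑ (suc r) (λ s → natR (r C s) * (S₂.powS Zs d s n * pow (- μ) (r ∸ s))) - H r n
      ≈⟨ +-comm _ _ ⟩
    - H r n + ∑ (suc r) (λ s → natR (r C s) * (S₂.powS Zs d s n * pow (- μ) (r ∸ s)))
      ≈⟨ +-congˡ (∑-cong (suc r) (λ s → trans (*-congˡ (*-comm _ _)) (sym (*-assoc _ _ _)))) ⟩
    - H r n + ∑ (suc r) (λ s → binomialCoeff r s * S₂.powS Zs d s n)       ≈⟨ +-congˡ (∑₂-coeff (suc r) _ n) ⟨
    - H r n + Σ₂.∑ (suc r) (λ s → scale (binomialCoeff r s) (S₂.powS Zs d s)) n ∎

module PartitionCoefficients where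
  open import Data.Nat using (_+_; _*_; _∸_; _^_; _≤_; _<_; s≤s; _!; NonZero)
  open import Data.Nat.Properties
  open import Data.Nat.Combinatorics using (_C_; k![n∸k]!∣n!; k>n⇒nCk≡0)
  open import Data.Nat.Combinatorics.Specification using (nCk≡n!/k![n-k]!)
  open import Data.Nat.DivMod using (_/_; m/n*n≡m; m*n/n≡m)
  open import Data.Nat.Divisibility using (_∣_; divides)
  open import Data.Nat.ListAction using (sum)
  open import Data.Sum using (inj₁; inj₂)
  open import Relation.Nullary using (yes; no)
  open import Data.Nat.Solver using (module +-*-Solver)
  open +-*-Solver
  open ≡.≡-Reasoning

  nCk*k!*[n∸k]!≡n! : ∀ {n k} → k ≤ n → (n C k) * (k ! * (n ∸ k) !) ≡ n !
  nCk*k!*[n∸k]!≡n! {n} {k} k≤n = ≡.trans (≡.cong (_* (k ! * (n ∸ k) !)) (nCk≡n!/k![n-k]! k≤n))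
                                (m/n*n≡m {{k !* (n ∸ k) !≢0}} (k![n∸k]!∣n! k≤n))

  falling*[n∸k]!≡n! : ∀ n k → k ≤ n → falling n k * (n ∸ k) ! ≡ n !
  falling*[n∸k]!≡n! n zero _ = +-identityʳ (n !)
  falling*[n∸k]!≡n! n (suc k) sk≤n = begin
    (n ∸ k) * falling n k * (n ∸ suc k) !
      ≡⟨ ≡.cong (λ z → z * falling n k * (n ∸ suc k) !) e ⟩
    suc (n ∸ suc k) * falling n k * (n ∸ suc k) !
      ≡⟨ solve 3 (λ a b c → (con 1 :+ a) :* b :* c := b :* ((con 1 :+ a) :* c)) ≡.refl (n ∸ suc k) (falling n k) ((n ∸ suc k) !) ⟩
    falling n k * (suc (n ∸ suc k) !)
      ≡⟨ ≡.cong (λ z → falling n k * (z !)) (≡.sym e) ⟩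
    falling n k * (n ∸ k) !
      ≡⟨ falling*[n∸k]!≡n! n k (<⇒≤ sk≤n) ⟩
    n ! ∎
    where
    e : n ∸ k ≡ suc (n ∸ suc k)
    e = +-∸-assoc 1 sk≤n

  k>n⇒falling≡0 : ∀ n k → n < k → falling n k ≡ 0
  k>n⇒falling≡0 n (suc k) (s≤s n≤k) with m≤n⇒m<n∨m≡n n≤k
  ... | inj₁ n<k = ≡.trans (≡.cong ((n ∸ k) *_) (k>n⇒falling≡0 n k n<k)) (*-zeroʳ (n ∸ k))
  ... | inj₂ ≡.refl = ≡.cong (_* falling n n) (n∸n≡0 n)

  nCk*k!≡falling : ∀ n k → (n C k) * k ! ≡ falling n k
  nCk*k!≡falling n k with k ≤? n
  ... | yes k≤n = *-cancelʳ-≡ _ _ ((n ∸ k) !) {{(n ∸ k) !≢0}} (begin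
      (n C k) * k ! * (n ∸ k) !
        ≡⟨ *-assoc (n C k) (k !) _ ⟩
      (n C k) * (k ! * (n ∸ k) !)
        ≡⟨ nCk*k!*[n∸k]!≡n! k≤n ⟩
      n !
        ≡⟨ ≡.sym (falling*[n∸k]!≡n! n k k≤n) ⟩
      falling n k * (n ∸ k) ! ∎)
  ... | no k≰n = ≡.trans (≡.cong (_* k !) (k>n⇒nCk≡0 (≰⇒> k≰n))) (≡.sym (k>n⇒falling≡0 n k (≰⇒> k≰n)))

  falling-+ : ∀ n x m → falling n (x + m) ≡ falling n x * falling (n ∸ x) m
  falling-+ n x zero = ≡.trans (≡.cong (falling n) (+-identityʳ x)) (≡.sym (*-identityʳ _))
  falling-+ n x (suc m) = begin
    falling n (x + suc m)
      ≡⟨ ≡.cong (falling n) (+-suc x m) ⟩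
    (n ∸ (x + m)) * falling n (x + m)
      ≡⟨ ≡.cong₂ _*_ (≡.sym (∸-+-assoc n x m)) (falling-+ n x m) ⟩
    (n ∸ x ∸ m) * (falling n x * falling (n ∸ x) m)
      ≡⟨ solve 3 (λ a b c → a :* (b :* c) := b :* (a :* c)) ≡.refl (n ∸ x ∸ m) (falling n x) (falling (n ∸ x) m) ⟩
    falling n x * ((n ∸ x ∸ m) * falling (n ∸ x) m) ∎

  -- orderedBlocks j x = (jx)!/(j!)ˣ and blocks j x = (jx)!/(x! (j!)ˣ), as products of binomial coefficients.
  orderedBlocks : ℕ → ℕ → ℕ
  orderedBlocks j zero = 1
  orderedBlocks j (suc x) = ((j * suc x) C j) * orderedBlocks j x

  j!^x*orderedBlocks≡[j*x]! : ∀ j x → (j !) ^ x * orderedBlocks j x ≡ (j * x) !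
  j!^x*orderedBlocks≡[j*x]! j zero = ≡.cong _! (≡.sym (*-zeroʳ j))
  j!^x*orderedBlocks≡[j*x]! j (suc x) = begin
    j ! * (j !) ^ x * (((j * suc x) C j) * orderedBlocks j x)
      ≡⟨ solve 4 (λ a b c e → a :* b :* (c :* e) := c :* (a :* (b :* e))) ≡.refl (j !) ((j !) ^ x) ((j * suc x) C j) (orderedBlocks j x) ⟩
    ((j * suc x) C j) * (j ! * ((j !) ^ x * orderedBlocks j x))
      ≡⟨ ≡.cong (λ z → ((j * suc x) C j) * (j ! * z)) (j!^x*orderedBlocks≡[j*x]! j x) ⟩
    ((j * suc x) C j) * (j ! * (j * x) !)
      ≡⟨ ≡.cong (λ z → ((j * suc x) C j) * (j ! * z !)) e ⟩
    ((j * suc x) C j) * (j ! * (j * suc x ∸ j) !)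
      ≡⟨ nCk*k!*[n∸k]!≡n! le ⟩
    (j * suc x) ! ∎
    where
    e : j * x ≡ j * suc x ∸ j
    e = ≡.sym (≡.trans (≡.cong (_∸ j) (*-suc j x)) (m+n∸m≡n j (j * x)))
    le : j ≤ j * suc x
    le = ≡.subst (j ≤_) (≡.sym (*-suc j x)) (m≤m+n j (j * x))

  blocks : ℕ → ℕ → ℕ
  blocks j zero = 1
  blocks j (suc x) = (((j * suc x) ∸ 1) C (j ∸ 1)) * blocks j x

  blocks*[x!*j!^x]≡[j*x]! : ∀ j' x → blocks (suc j') x * (x ! * (suc j' !) ^ x) ≡ (suc j' * x) !
  blocks*[x!*j!^x]≡[j*x]! j' zero = ≡.cong _! (≡.sym (*-zeroʳ (suc j')))
  blocks*[x!*j!^x]≡[j*x]! j' (suc x) = begin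
    ((q C j') * blocks j x) * ((suc x * x !) * (j ! * (j !) ^ x))
      ≡⟨ solve 6 (λ a m sx xf jf jp → (a :* m) :* ((sx :* xf) :* (jf :* jp)) := (a :* sx :* jf) :* (m :* (xf :* jp))) ≡.refl (q C j') (blocks j x) (suc x) (x !) (j !) ((j !) ^ x) ⟩
    ((q C j') * suc x * j !) * (blocks j x * (x ! * (j !) ^ x))
      ≡⟨ ≡.cong (((q C j') * suc x * j !) *_) (blocks*[x!*j!^x]≡[j*x]! j' x) ⟩
    ((q C j') * suc x * (suc j' * j' !)) * (j * x) !
      ≡⟨ solve 5 (λ a sx sj jf f → (a :* sx :* (sj :* jf)) :* f := (sj :* sx) :* (a :* (jf :* f))) ≡.refl (q C j') (suc x) (suc j') (j' !) ((j * x) !) ⟩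
    (suc j' * suc x) * ((q C j') * (j' ! * (j * x) !))
      ≡⟨ ≡.cong (λ z → (suc j' * suc x) * ((q C j') * (j' ! * z !))) (≡.sym (≡.trans (≡.cong (_∸ j') qe) (m+n∸m≡n j' (j * x)))) ⟩
    (suc j' * suc x) * ((q C j') * (j' ! * (q ∸ j') !))
      ≡⟨ ≡.cong ((suc j' * suc x) *_) (nCk*k!*[n∸k]!≡n! (≡.subst (j' ≤_) (≡.sym qe) (m≤m+n j' (j * x)))) ⟩
    (suc j' * suc x) * q !
      ≡⟨ ≡.cong (_* q !) e ⟩
    suc q * q ! ∎
    where
    j = suc j'
    q = (j * suc x) ∸ 1
    qe : q ≡ j' + j * x
    qe = ≡.cong (_∸ 1) (*-suc j x)
    e : suc j' * suc x ≡ suc q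
    e = ≡.trans (*-suc (suc j') x) (≡.cong suc (≡.sym qe))

  orderedBlocks≡x!*blocks : ∀ j' x → orderedBlocks (suc j') x ≡ x ! * blocks (suc j') x
  orderedBlocks≡x!*blocks j' x = *-cancelˡ-≡ _ _ ((suc j' !) ^ x) {{m^n≢0 (suc j' !) x {{suc j' !≢0}}}} (begin
    (suc j' !) ^ x * orderedBlocks (suc j') x
      ≡⟨ j!^x*orderedBlocks≡[j*x]! (suc j') x ⟩
    (suc j' * x) !
      ≡⟨ ≡.sym (blocks*[x!*j!^x]≡[j*x]! j' x) ⟩
    blocks (suc j') x * (x ! * (suc j' !) ^ x)
      ≡⟨ solve 3 (λ m a b → m :* (a :* b) := b :* (a :* m)) ≡.refl (blocks (suc j') x) (x !) ((suc j' !) ^ x) ⟩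
    (suc j' !) ^ x * (x ! * blocks (suc j') x) ∎)

  -- For ℓ = (ℓⱼ, ℓⱼ₊₁, …) of weight w: d!/(d − |ℓ|)! · w!/∏ᵢ ℓᵢ! (i!)^ℓᵢ, built one multiplicity at a time.
  partitionCoeff : ℕ → ℕ → List ℕ → ℕ
  partitionCoeff j d [] = 1
  partitionCoeff j d (x ∷ xs) = falling d x * blocks j x * ((weightFrom j (x ∷ xs)) C (j * x)) * partitionCoeff (suc j) (d ∸ x) xs

  denom*partitionCoeff : ∀ j' d xs → denomFrom (suc j') xs * partitionCoeff (suc j') d xs ≡ falling d (sum xs) * (weightFrom (suc j') xs) !
  denom*partitionCoeff j' d [] = ≡.refl
  denom*partitionCoeff j' d (x ∷ xs) = begin
    (x ! * (j !) ^ x * D') * (falling d x * blocks j x * (s C (j * x)) * Q)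
      ≡⟨ solve 7 (λ xf jp d' fa m c q → (xf :* jp :* d') :* (fa :* m :* c :* q) := fa :* (m :* (xf :* jp)) :* c :* (d' :* q)) ≡.refl
           (x !) ((j !) ^ x) D' (falling d x) (blocks j x) (s C (j * x)) Q ⟩
    falling d x * (blocks j x * (x ! * (j !) ^ x)) * (s C (j * x)) * (D' * Q)
      ≡⟨ ≡.cong₂ (λ a b → falling d x * a * (s C (j * x)) * b) (blocks*[x!*j!^x]≡[j*x]! j' x) (denom*partitionCoeff (suc j') (d ∸ x) xs) ⟩
    falling d x * (j * x) ! * (s C (j * x)) * (falling (d ∸ x) (sum xs) * w !)
      ≡⟨ solve 5 (λ fa f c fb wf → fa :* f :* c :* (fb :* wf) := (fa :* fb) :* (c :* (f :* wf))) ≡.refl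
           (falling d x) ((j * x) !) (s C (j * x)) (falling (d ∸ x) (sum xs)) (w !) ⟩
    (falling d x * falling (d ∸ x) (sum xs)) * ((s C (j * x)) * ((j * x) ! * w !))
      ≡⟨ ≡.cong₂ _*_ (≡.sym (falling-+ d x (sum xs))) (≡.trans (≡.cong (λ z → (s C (j * x)) * ((j * x) ! * z !)) (≡.sym (m+n∸m≡n (j * x) w))) (nCk*k!*[n∸k]!≡n! (m≤m+n (j * x) w))) ⟩
    falling d (x + sum xs) * s ! ∎
    where
    j = suc j'
    w = weightFrom (suc j) xs
    s = j * x + w
    D' = denomFrom (suc j) xs
    Q = partitionCoeff (suc j) (d ∸ x) xs

  denom∣weight! : ∀ j' xs → denomFrom (suc j') xs ∣ (weightFrom (suc j') xs) !
  denom∣weight! j' [] = divides 1 ≡.refl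
  denom∣weight! j' (x ∷ xs) with denom∣weight! (suc j') xs
  ... | divides q eq = divides ((s C (j * x)) * blocks j x * q) (begin
    s !
      ≡⟨ ≡.sym (nCk*k!*[n∸k]!≡n! (m≤m+n (j * x) w)) ⟩
    (s C (j * x)) * ((j * x) ! * (s ∸ (j * x)) !)
      ≡⟨ ≡.cong (λ z → (s C (j * x)) * ((j * x) ! * z !)) (m+n∸m≡n (j * x) w) ⟩
    (s C (j * x)) * ((j * x) ! * w !)
      ≡⟨ ≡.cong₂ (λ a b → (s C (j * x)) * (a * b)) (≡.sym (blocks*[x!*j!^x]≡[j*x]! j' x)) eq ⟩
    (s C (j * x)) * (blocks j x * (x ! * (j !) ^ x) * (q * D'))
      ≡⟨ solve 6 (λ c m xf jp q' d' → c :* (m :* (xf :* jp) :* (q' :* d')) := c :* m :* q' :* (xf :* jp :* d')) ≡.refl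
           (s C (j * x)) (blocks j x) (x !) ((j !) ^ x) q D' ⟩
    (s C (j * x)) * blocks j x * q * (x ! * (j !) ^ x * D') ∎)
    where
    j = suc j'
    w = weightFrom (suc j) xs
    s = j * x + w
    D' = denomFrom (suc j) xs

  denom-nonZero : ∀ j xs → NonZero (denomFrom j xs)
  denom-nonZero j [] = _
  denom-nonZero j (x ∷ xs) = m*n≢0 (x ! * (j !) ^ x) (denomFrom (suc j) xs)
    {{m*n≢0 (x !) ((j !) ^ x) {{x !≢0}} {{m^n≢0 (j !) x {{j !≢0}}}}}} {{denom-nonZero (suc j) xs}}

  divN≡/ : ∀ m n .{{_ : NonZero n}} → divN m n ≡ m / n
  divN≡/ m (suc n) = ≡.refl

  falling*divN≡partitionCoeff : ∀ d xs → falling d (sum xs) * divN ((weightFrom 1 xs) !) (denomFrom 1 xs) ≡ partitionCoeff 1 d xs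
  falling*divN≡partitionCoeff d xs with denom∣weight! 0 xs
  ... | divides q s!≡q*D = begin
    falling d (sum xs) * divN (s !) D   ≡⟨ ≡.cong (falling d (sum xs) *_) divN≡q ⟩
    falling d (sum xs) * q              ≡⟨ *-cancelˡ-≡ _ _ D D*[falling*q]≡D*coeff ⟩
    partitionCoeff 1 d xs               ∎
    where
    s = weightFrom 1 xs
    D = denomFrom 1 xs
    instance _ = denom-nonZero 1 xs
    divN≡q : divN (s !) D ≡ q
    divN≡q = ≡.trans (divN≡/ (s !) D) (≡.trans (≡.cong (_/ D) s!≡q*D) (m*n/n≡m q D))
    D*[falling*q]≡D*coeff : D * (falling d (sum xs) * q) ≡ D * partitionCoeff 1 d xs
    D*[falling*q]≡D*coeff = begin
      D * (falling d (sum xs) * q)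
        ≡⟨ solve 3 (λ a b c → a :* (b :* c) := b :* (c :* a)) ≡.refl D (falling d (sum xs)) q ⟩
      falling d (sum xs) * (q * D)
        ≡⟨ ≡.cong (falling d (sum xs) *_) (≡.sym s!≡q*D) ⟩
      falling d (sum xs) * s !
        ≡⟨ ≡.sym (denom*partitionCoeff 0 d xs) ⟩
      D * partitionCoeff 1 d xs ∎

  tail-coeff : ∀ j' d s x → (d C x) * (s C (suc j' * x)) * orderedBlocks (suc j') x ≡ falling d x * blocks (suc j') x * (s C (suc j' * x))
  tail-coeff j' d s x = begin
    (d C x) * (s C (j * x)) * orderedBlocks j x
      ≡⟨ ≡.cong ((d C x) * (s C (j * x)) *_) (orderedBlocks≡x!*blocks j' x) ⟩
    (d C x) * (s C (j * x)) * (x ! * blocks j x)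
      ≡⟨ solve 4 (λ a b f m → a :* b :* (f :* m) := a :* f :* m :* b) ≡.refl (d C x) (s C (j * x)) (x !) (blocks j x) ⟩
    (d C x) * x ! * blocks j x * (s C (j * x))
      ≡⟨ ≡.cong (λ z → z * blocks j x * (s C (j * x))) (nCk*k!≡falling d x) ⟩
    falling d x * blocks j x * (s C (j * x)) ∎
    where
    j = suc j'

module Monomials {c ℓ} (K : CommutativeRing c ℓ) where
  open import Data.Bool using (if_then_else_)
  open import Data.Sum using (inj₁; inj₂)
  open import Relation.Nullary using (Dec; yes; no; does; ¬_)
  open import Relation.Nullary.Decidable using (dec-true; dec-false)
  open CommutativeRing K
  open Series K
  open Sums K
  open SeriesRing K
  open PartitionCoefficients using (orderedBlocks)
  open import Algebra.Properties.CommutativeSemigroup *-commutativeSemigroup using (x∙yz≈y∙xz)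
  open import Relation.Binary.Reasoning.Setoid setoid

  if-intro : ∀ {P : Set} (q : Dec P) {L X} → (P → L ≈ X) → (¬ P → L ≈ 0#) → L ≈ (if does q then X else 0#)
  if-intro (yes p) f g = f p
  if-intro (no ¬p) f g = g ¬p

  if-vanish : ∀ {P : Set} (q : Dec P) {X} → (P → X ≈ 0#) → (if does q then X else 0#) ≈ 0#
  if-vanish q f = sym (if-intro q (λ p → sym (f p)) (λ _ → refl))

  *-if : ∀ {P : Set} (q : Dec P) x {X} → x * (if does q then X else 0#) ≈ (if does q then x * X else 0#)
  *-if (yes _) x = refl
  *-if (no _)  x = zeroʳ x

  if-cong : ∀ {P : Set} (q : Dec P) {X Y} → (P → X ≈ Y) → (if does q then X else 0#) ≈ (if does q then Y else 0#)
  if-cong (yes p) f = f p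
  if-cong (no _)  f = refl

  onlyAt : ℕ → ℕ → Carrier → Carrier
  onlyAt i p w = if does (i ≟ p) then w else 0#

  onlyAt-≡ : ∀ p w → onlyAt p p w ≡ w
  onlyAt-≡ p w rewrite dec-true (p ≟ p) ≡.refl = ≡.refl

  onlyAt-≢ : ∀ {i p} w → i ≢ p → onlyAt i p w ≡ 0#
  onlyAt-≢ {i} {p} w i≢p rewrite dec-false (i ≟ p) i≢p = ≡.refl

  -- monomial p w = w xᵖ/p!
  monomial : ℕ → Carrier → Ser
  monomial p w i = onlyAt i p w

  ∑-single : ∀ n (g : ℕ → Carrier) {p} → p < n → (∀ k → k ≢ p → g k ≈ 0#) → ∑ n g ≈ g p
  ∑-single (suc n) g {p} p<1+n z with ℕₚ.m≤n⇒m<n∨m≡n (ℕₚ.≤-pred p<1+n)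
  ... | inj₁ p<n    = trans (∑-last n g) (trans (+-cong (∑-single n g p<n z) (z n (ℕₚ.>⇒≢ p<n))) (+-identityʳ _))
  ... | inj₂ ≡.refl = trans (∑-last p g) (trans (+-congʳ (∑-vanish< p g (λ k k<p → z k (ℕₚ.<⇒≢ k<p)))) (+-identityˡ _))

  monomial-⊛-≤ : ∀ {p i} w U → p ≤ i → (monomial p w ⊛ U) i ≈ natR (i C p) * (w * U (i ∸ p))
  monomial-⊛-≤ {p} {i} w U p≤i = begin
    (monomial p w ⊛ U) i                                           ≈⟨ ⊛-coeff (monomial p w) U i ⟩
    ∑ (suc i) (λ k → natR (i C k) * (monomial p w k * U (i ∸ k)))   ≈⟨ ∑-single (suc i) _ (s≤s p≤i) off ⟩
    natR (i C p) * (onlyAt p p w * U (i ∸ p))                      ≡⟨ ≡.cong (λ z → natR (i C p) * (z * U (i ∸ p))) (onlyAt-≡ p w) ⟩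
    natR (i C p) * (w * U (i ∸ p))                                 ∎
    where
    off : ∀ k → k ≢ p → natR (i C k) * (monomial p w k * U (i ∸ k)) ≈ 0#
    off k k≢p = trans (*-congˡ (trans (*-congʳ (reflexive (onlyAt-≢ w k≢p))) (zeroˡ _))) (zeroʳ _)

  monomial-⊛-> : ∀ {p i} w U → i < p → (monomial p w ⊛ U) i ≈ 0#
  monomial-⊛-> {p} {i} w U i<p = trans (⊛-coeff (monomial p w) U i) (∑-vanish< (suc i) _ off)
    where
    off : ∀ k → k < suc i → natR (i C k) * (monomial p w k * U (i ∸ k)) ≈ 0#
    off k k≤i = trans (*-congˡ (trans (*-congʳ (reflexive (onlyAt-≢ {k} {p} w (λ { ≡.refl → ℕₚ.<⇒≱ i<p (ℕₚ.≤-pred k≤i) })))) (zeroˡ _))) (zeroʳ _)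

  powS-monomial : ∀ j w x → powS (monomial j w) x ≈S monomial (j ℕ.* x) (natR (orderedBlocks j x) * pow w x)
  powS-monomial j w zero i rewrite ℕₚ.*-zeroʳ j with i
  ... | zero  = sym (trans (*-congʳ natR-1) (*-identityˡ 1#))
  ... | suc _ = refl
  powS-monomial j w (suc x) i = trans (⊛-cong {monomial j w} {B = powS (monomial j w) x} (λ _ → refl) (powS-monomial j w x) i) coeff
    where
    J = j ℕ.* suc x
    w̃ = natR (orderedBlocks j x) * pow w x
    J≡j+jx : J ≡ j ℕ.+ j ℕ.* x
    J≡j+jx = ℕₚ.*-suc j x
    coeff : (monomial j w ⊛ monomial (j ℕ.* x) w̃) i ≈ monomial J (natR (orderedBlocks j (suc x)) * pow w (suc x)) i
    coeff with i ≟ J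
    ... | yes ≡.refl = begin
      (monomial j w ⊛ monomial (j ℕ.* x) w̃) J
        ≈⟨ monomial-⊛-≤ w (monomial (j ℕ.* x) w̃) (≡.subst (j ≤_) (≡.sym J≡j+jx) (ℕₚ.m≤m+n j (j ℕ.* x))) ⟩
      natR (J C j) * (w * onlyAt (J ∸ j) (j ℕ.* x) w̃)
        ≡⟨ ≡.cong (λ z → natR (J C j) * (w * z))
             (≡.trans (≡.cong (λ z → onlyAt z (j ℕ.* x) w̃) (≡.trans (≡.cong (_∸ j) J≡j+jx) (ℕₚ.m+n∸m≡n j (j ℕ.* x))))
                      (onlyAt-≡ (j ℕ.* x) w̃)) ⟩
      natR (J C j) * (w * (natR (orderedBlocks j x) * pow w x))
        ≈⟨ trans (*-congˡ (x∙yz≈y∙xz _ _ _)) (sym (*-assoc _ _ _)) ⟩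
      (natR (J C j) * natR (orderedBlocks j x)) * (w * pow w x)
        ≈⟨ *-congʳ (natR-* (J C j) (orderedBlocks j x)) ⟨
      natR (orderedBlocks j (suc x)) * pow w (suc x)
        ≡⟨ onlyAt-≡ J _ ⟨
      monomial J (natR (orderedBlocks j (suc x)) * pow w (suc x)) J
        ∎
    ... | no i≢J with j ℕ.≤? i
    ...   | no  j≰i = trans (monomial-⊛-> w (monomial (j ℕ.* x) w̃) (ℕₚ.≰⇒> j≰i)) (reflexive (≡.sym (onlyAt-≢ (natR (orderedBlocks j (suc x)) * pow w (suc x)) i≢J)))
    ...   | yes j≤i = begin
      (monomial j w ⊛ monomial (j ℕ.* x) w̃) i         ≈⟨ monomial-⊛-≤ w (monomial (j ℕ.* x) w̃) j≤i ⟩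
      natR (i C j) * (w * onlyAt (i ∸ j) (j ℕ.* x) w̃)  ≡⟨ ≡.cong (λ z → natR (i C j) * (w * z)) (onlyAt-≢ w̃ i∸j≢jx) ⟩
      natR (i C j) * (w * 0#)                          ≈⟨ trans (*-congˡ (zeroʳ w)) (zeroʳ _) ⟩
      0#                                               ≡⟨ onlyAt-≢ (natR (orderedBlocks j (suc x)) * pow w (suc x)) i≢J ⟨
      monomial J _ i                                   ∎
      where
      i∸j≢jx : i ∸ j ≢ j ℕ.* x
      i∸j≢jx e = i≢J (≡.trans (≡.sym (ℕₚ.m+[n∸m]≡n j≤i)) (≡.trans (≡.cong (j ℕ.+_) e) (≡.sym J≡j+jx)))

module BoundedLists where
  open import Data.List using (length; map; replicate; upTo; _++_)
  import Data.List.Properties as Listₚ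
  open import Data.List.Membership.Propositional using (_∈_)
  open import Data.List.Membership.Propositional.Properties using (∈-map⁺; ∈-map⁻; ∈-upTo⁺)
  open import Data.List.Relation.Unary.Any using (here)
  open import Data.List.Relation.Unary.All using (All; []; _∷_)
  open import Data.List.Relation.Unary.AllPairs using ([]; _∷_)
  open import Data.List.Relation.Unary.Unique.Propositional using (Unique)
  import Data.List.Relation.Unary.Unique.Propositional.Properties as Uniqueₚ
  open import Data.Empty using (⊥-elim)
  open import Data.Product using (_,_)
  open ListCombinatorics using (∈-concatMap⁺′; ∈-concatMap⁻′; Unique-concatMap⁺; Unique-map⁺)

  boundedLists-length : ∀ k b {ℓs} → ℓs ∈ boundedLists k b → length ℓs ≡ k
  boundedLists-length zero    b (here ≡.refl) = ≡.refl
  boundedLists-length (suc k) b m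
    with x , _ , m' ← ∈-concatMap⁻′ (λ x → map (x ∷_) (boundedLists k b)) (upTo (suc b)) m
    with ys , mys , ≡.refl ← ∈-map⁻ (x ∷_) m'
    = ≡.cong suc (boundedLists-length k b mys)

  ∈-boundedLists : ∀ {b} xs → All (_≤ b) xs → xs ∈ boundedLists (length xs) b
  ∈-boundedLists     []       []          = here ≡.refl
  ∈-boundedLists {b} (x ∷ xs) (x≤b ∷ xs≤b) =
    ∈-concatMap⁺′ (λ y → map (y ∷_) (boundedLists (length xs) b)) (∈-upTo⁺ (s≤s x≤b)) (∈-map⁺ (x ∷_) (∈-boundedLists xs xs≤b))

  boundedLists-unique : ∀ k b → Unique (boundedLists k b)
  boundedLists-unique zero    b = [] ∷ []
  boundedLists-unique (suc k) b = Unique-concatMap⁺ (λ y → map (y ∷_) (boundedLists k b)) (Uniqueₚ.upTo⁺ (suc b))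
    (λ _ → Unique-map⁺ _ (boundedLists-unique k b) (λ _ _ → Listₚ.∷-injectiveʳ))
    (λ _ _ m₁ m₂ → let (_ , _ , e₁) = ∈-map⁻ _ m₁ ; (_ , _ , e₂) = ∈-map⁻ _ m₂ in Listₚ.∷-injectiveˡ (≡.trans (≡.sym e₁) e₂))

  mult-beyond : ∀ ℓs t → length ℓs ≤ t → mult ℓs (suc t) ≡ 0
  mult-beyond []       t       _        = ≡.refl
  mult-beyond (x ∷ xs) (suc t) (s≤s le) = mult-beyond xs t le

  mult*≤weight : ∀ ℓs j t → (j ℕ.+ t) ℕ.* mult ℓs (suc t) ≤ weightFrom j ℓs
  mult*≤weight []       j t       = ≡.subst (_≤ 0) (≡.sym (ℕₚ.*-zeroʳ (j ℕ.+ t))) z≤n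
  mult*≤weight (x ∷ xs) j zero    = ≡.subst (λ z → z ℕ.* x ≤ weightFrom j (x ∷ xs)) (≡.sym (ℕₚ.+-identityʳ j)) (ℕₚ.m≤m+n (j ℕ.* x) _)
  mult*≤weight (x ∷ xs) j (suc t) = ≡.subst (λ z → z ℕ.* mult xs (suc t) ≤ weightFrom j (x ∷ xs)) (≡.sym (ℕₚ.+-suc j t))
    (ℕₚ.≤-trans (mult*≤weight xs (suc j) t) (ℕₚ.m≤n+m _ (j ℕ.* x)))

  singlePart : ℕ → List ℕ
  singlePart t = replicate t 0 ++ (1 ∷ [])

  singlePart-length : ∀ t → length (singlePart t) ≡ suc t
  singlePart-length zero    = ≡.refl
  singlePart-length (suc t) = ≡.cong suc (singlePart-length t)

  singlePart-weight : ∀ j t → weightFrom j (singlePart t) ≡ j ℕ.+ t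
  singlePart-weight j zero    = ≡.trans (ℕₚ.+-identityʳ (j ℕ.* 1)) (≡.trans (ℕₚ.*-identityʳ j) (≡.sym (ℕₚ.+-identityʳ j)))
  singlePart-weight j (suc t) = ≡.trans (≡.cong₂ ℕ._+_ (ℕₚ.*-zeroʳ j) (singlePart-weight (suc j) t)) (≡.sym (ℕₚ.+-suc j t))

  singlePart-mult : ∀ t → mult (singlePart t) (suc t) ≡ 1
  singlePart-mult zero    = ≡.refl
  singlePart-mult (suc t) = singlePart-mult t

  singlePart-card : ∀ t → card (singlePart t) ≡ 1
  singlePart-card zero    = ≡.refl
  singlePart-card (suc t) = singlePart-card t

  singlePart-denom : ∀ j t → denomFrom j (singlePart t) ≡ (j ℕ.+ t) !
  singlePart-denom j zero    =
    ≡.trans (ℕₚ.*-identityʳ _) (≡.trans (ℕₚ.+-identityʳ _) (≡.trans (ℕₚ.*-identityʳ (j !)) (≡.cong _! (≡.sym (ℕₚ.+-identityʳ j)))))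
  singlePart-denom j (suc t) = ≡.trans (ℕₚ.+-identityʳ _) (≡.trans (singlePart-denom (suc j) t) (≡.cong _! (≡.sym (ℕₚ.+-suc j t))))

  singlePart-∈ : ∀ t → singlePart t ∈ boundedLists (suc t) (suc t)
  singlePart-∈ t = ≡.subst (λ k → singlePart t ∈ boundedLists k (suc t)) (singlePart-length t) (∈-boundedLists (singlePart t) (bounded t ℕₚ.≤-refl))
    where
    bounded : ∀ t' → t' ≤ t → All (_≤ suc t) (singlePart t')
    bounded zero     _   = s≤s z≤n ∷ []
    bounded (suc t') t'< = z≤n ∷ bounded t' (ℕₚ.≤-trans (ℕₚ.n≤1+n t') t'<)

  *+≡⇒≡0 : ∀ a x {w N} → suc a ℕ.* x ℕ.+ w ≡ N → N ≤ w → x ≡ 0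
  *+≡⇒≡0 a zero    _ _   = ≡.refl
  *+≡⇒≡0 a (suc x) e N≤w = ⊥-elim (ℕₚ.<⇒≱ (≡.subst (_ <_) e (ℕₚ.m<n+m _ (s≤s z≤n))) N≤w)

  -- The part at position t already carries the whole weight, so every other multiplicity vanishes.
  singlePart-unique : ∀ ℓs j t → length ℓs ≡ suc t → weightFrom (suc j) ℓs ≡ suc j ℕ.+ t → mult ℓs (suc t) ≡ 1 → ℓs ≡ singlePart t
  singlePart-unique (x ∷ [])      j zero    _   _ ≡.refl = ≡.refl
  singlePart-unique (x ∷ x' ∷ xs) j zero    ()  _ _
  singlePart-unique (x ∷ xs)      j (suc t) len w m = ≡.cong₂ _∷_ x≡0 (singlePart-unique xs (suc j) t (ℕₚ.suc-injective len) w' m)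
    where
    N' = suc (suc j) ℕ.+ t
    rest≥ : N' ≤ weightFrom (suc (suc j)) xs
    rest≥ = ≡.subst (_≤ weightFrom (suc (suc j)) xs) (≡.trans (≡.cong (N' ℕ.*_) m) (ℕₚ.*-identityʳ N')) (mult*≤weight xs (suc (suc j)) t)
    w≡ : suc j ℕ.* x ℕ.+ weightFrom (suc (suc j)) xs ≡ N'
    w≡ = ≡.trans w (ℕₚ.+-suc (suc j) t)
    x≡0 : x ≡ 0
    x≡0 = *+≡⇒≡0 j x w≡ rest≥
    w' : weightFrom (suc (suc j)) xs ≡ suc (suc j) ℕ.+ t
    w' = ≡.trans (≡.sym (≡.cong (ℕ._+ weightFrom (suc (suc j)) xs) (ℕₚ.*-zeroʳ (suc j))))
                 (≡.subst (λ z → suc j ℕ.* z ℕ.+ weightFrom (suc (suc j)) xs ≡ N') x≡0 w≡)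

-- tail W j = 1 + Σ_{i ≥ j} W i aⁱ/i!
module PowersOfTails {c ℓ} (K : CommutativeRing c ℓ) (W : ℕ → CommutativeRing.Carrier K) where
  open import Data.Nat as ℕ using (_<?_)
  open import Data.Nat.ListAction using (sum)
  open import Data.Bool using (if_then_else_)
  open import Data.List using (length; map; upTo; concatMap)
  import Data.List.Properties as Listₚ
  open import Data.List.Membership.Propositional using (_∈_)
  open import Data.List.Membership.Propositional.Properties using (∈-map⁻)
  open import Data.Product using (_,_)
  open import Data.Sum using (inj₁; inj₂)
  open import Relation.Binary using (tri<; tri≈; tri>)
  open import Relation.Nullary using (yes; no; does; ¬_)
  open import Relation.Nullary.Decidable using (dec-true; dec-false)
  open CommutativeRing K
  open Series K
  open Sums K
  open SeriesRing K
  open Bivariate K using (powS-binomial)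
  open Monomials K
  open PartitionCoefficients
  open BoundedLists using (boundedLists-length)
  open import Algebra.Properties.CommutativeSemigroup *-commutativeSemigroup using (x∙yz≈y∙xz)
  open import Relation.Binary.Reasoning.Setoid setoid

  tail : ℕ → Ser
  tail j zero    = 1#
  tail j (suc i) = if does (suc i <? j) then 0# else W (suc i)

  tail-split : ∀ j → 1 ≤ j → tail j ≈S (monomial j (W j) ⊕ tail (suc j))
  tail-split j 1≤j zero = sym (trans (+-congʳ (reflexive (onlyAt-≢ (W j) (λ e → ℕₚ.<-irrefl e 1≤j)))) (+-identityˡ 1#))
  tail-split j 1≤j (suc i) with ℕₚ.<-cmp (suc i) j
  ... | tri< i<j _ _ rewrite dec-true (suc i <? j) i<j | dec-true (suc i <? suc j) (ℕₚ.m≤n⇒m≤1+n i<j) =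
        sym (trans (+-congʳ (reflexive (onlyAt-≢ (W j) (λ e → ℕₚ.<-irrefl e i<j)))) (+-identityˡ 0#))
  ... | tri≈ _ ≡.refl _ rewrite dec-false (suc i <? suc i) (ℕₚ.<-irrefl ≡.refl) | dec-true (suc i <? suc (suc i)) (ℕₚ.n<1+n (suc i)) =
        sym (trans (+-congʳ (reflexive (onlyAt-≡ (suc i) (W (suc i))))) (+-identityʳ _))
  ... | tri> _ _ j<i rewrite dec-false (suc i <? j) (ℕₚ.<⇒≯ j<i) | dec-false (suc i <? suc j) (λ i<1+j → ℕₚ.<⇒≱ j<i (ℕₚ.≤-pred i<1+j)) =
        sym (trans (+-congʳ (reflexive (onlyAt-≢ (W j) (λ e → ℕₚ.<-irrefl (≡.sym e) j<i)))) (+-identityˡ _))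

  -- The x-th term of the binomial expansion of (W j aʲ/j! + tail (j + 1))ᵈ at aˢ.
  tailTerm : ℕ → ℕ → ℕ → ℕ → Carrier
  tailTerm j d s x = if does (j ℕ.* x ≤? s)
    then natR (falling d x ℕ.* blocks j x ℕ.* (s C (j ℕ.* x))) * (pow (W j) x * powS (tail (suc j)) (d ∸ x) (s ∸ j ℕ.* x))
    else 0#

  binomialTerm≈tailTerm : ∀ j' d s x →
    natR (d C x) * (powS (monomial (suc j') (W (suc j'))) x ⊛ powS (tail (suc (suc j'))) (d ∸ x)) s ≈ tailTerm (suc j') d s x
  binomialTerm≈tailTerm j' d s x = begin
    natR (d C x) * (powS (monomial j (W j)) x ⊛ R) s
      ≈⟨ *-congˡ (⊛-cong {B = R} {R} (powS-monomial j (W j) x) (λ _ → refl) s) ⟩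
    natR (d C x) * (monomial (j ℕ.* x) (natR n * w) ⊛ R) s
      ≈⟨ *-congˡ (if-intro (j ℕ.* x ≤? s) (monomial-⊛-≤ _ R) (λ jx≰s → monomial-⊛-> _ R (ℕₚ.≰⇒> jx≰s))) ⟩
    natR a * (if does (j ℕ.* x ≤? s) then natR b * ((natR n * w) * r) else 0#)
      ≈⟨ *-if (j ℕ.* x ≤? s) (natR a) ⟩
    (if does (j ℕ.* x ≤? s) then natR a * (natR b * ((natR n * w) * r)) else 0#)
      ≈⟨ if-cong (j ℕ.* x ≤? s) (λ _ → coefficients) ⟩
    tailTerm j d s x
      ∎
    where
    j = suc j'
    R = powS (tail (suc j)) (d ∸ x)
    w = pow (W j) x
    r = R (s ∸ j ℕ.* x)
    a = d C x
    b = s C (j ℕ.* x)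
    n = orderedBlocks j x
    coefficients : natR a * (natR b * ((natR n * w) * r)) ≈ natR (falling d x ℕ.* blocks j x ℕ.* b) * (w * r)
    coefficients = begin
      natR a * (natR b * ((natR n * w) * r))   ≈⟨ rearrange (natR a) (natR b) (natR n) w r ⟩
      ((natR a * natR b) * natR n) * (w * r)   ≈⟨ *-congʳ (trans (*-congʳ (sym (natR-* a b))) (sym (natR-* (a ℕ.* b) n))) ⟩
      natR (a ℕ.* b ℕ.* n) * (w * r)           ≡⟨ ≡.cong (λ z → natR z * (w * r)) (tail-coeff j' d s x) ⟩
      natR (falling d x ℕ.* blocks j x ℕ.* b) * (w * r) ∎
      where
      open import Algebra.Solver.Ring.NaturalCoefficients.Default commutativeSemiring using (solve; _:*_; _:=_)
      rearrange : ∀ a b n w r → a * (b * ((n * w) * r)) ≈ ((a * b) * n) * (w * r)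
      rearrange = solve 5 (λ a b n w r → a :* (b :* ((n :* w) :* r)) := ((a :* b) :* n) :* (w :* r)) refl

  powS-tail : ∀ j' d s → powS (tail (suc j')) d s ≈ ∑ (suc d) (tailTerm (suc j') d s)
  powS-tail j' d s = begin
    powS (tail j) d s
      ≈⟨ powS-cong (tail-split j (s≤s z≤n)) d s ⟩
    powS (monomial j (W j) ⊕ tail (suc j)) d s
      ≈⟨ powS-binomial (monomial j (W j)) (tail (suc j)) d s ⟩
    ∑ (suc d) (λ x → natR (d C x) * (powS (monomial j (W j)) x ⊛ powS (tail (suc j)) (d ∸ x)) s)
      ≈⟨ ∑-cong (suc d) (binomialTerm≈tailTerm j' d s) ⟩
    ∑ (suc d) (tailTerm j d s)
      ∎
    where j = suc j'

  powersFrom : ℕ → List ℕ → Carrier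
  powersFrom j []       = 1#
  powersFrom j (x ∷ xs) = pow (W j) x * powersFrom (suc j) xs

  -- The contribution of the multiplicities (ℓⱼ, ℓⱼ₊₁, …) to the coefficient of aˢ in (tail j)ᵈ.
  partitionTerm : ℕ → ℕ → ℕ → List ℕ → Carrier
  partitionTerm j d s xs = if does (weightFrom j xs ≟ s) then natR (partitionCoeff j d xs) * powersFrom j xs else 0#

  ≡∸⇒+≡ : ∀ {a w s} → a ≤ s → w ≡ s ∸ a → a ℕ.+ w ≡ s
  ≡∸⇒+≡ a≤s e = ≡.trans (≡.cong (_ ℕ.+_) e) (ℕₚ.m+[n∸m]≡n a≤s)

  partitionTerm-∷ : ∀ j' d s x xs → suc j' ℕ.* x ≤ s →
    partitionTerm (suc j') d s (x ∷ xs) ≈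
    natR (falling d x ℕ.* blocks (suc j') x ℕ.* (s C (suc j' ℕ.* x))) * (pow (W (suc j')) x * partitionTerm (suc (suc j')) (d ∸ x) (s ∸ suc j' ℕ.* x) xs)
  partitionTerm-∷ j' d s x xs jx≤s with weightFrom (suc (suc j')) xs ≟ s ∸ suc j' ℕ.* x
  ... | yes e rewrite dec-true (suc j' ℕ.* x ℕ.+ weightFrom (suc (suc j')) xs ≟ s) (≡∸⇒+≡ jx≤s e)
                    | ≡.cong (_C (suc j' ℕ.* x)) (≡∸⇒+≡ jx≤s e)
                    | dec-true (weightFrom (suc (suc j')) xs ≟ s ∸ suc j' ℕ.* x) e = begin
      natR (cx ℕ.* partitionCoeff (suc j) (d ∸ x) xs) * (w * powersFrom (suc j) xs)
        ≈⟨ *-congʳ (natR-* cx _) ⟩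
      (natR cx * natR (partitionCoeff (suc j) (d ∸ x) xs)) * (w * powersFrom (suc j) xs)
        ≈⟨ trans (*-assoc _ _ _) (*-congˡ (x∙yz≈y∙xz _ _ _)) ⟩
      natR cx * (w * (natR (partitionCoeff (suc j) (d ∸ x) xs) * powersFrom (suc j) xs))
        ∎
    where
    j = suc j'
    cx = falling d x ℕ.* blocks j x ℕ.* (s C (j ℕ.* x))
    w = pow (W j) x
  ... | no ne rewrite dec-false (suc j' ℕ.* x ℕ.+ weightFrom (suc (suc j')) xs ≟ s)
                        (λ e → ne (≡.trans (≡.sym (ℕₚ.m+n∸m≡n (suc j' ℕ.* x) _)) (≡.cong (_∸ (suc j' ℕ.* x)) e)))
                    | dec-false (weightFrom (suc (suc j')) xs ≟ s ∸ suc j' ℕ.* x) ne =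
    sym (trans (*-congˡ (zeroʳ _)) (zeroʳ _))

  partitionTerm-overweight : ∀ j' d s x xs → ¬ (suc j' ℕ.* x ≤ s) → partitionTerm (suc j') d s (x ∷ xs) ≈ 0#
  partitionTerm-overweight j' d s x xs jx≰s
    rewrite dec-false (suc j' ℕ.* x ℕ.+ weightFrom (suc (suc j')) xs ≟ s) (λ e → jx≰s (≡.subst (suc j' ℕ.* x ≤_) e (ℕₚ.m≤m+n _ _))) = refl

  tailTerm-vanishˢ : ∀ j' d s x → s < x → tailTerm (suc j') d s x ≈ 0#
  tailTerm-vanishˢ j' d s x s<x
    rewrite dec-false (suc j' ℕ.* x ≤? s) (λ jx≤s → ℕₚ.<⇒≱ s<x (ℕₚ.≤-trans (ℕₚ.m≤m+n x (j' ℕ.* x)) jx≤s)) = refl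

  tailTerm-vanishᵈ : ∀ j' d s x → d < x → tailTerm (suc j') d s x ≈ 0#
  tailTerm-vanishᵈ j' d s x d<x = if-vanish (suc j' ℕ.* x ≤? s)
    (λ _ → trans (*-congʳ (reflexive (≡.cong (λ z → natR (z ℕ.* blocks (suc j') x ℕ.* (s C (suc j' ℕ.* x)))) (k>n⇒falling≡0 d x d<x)))) (zeroˡ _))

  ∑-tailTerm : ∀ j' d s b → s ≤ b → ∑ (suc b) (tailTerm (suc j') d s) ≈ ∑ (suc d) (tailTerm (suc j') d s)
  ∑-tailTerm j' d s b s≤b = trans (∑-extend (suc s) (suc b) _ (s≤s s≤b) (λ i s<i _ → tailTerm-vanishˢ j' d s i s<i)) cut
    where
    cut : ∑ (suc s) (tailTerm (suc j') d s) ≈ ∑ (suc d) (tailTerm (suc j') d s)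
    cut with ℕₚ.≤-total d s
    ... | inj₁ d≤s = ∑-extend (suc d) (suc s) _ (s≤s d≤s) (λ i d<i _ → tailTerm-vanishᵈ j' d s i d<i)
    ... | inj₂ s≤d = sym (∑-extend (suc s) (suc d) _ (s≤s s≤d) (λ i s<i _ → tailTerm-vanishˢ j' d s i s<i))

  boundedSum : ℕ → ℕ → ℕ → ℕ → ℕ → Carrier
  boundedSum j k b d s = sumL (map (partitionTerm j d s) (boundedLists k b))

  -- Below aʲ the series tail j agrees with 1.
  partitionTerm-[]≈powS-tail : ∀ j' d s → s < suc j' → partitionTerm (suc j') d s [] ≈ powS (tail (suc j')) d s
  partitionTerm-[]≈powS-tail j' d s s<j = begin
    partitionTerm (suc j') d s []   ≈⟨ empty s ⟩
    one s                           ≈⟨ powS-one d s ⟨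
    powS one d s                    ≈⟨ powS-cong≤ s agree d s ℕₚ.≤-refl ⟩
    powS (tail (suc j')) d s        ∎
    where
    empty : ∀ s → partitionTerm (suc j') d s [] ≈ one s
    empty zero    = trans (*-congʳ natR-1) (*-identityˡ 1#)
    empty (suc s) = refl
    agree : ∀ i → i ≤ s → one i ≈ tail (suc j') i
    agree zero    _   = refl
    agree (suc i) i≤s rewrite dec-true (suc i <? suc j') (ℕₚ.≤-<-trans i≤s s<j) = refl

  -- Peeling off the multiplicity of the smallest part is one step of the binomial expansion powS-tail.
  boundedSum≈powS-tail : ∀ k j' b d s → s ≤ b → s < suc j' ℕ.+ k → boundedSum (suc j') k b d s ≈ powS (tail (suc j')) d s
  boundedSum≈powS-tail zero j' b d s s≤b s<j =
    trans (+-identityʳ _) (partitionTerm-[]≈powS-tail j' d s (≡.subst (s <_) (ℕₚ.+-identityʳ (suc j')) s<j))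
  boundedSum≈powS-tail (suc k) j' b d s s≤b s<j = begin
    sumL (map (partitionTerm j d s) (concatMap (λ x → map (x ∷_) (boundedLists k b)) (upTo (suc b))))
      ≈⟨ sumL-concatMap (partitionTerm j d s) (λ x → map (x ∷_) (boundedLists k b)) (upTo (suc b)) ⟩
    sumL (map (λ x → sumL (map (partitionTerm j d s) (map (x ∷_) (boundedLists k b)))) (upTo (suc b)))
      ≡⟨ sumL-upTo (suc b) _ ⟩
    ∑ (suc b) (λ x → sumL (map (partitionTerm j d s) (map (x ∷_) (boundedLists k b))))
      ≈⟨ ∑-cong (suc b) byMultiplicity ⟩
    ∑ (suc b) (tailTerm j d s)   ≈⟨ ∑-tailTerm j' d s b s≤b ⟩
    ∑ (suc d) (tailTerm j d s)   ≈⟨ powS-tail j' d s ⟨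
    powS (tail j) d s            ∎
    where
    j = suc j'
    byMultiplicity : ∀ x → sumL (map (partitionTerm j d s) (map (x ∷_) (boundedLists k b))) ≈ tailTerm j d s x
    byMultiplicity x = if-intro (j ℕ.* x ≤? s) fits overweight
      where
      fits : j ℕ.* x ≤ s → _
      fits jx≤s = begin
        sumL (map (partitionTerm j d s) (map (x ∷_) (boundedLists k b)))
          ≡⟨ sumL-map (partitionTerm j d s) (x ∷_) (boundedLists k b) ⟩
        sumL (map (λ xs → partitionTerm j d s (x ∷ xs)) (boundedLists k b))
          ≈⟨ sumL-cong (boundedLists k b) (λ xs → partitionTerm-∷ j' d s x xs jx≤s) ⟩
        sumL (map (λ xs → cx * (w * partitionTerm (suc j) (d ∸ x) (s ∸ j ℕ.* x) xs)) (boundedLists k b))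
          ≈⟨ trans (sym (sumL-distribˡ cx _ (boundedLists k b))) (*-congˡ (sym (sumL-distribˡ w _ (boundedLists k b)))) ⟩
        cx * (w * boundedSum (suc j) k b (d ∸ x) (s ∸ j ℕ.* x))
          ≈⟨ *-congˡ (*-congˡ (boundedSum≈powS-tail k (suc j') b (d ∸ x) (s ∸ j ℕ.* x) (ℕₚ.≤-trans (ℕₚ.m∸n≤m s (j ℕ.* x)) s≤b)
               (ℕₚ.≤-<-trans (ℕₚ.m∸n≤m s (j ℕ.* x)) (≡.subst (s <_) (ℕₚ.+-suc (suc j') k) s<j)))) ⟩
        cx * (w * powS (tail (suc j)) (d ∸ x) (s ∸ j ℕ.* x))
          ∎
        where
        cx = natR (falling d x ℕ.* blocks j x ℕ.* (s C (j ℕ.* x)))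
        w = pow (W j) x
      overweight : ¬ (j ℕ.* x ≤ s) → _
      overweight jx≰s = sumL-vanish (partitionTerm j d s) (map (x ∷_) (boundedLists k b)) (λ m →
        let (xs , _ , e) = ∈-map⁻ (x ∷_) m in ≡.subst (λ ys → partitionTerm j d s ys ≈ 0#) (≡.sym e) (partitionTerm-overweight j' d s x xs jx≰s))

  prodL-powers : ∀ ℓs t → prodL (map (λ i → pow (W (suc (t ℕ.+ i))) (mult ℓs (suc i))) (upTo (length ℓs))) ≈ powersFrom (suc t) ℓs
  prodL-powers []       t = refl
  prodL-powers (x ∷ xs) t = *-cong (reflexive (≡.cong (λ z → pow (W (suc z)) x) (ℕₚ.+-identityʳ t)))
    (trans (reflexive (≡.cong prodL (≡.trans (≡.cong (map g) (≡.sym (Listₚ.map-upTo suc (length xs))))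
                 (≡.trans (≡.sym (Listₚ.map-∘ (upTo (length xs))))
                          (Listₚ.map-cong (λ i → ≡.cong (λ z → pow (W (suc z)) (mult xs (suc i))) (ℕₚ.+-suc t i)) (upTo (length xs)))))))
           (prodL-powers xs (suc t)))
    where
    g : ℕ → Carrier
    g i = pow (W (suc (t ℕ.+ i))) (mult (x ∷ xs) (suc i))

  partitionSummand : ℕ → ℕ → List ℕ → Carrier
  partitionSummand d s ℓs = natR (falling d (card ℓs) ℕ.* divN (s !) (denomFrom 1 ℓs)) * prodL (map (λ j → pow (W j) (mult ℓs j)) (map suc (upTo s)))

  powS-tail-partitions : ∀ d s → powS (tail 1) d s ≈ sumL (map (partitionSummand d s) (partitions s))
  powS-tail-partitions d s = begin
    powS (tail 1) d s
      ≈⟨ boundedSum≈powS-tail s 0 s d s ℕₚ.≤-refl (ℕₚ.n<1+n s) ⟨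
    sumL (map (partitionTerm 1 d s) (boundedLists s s))
      ≈⟨ sumL-cong∈ (boundedLists s s) termwise ⟩
    sumL (map (λ ℓs → if does (weight ℓs ≟ s) then partitionSummand d s ℓs else 0#) (boundedLists s s))
      ≈⟨ sumL-filter (λ ℓs → weight ℓs ≟ s) (partitionSummand d s) (boundedLists s s) ⟨
    sumL (map (partitionSummand d s) (partitions s))
      ∎
    where
    termwise : ∀ {ℓs} → ℓs ∈ boundedLists s s → partitionTerm 1 d s ℓs ≈ (if does (weight ℓs ≟ s) then partitionSummand d s ℓs else 0#)
    termwise {ℓs} m = if-cong (weight ℓs ≟ s) (λ e → *-cong
      (reflexive (≡.cong natR (≡.sym (≡.subst (λ z → falling d (sum ℓs) ℕ.* divN (z !) (denomFrom 1 ℓs) ≡ partitionCoeff 1 d ℓs) e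
                                                (falling*divN≡partitionCoeff d ℓs)))))
      (sym (trans (reflexive (≡.cong prodL (≡.trans (≡.sym (Listₚ.map-∘ (upTo s)))
                    (≡.cong (λ z → map (λ i → pow (W (suc i)) (mult ℓs (suc i))) (upTo z)) (≡.sym (boundedLists-length s s m))))))
                  (prodL-powers ℓs 0))))

module SinglePartSum {c ℓ} (K : CommutativeRing c ℓ) (W : ℕ → CommutativeRing.Carrier K) where
  open import Data.Nat.DivMod using (n/n≡1)
  open import Data.Bool using (if_then_else_)
  open import Data.List using (map; upTo; filter)
  import Data.List.Properties as Listₚ
  open import Data.List.Membership.Propositional using (_∈_)
  open import Data.Empty using (⊥-elim)
  open import Relation.Nullary.Decidable using (dec-true)
  open import Relation.Nullary using (does)
  open CommutativeRing K
  open Series K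
  open Sums K
  open Monomials K using (if-intro; if-vanish)
  open PartitionCoefficients using (divN≡/)
  open BoundedLists
  open PowersOfTails K W using (powersFrom; prodL-powers; partitionSummand)
  open import Relation.Binary.Reasoning.Setoid setoid

  powersFrom-singlePart : ∀ j t → powersFrom j (singlePart t) ≈ W (j ℕ.+ t)
  powersFrom-singlePart j zero    = trans (*-identityʳ _) (trans (*-identityʳ _) (reflexive (≡.cong W (≡.sym (ℕₚ.+-identityʳ j)))))
  powersFrom-singlePart j (suc t) = trans (*-identityˡ _) (trans (powersFrom-singlePart (suc j) t) (reflexive (≡.cong W (≡.sym (ℕₚ.+-suc j t)))))

  partitionSummand-singlePart : ∀ d t → partitionSummand d (suc t) (singlePart t) ≈ natR d * W (suc t)
  partitionSummand-singlePart d t = *-cong (reflexive (≡.cong natR coeff≡d)) product≡W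
    where
    coeff≡d : falling d (card (singlePart t)) ℕ.* divN (suc t !) (denomFrom 1 (singlePart t)) ≡ d
    coeff≡d = ≡.trans (≡.cong₂ (λ a b → falling d a ℕ.* divN (suc t !) b) (singlePart-card t) (singlePart-denom 1 t))
              (≡.trans (≡.cong (falling d 1 ℕ.*_) (≡.trans (divN≡/ (suc t !) (suc t !) {{ℕₚ._!≢0 (suc t)}})
                                                           (n/n≡1 (suc t !) {{ℕₚ._!≢0 (suc t)}})))
                       (≡.trans (ℕₚ.*-identityʳ _) (ℕₚ.*-identityʳ _)))
    product≡W : prodL (map (λ j → pow (W j) (mult (singlePart t) j)) (map suc (upTo (suc t)))) ≈ W (suc t)
    product≡W = trans (reflexive (≡.cong prodL (≡.trans (≡.sym (Listₚ.map-∘ (upTo (suc t))))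
                        (≡.cong (λ z → map (λ i → pow (W (suc i)) (mult (singlePart t) (suc i))) (upTo z)) (≡.sym (singlePart-length t))))))
                      (trans (prodL-powers (singlePart t) 0) (powersFrom-singlePart 1 t))

  -- Among the partitions of s ≤ t + 1, only the single part t + 1 has ℓ_{t+1} = 1.
  sum-mult≡1 : ∀ d t s → s ≤ suc t →
    sumL (map (partitionSummand d s) (filter (λ ℓs → mult ℓs (suc t) ≟ 1) (partitions s))) ≈
    (if does (s ≟ suc t) then natR d * W (suc t) else 0#)
  sum-mult≡1 d t s s≤r = begin
    sumL (map (partitionSummand d s) (filter (λ ℓs → mult ℓs r ≟ 1) (partitions s)))
      ≈⟨ sumL-filter (λ ℓs → mult ℓs r ≟ 1) (partitionSummand d s) (partitions s) ⟩
    sumL (map (withMult s) (partitions s))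
      ≈⟨ sumL-filter (λ ℓs → weight ℓs ≟ s) (withMult s) (boundedLists s s) ⟩
    sumL (map (withWeight s) (boundedLists s s))
      ≈⟨ if-intro (s ≟ r) (λ { ≡.refl → single }) none ⟩
    (if does (s ≟ r) then natR d * W r else 0#)
      ∎
    where
    r = suc t
    withMult withWeight : ℕ → List ℕ → Carrier
    withMult   s ℓs = if does (mult ℓs r ≟ 1) then partitionSummand d s ℓs else 0#
    withWeight s ℓs = if does (weight ℓs ≟ s) then withMult s ℓs else 0#
    single : sumL (map (withWeight r) (boundedLists r r)) ≈ natR d * W r
    single = trans (sumL-single (withWeight r) (boundedLists-unique r r) (singlePart-∈ t) others) atSinglePart
      where
      others : ∀ {ℓs} → ℓs ∈ boundedLists r r → ℓs ≢ singlePart t → withWeight r ℓs ≈ 0#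
      others {ℓs} m ℓs≢ = if-vanish (weight ℓs ≟ r) (λ w → if-vanish (mult ℓs r ≟ 1) (λ ℓr≡1 →
        ⊥-elim (ℓs≢ (singlePart-unique ℓs 0 t (boundedLists-length r r m) w ℓr≡1))))
      atSinglePart : withWeight r (singlePart t) ≈ natR d * W r
      atSinglePart rewrite dec-true (weight (singlePart t) ≟ r) (singlePart-weight 1 t)
                         | dec-true (mult (singlePart t) r ≟ 1) (singlePart-mult t) = partitionSummand-singlePart d t
    none : s ≢ r → sumL (map (withWeight s) (boundedLists s s)) ≈ 0#
    none s≢r = sumL-vanish (withWeight s) (boundedLists s s) (λ {ℓs} m → if-vanish (weight ℓs ≟ s) (λ _ → if-vanish (mult ℓs r ≟ 1) (λ ℓr≡1 →
      ⊥-elim (ℕₚ.1+n≢0 (≡.trans (≡.sym ℓr≡1)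
        (mult-beyond ℓs t (≡.subst (_≤ t) (≡.sym (boundedLists-length s s m)) (ℕₚ.≤-pred (ℕₚ.≤∧≢⇒< s≤r s≢r)))))))))

module Derivatives {c ℓ} (R : CommutativeRing c ℓ) (d : ℕ)
                   (f : DTree d → CommutativeRing.Carrier R) (μ : CommutativeRing.Carrier R)
                   (enum : ℕ → List (DTree d)) (isE : IsEnumeration enum)
                   (V : ℕ → CommutativeRing.Carrier R)
                   (V*Z≈1 : Series._≈S_ R (Series._⊛_ R V (Main.Z R d f μ enum)) (Series.one R)) where
  open import Data.Nat.Combinatorics using (nCn≡1)
  open import Data.Bool using (if_then_else_)
  open import Relation.Nullary using (does; ¬?)
  open import Relation.Nullary.Decidable using (dec-true; dec-false)
  open CommutativeRing R
  open Series R
  open Sums R using (natR-1)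
  open SeriesRing R
  open Bivariate R
  open Main R d f μ enum
  open RootRecursion R d f μ enum isE using (Zs; deriv-Z; binomialCoeff; deriv-Zr)
  module S = CommutativeRing seriesRing
  module ΣS = Sums seriesRing
  open import Relation.Binary.Reasoning.Setoid S.setoid
  open import Algebra.Solver.Ring.NaturalCoefficients.Default S.commutativeSemiring using (solve; _:+_; _:*_; _:=_; con)
  open import Algebra.Properties.Ring S.ring using (-‿distribˡ-*; -‿distribʳ-*)
  open import Algebra.Properties.AbelianGroup S.+-abelianGroup using (⁻¹-∙-comm; ε⁻¹≈ε)
  open import Algebra.Properties.Group S.+-group using (inverseˡ-unique)

  natS : ℕ → Ser
  natS = S₂.natR

  deriv-V : deriv V ≈S neg ((V ⊛ powS Z d) ⊛ V)
  deriv-V = begin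
    deriv V                    ≈⟨ S.*-identityʳ (deriv V) ⟨
    deriv V ⊛ one              ≈⟨ S.*-congˡ (S.trans (S.*-comm Z V) V*Z≈1) ⟨
    deriv V ⊛ (Z ⊛ V)          ≈⟨ S.*-assoc (deriv V) Z V ⟨
    (deriv V ⊛ Z) ⊛ V          ≈⟨ S.*-congʳ (inverseˡ-unique (deriv V ⊛ Z) (V ⊛ deriv Z) (λ n → trans (sym (leibniz V Z n)) (V*Z≈1 (suc n)))) ⟩
    neg (V ⊛ deriv Z) ⊛ V      ≈⟨ S.*-congʳ (S.-‿cong (S.*-congˡ deriv-Z)) ⟩
    neg (V ⊛ powS Z d) ⊛ V     ≈⟨ -‿distribˡ-* (V ⊛ powS Z d) V ⟨
    neg ((V ⊛ powS Z d) ⊛ V)   ∎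

  deriv-powS-V : ∀ k → deriv (powS V k) ≈S neg (natS k ⊛ (powS V (suc k) ⊛ powS Z d))
  deriv-powS-V zero    = S.sym (S.trans (S.-‿cong (S.zeroˡ _)) ε⁻¹≈ε)
  deriv-powS-V (suc k) = begin
    deriv (V ⊛ Vᵏ)
      ≈⟨ leibniz V Vᵏ ⟩
    (deriv V ⊛ Vᵏ) ⊕ (V ⊛ deriv Vᵏ)
      ≈⟨ S.+-cong (S.*-congʳ deriv-V) (S.*-congˡ (deriv-powS-V k)) ⟩
    (neg ((V ⊛ Zᵈ) ⊛ V) ⊛ Vᵏ) ⊕ (V ⊛ neg (natS k ⊛ ((V ⊛ Vᵏ) ⊛ Zᵈ)))
      ≈⟨ S.+-cong (-‿distribˡ-* _ _) (-‿distribʳ-* _ _) ⟨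
    neg (((V ⊛ Zᵈ) ⊛ V) ⊛ Vᵏ) ⊕ neg (V ⊛ (natS k ⊛ ((V ⊛ Vᵏ) ⊛ Zᵈ)))
      ≈⟨ ⁻¹-∙-comm _ _ ⟩
    neg ((((V ⊛ Zᵈ) ⊛ V) ⊛ Vᵏ) ⊕ (V ⊛ (natS k ⊛ ((V ⊛ Vᵏ) ⊛ Zᵈ))))
      ≈⟨ S.-‿cong (solve 4 (λ v z w k → (((v :* z) :* v) :* w :+ v :* (k :* ((v :* w) :* z))) := ((con 1 :+ k) :* ((v :* (v :* w)) :* z))) S.refl V Zᵈ Vᵏ (natS k)) ⟩
    neg (natS (suc k) ⊛ ((V ⊛ (V ⊛ Vᵏ)) ⊛ Zᵈ))
      ∎
    where
    Zᵈ = powS Z d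
    Vᵏ = powS V k

  powS-V*powS-Z : ∀ k → (powS V k ⊛ powS Z k) ≈S one
  powS-V*powS-Z zero    = S.*-identityˡ one
  powS-V*powS-Z (suc k) = begin
    (V ⊛ powS V k) ⊛ (Z ⊛ powS Z k)   ≈⟨ solve 4 (λ v vk z zk → (v :* vk) :* (z :* zk) := (v :* z) :* (vk :* zk)) S.refl V (powS V k) Z (powS Z k) ⟩
    (V ⊛ Z) ⊛ (powS V k ⊛ powS Z k)   ≈⟨ S.*-cong V*Z≈1 (powS-V*powS-Z k) ⟩
    one ⊛ one                         ≈⟨ S.*-identityˡ one ⟩
    one                               ∎

  -- W j = Z⁽ʲ⁾/Z
  W : ℕ → Ser
  W j = Zr j ⊛ V

  deriv-Vᵈ*Zr : ∀ r → (deriv (powS V d) ⊛ Zr r) ≈S neg (natS d ⊛ W r)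
  deriv-Vᵈ*Zr r = begin
    deriv (powS V d) ⊛ Zr r
      ≈⟨ S.*-congʳ (deriv-powS-V d) ⟩
    neg (natS d ⊛ ((V ⊛ powS V d) ⊛ powS Z d)) ⊛ Zr r
      ≈⟨ -‿distribˡ-* _ _ ⟨
    neg ((natS d ⊛ ((V ⊛ powS V d) ⊛ powS Z d)) ⊛ Zr r)
      ≈⟨ S.-‿cong (S.*-congʳ (S.*-congˡ (S.trans (S.*-assoc V (powS V d) (powS Z d)) (S.trans (S.*-congˡ (powS-V*powS-Z d)) (S.*-identityʳ V))))) ⟩
    neg ((natS d ⊛ V) ⊛ Zr r)
      ≈⟨ S.-‿cong (S.trans (S.*-assoc (natS d) V (Zr r)) (S.*-congˡ (S.*-comm V (Zr r)))) ⟩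
    neg (natS d ⊛ W r)
      ∎

  tail1≈W : ∀ s → PowersOfTails.tail seriesRing W 1 s ≈S W s
  tail1≈W zero    = S.sym (S.trans (S.*-comm Z V) V*Z≈1)
  tail1≈W (suc i) = S.refl

  partitionSummand≈partTerm : ∀ s ℓs → PowersOfTails.partitionSummand seriesRing W d s ℓs ≈S partTerm V s ℓs
  partitionSummand≈partTerm s ℓs =
    S.trans (S.*-congˡ (prodL≈prodS (map suc (upTo s))))
            (natR₂-⊛ (falling d (card ℓs) ℕ.* divN (s !) (denomFrom 1 ℓs)) (prodS (map (λ j → powS (W j) (mult ℓs j)) (map suc (upTo s)))))
    where
    prodL≈prodS : ∀ (L : List ℕ) → S₂.prodL (map (λ j → S₂.pow (W j) (mult ℓs j)) L) ≈S prodS (map (λ j → powS (W j) (mult ℓs j)) L)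
    prodL≈prodS []      = S.refl
    prodL≈prodS (j ∷ L) = S.*-cong (pow₂≈powS (W j) (mult ℓs j)) (prodL≈prodS L)

  restricted : ℕ → ℕ → Ser
  restricted r s = sumS (map (partTerm V s) (filter (λ ℓs → ¬? (mult ℓs r ≟ 1)) (partitions s)))

  singleTerm : ℕ → ℕ → Ser
  singleTerm r s = if does (s ≟ r) then natS d ⊛ W r else zeroS

  powS-W : ∀ t s → s ≤ suc t → S₂.powS W d s ≈S (restricted (suc t) s ⊕ singleTerm (suc t) s)
  powS-W t s s≤r = begin
    S₂.powS W d s
      ≈⟨ R₂.powS-cong tail1≈W d s ⟨
    S₂.powS (PowersOfTails.tail seriesRing W 1) d s
      ≈⟨ PowersOfTails.powS-tail-partitions seriesRing W d s ⟩
    S₂.sumL (map summand (partitions s))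
      ≈⟨ ΣS.sumL-partition (λ ℓs → mult ℓs r ≟ 1) summand (partitions s) ⟩
    S₂.sumL (map summand (filter (λ ℓs → ¬? (mult ℓs r ≟ 1)) (partitions s))) ⊕ S₂.sumL (map summand (filter (λ ℓs → mult ℓs r ≟ 1) (partitions s)))
      ≈⟨ S.+-cong (ΣS.sumL-cong (filter (λ ℓs → ¬? (mult ℓs r ≟ 1)) (partitions s)) (partitionSummand≈partTerm s))
                  (SinglePartSum.sum-mult≡1 seriesRing W d t s s≤r) ⟩
    restricted r s ⊕ singleTerm r s
      ∎
    where
    r = suc t
    summand = PowersOfTails.partitionSummand seriesRing W d s

  module _ (t : ℕ) where
    r = suc t

    ∑-singleTerm : ΣS.∑ (suc r) (λ s → scale (binomialCoeff r s) (singleTerm r s)) ≈S (natS d ⊛ W r)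
    ∑-singleTerm = begin
      ΣS.∑ (suc r) (λ s → scale (binomialCoeff r s) (singleTerm r s))
        ≈⟨ ΣS.∑-last r _ ⟩
      ΣS.∑ r (λ s → scale (binomialCoeff r s) (singleTerm r s)) ⊕ scale (binomialCoeff r r) (singleTerm r r)
        ≈⟨ S.+-cong (ΣS.∑-vanish< r _ (λ s s<r n → trans (*-congˡ (offDiagonal s<r n)) (zeroʳ _))) diagonal ⟩
      zeroS ⊕ (natS d ⊛ W r)
        ≈⟨ S.+-identityˡ _ ⟩
      natS d ⊛ W r
        ∎
      where
      offDiagonal : ∀ {s} → s < r → singleTerm r s ≈S zeroS
      offDiagonal {s} s<r n = reflexive (≡.cong (λ b → (if b then natS d ⊛ W r else zeroS) n) (dec-false (s ≟ r) (ℕₚ.<⇒≢ s<r)))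
      binomialCoeff-r : binomialCoeff r r ≈ 1#
      binomialCoeff-r = trans (*-cong (reflexive (≡.cong natR (nCn≡1 r))) (reflexive (≡.cong (pow (- μ)) (ℕₚ.n∸n≡0 r))))
                              (trans (*-congʳ natR-1) (*-identityˡ 1#))
      diagonal : scale (binomialCoeff r r) (singleTerm r r) ≈S (natS d ⊛ W r)
      diagonal n = trans (*-congˡ (reflexive (≡.cong (λ b → (if b then natS d ⊛ W r else zeroS) n) (dec-true (r ≟ r) ≡.refl))))
                         (trans (*-congʳ binomialCoeff-r) (*-identityˡ _))

    Vᵈ*∑ : (powS V d ⊛ ΣS.∑ (suc r) (λ s → scale (binomialCoeff r s) (S₂.powS Zs d s))) ≈S
           (ΣS.∑ (suc r) (λ s → scale (binomialCoeff r s) (restricted r s)) ⊕ (natS d ⊛ W r))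
    Vᵈ*∑ = begin
      powS V d ⊛ ΣS.∑ (suc r) (λ s → scale (binomialCoeff r s) (S₂.powS Zs d s))
        ≈⟨ ΣS.∑-distribˡ (suc r) (powS V d) _ ⟩
      ΣS.∑ (suc r) (λ s → powS V d ⊛ scale (binomialCoeff r s) (S₂.powS Zs d s))
        ≈⟨ ΣS.∑-cong< (suc r) (λ s s≤r →
             S.trans (scale-⊛ʳ (binomialCoeff r s) (powS V d) (S₂.powS Zs d s))
             (S.trans (scale-cong (binomialCoeff r s) (S.sym (powS₂-scale Zs V d s)))
             (S.trans (scale-cong (binomialCoeff r s) (powS-W t s (ℕₚ.≤-pred s≤r)))
                      (λ n → distribˡ (binomialCoeff r s) _ _)))) ⟩
      ΣS.∑ (suc r) (λ s → scale (binomialCoeff r s) (restricted r s) ⊕ scale (binomialCoeff r s) (singleTerm r s))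
        ≈⟨ ΣS.∑-+ (suc r) _ _ ⟩
      ΣS.∑ (suc r) (λ s → scale (binomialCoeff r s) (restricted r s)) ⊕ ΣS.∑ (suc r) (λ s → scale (binomialCoeff r s) (singleTerm r s))
        ≈⟨ S.+-congˡ ∑-singleTerm ⟩
      ΣS.∑ (suc r) (λ s → scale (binomialCoeff r s) (restricted r s)) ⊕ (natS d ⊛ W r)
        ∎

    LHS≈RHS : LHS V r ≈S RHS V r
    LHS≈RHS = begin
      deriv (powS V d ⊛ Zr r)
        ≈⟨ leibniz (powS V d) (Zr r) ⟩
      (deriv (powS V d) ⊛ Zr r) ⊕ (powS V d ⊛ deriv (Zr r))
        ≈⟨ S.+-cong (deriv-Vᵈ*Zr r) (S.*-congˡ (deriv-Zr r)) ⟩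
      neg (natS d ⊛ W r) ⊕ (powS V d ⊛ (neg (H r) ⊕ ΣS.∑ (suc r) (λ s → scale (binomialCoeff r s) (S₂.powS Zs d s))))
        ≈⟨ S.+-congˡ (S.distribˡ (powS V d) _ _) ⟩
      neg (natS d ⊛ W r) ⊕ ((powS V d ⊛ neg (H r)) ⊕ (powS V d ⊛ ΣS.∑ (suc r) (λ s → scale (binomialCoeff r s) (S₂.powS Zs d s))))
        ≈⟨ S.+-congˡ (S.+-cong (S.sym (-‿distribʳ-* (powS V d) (H r))) Vᵈ*∑) ⟩
      neg (natS d ⊛ W r) ⊕ (neg (powS V d ⊛ H r) ⊕ (∑restricted ⊕ (natS d ⊛ W r)))
        ≈⟨ cancel _ _ _ ⟩
      neg (powS V d ⊛ H r) ⊕ ∑restricted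
        ≡⟨ ≡.cong (neg (powS V d ⊛ H r) ⊕_) (ΣS.sumL-upTo (suc r) (λ s → scale (binomialCoeff r s) (restricted r s))) ⟨
      RHS V r
        ∎
      where
      ∑restricted = ΣS.∑ (suc r) (λ s → scale (binomialCoeff r s) (restricted r s))
      cancel : ∀ a b c → (neg a ⊕ (b ⊕ (c ⊕ a))) ≈S (b ⊕ c)
      cancel a b c = begin
        neg a ⊕ (b ⊕ (c ⊕ a))   ≈⟨ S.+-congˡ (S.+-assoc b c a) ⟨
        neg a ⊕ ((b ⊕ c) ⊕ a)   ≈⟨ S.+-comm _ _ ⟩
        ((b ⊕ c) ⊕ a) ⊕ neg a   ≈⟨ S.+-assoc _ _ _ ⟩
        (b ⊕ c) ⊕ (a ⊕ neg a)   ≈⟨ S.+-congˡ (S.-‿inverseʳ a) ⟩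
        (b ⊕ c) ⊕ zeroS         ≈⟨ S.+-identityʳ _ ⟩
        b ⊕ c                   ∎

lemma1 : ∀ {c ℓ} (R : CommutativeRing c ℓ) (d : ℕ) → 2 ≤ d →
         (f : DTree d → CommutativeRing.Carrier R)
         (μ : CommutativeRing.Carrier R)
         (enum : ℕ → List (DTree d)) → IsEnumeration enum →
         (V : ℕ → CommutativeRing.Carrier R) →
         Series._≈S_ R (Series._⊛_ R V (Main.Z R d f μ enum)) (Series.one R) →
         (r : ℕ) → 1 ≤ r →
         Series._≈S_ R (Main.LHS R d f μ enum V r) (Main.RHS R d f μ enum V r)
lemma1 R d _ f μ enum isE V V*Z≈1 (suc t) _ = Derivatives.LHS≈RHS R d f μ enum isE V V*Z≈1 t
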